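{- The elements $\phi_\sigma$ (over all permutations $\sigma$ of $[n]$, all $n\ge0$) span a subalgebra $\Phi\mathbf{Sym}$ of $\mathbb K\langle a_{i\,j}\mid i,j\ge1\rangle$. More precisely, for all permutations $\alpha,\beta$, $$\phi_\alpha\phi_\beta=\sum_\sigma g^\sigma_{\alpha,\beta}\,\phi_\sigma\quad\text{with } g^\sigma_{\alpha,\beta}\in\{0,1\}.$$ Moreover $\Phi\mathbf{Sym}$ is free as an associative algebra over the set $\{\phi_\alpha\mid\alpha\text{ connected}\}$.
   Context: Let $\mathbb K$ be a field of characteristic zero and $\{a_{i\,j}\mid i,j\ge1\}$ non-commuting indeterminates. For words $x=x_1\cdots x_n$, $a=a_1\cdots a_n$ of positive integers write the biword $\binom{x}{a}=a_{x_1\,a_1}a_{x_2\,a_2}\cdots a_{x_n\,a_n}$. The standardization $\mathrm{Std}(w)$ of a word $w$ is the permutation obtained by numbering its letters in increasing order, equal letters numbered from left to right. A cycle $(c_1c_2\cdots c_k)$ of a permutation sends $c_1\mapsto c_2\mapsto\cdots\mapsto c_k\mapsto c_1$; its cycle words are the words $c_jc_{j+1}\cdots c_kc_1\cdots c_{j-1}$ ($1\le j\le k$). For $\sigma\in\mathfrak S_n$ define $\phi_\sigma=\sum\binom{x}{a}$, the sum over all pairs of words $x,a$ of length $n$ over positive integers such that (i) $x_i=x_j$ iff $i$ and $j$ belong to the same cycle of $\sigma$, and (ii) for each cycle $c$ of $\sigma$ with support $\{p_1<\cdots<p_k\}$, letting $\tilde c$ be the cycle on $[k]$ obtained by replacing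 each $p_r$ by $r$, the inverse permutation $\mathrm{Std}(a_{p_1}\cdots a_{p_k})^{ -1}$, written as a word, is a cycle word of $\tilde c$. For $n=0$, $\phi_\emptyset=1$. A permutation $\sigma\in\mathfrak S_n$, $n\ge1$, is connected if $\sigma([1,k])\ne[1,k]$ for all $1\le k\le n-1$. -}

module Defs where

open import Level using (Level; suc; _⊔_)
open import Data.Bool.ListAction using (all; any)
open import Data.Bool using (Bool; true; false; _∧_; _∨_; not; if_then_else_; T)
open import Data.Nat using (ℕ; zero; _<ᵇ_; _≡ᵇ_; _<_; _≤_) renaming (suc to 1+)
open import Data.List using (List; []; _∷_; map; length; filter; upTo; foldr; _++_; concatMap)
open import Data.Product using (Σ; _×_; _,_; proj₁; proj₂; ∃)
open import Relation.Nullary using (¬_)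
open import Relation.Binary.PropositionalEquality using (_≡_)
open import Function.Bundles using (_⇔_)
open import Algebra.Bundles using (CommutativeRing)

natR : ∀ {c ℓ} (R : CommutativeRing c ℓ) → ℕ → CommutativeRing.Carrier R
natR R zero   = CommutativeRing.0# R
natR R (1+ n) = CommutativeRing._+_ R (CommutativeRing.1# R) (natR R n)

record CharZeroField (c ℓ : Level) : Set (Level.suc (c ⊔ ℓ)) where
  field
    cring : CommutativeRing c ℓ
  open CommutativeRing cring public
  field
    0≉1     : ¬ (0# ≈ 1#)
    inverse : ∀ x → ¬ (x ≈ 0#) → Σ Carrier (λ y → x * y ≈ 1#)
    char0   : ∀ n → ¬ (natR cring (1+ n) ≈ 0#)

-- Permutations of [n], represented 0-based:
-- the list [σ(0), …, σ(n-1)] of images, values in {0,…,n-1}, no repetition.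

memB : ℕ → List ℕ → Bool
memB x = any (λ y → x ≡ᵇ y)

noDupB : List ℕ → Bool
noDupB []       = true
noDupB (x ∷ xs) = not (memB x xs) ∧ noDupB xs

isPermB : ℕ → List ℕ → Bool
isPermB n l = (length l ≡ᵇ n) ∧ (all (λ v → v <ᵇ n) l ∧ noDupB l)

record Perm (n : ℕ) : Set where
  constructor perm
  field
    images : List ℕ
    valid  : T (isPermB n images)
open Perm public

at : List ℕ → ℕ → ℕ
at []       _      = 0
at (x ∷ _)  zero   = x
at (_ ∷ xs) (1+ i) = at xs i

app : ∀ {n} → Perm n → ℕ → ℕ
app σ i = at (images σ) i

AnyPerm : Set
AnyPerm = Σ ℕ Perm

-- connected: σ([0,k)) ≠ [0,k) for all 1 ≤ k ≤ n-1 (0-based version of σ([1,k]) ≠ [1,k])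
Connected : ∀ {n} → Perm n → Set
Connected {n} σ = (1 ≤ n) ×
  (∀ k → 1 ≤ k → k < n →
     ¬ (∀ j → (j < k) ⇔ (Σ ℕ (λ i → (i < k) × (app σ i ≡ j)))))

count : (ℕ → Bool) → List ℕ → ℕ
count p []       = 0
count p (x ∷ xs) = if p x then 1+ (count p xs) else count p xs

indexOf : ℕ → List ℕ → ℕ
indexOf x []       = 0
indexOf x (y ∷ ys) = if x ≡ᵇ y then 0 else 1+ (indexOf x ys)

listEqB : List ℕ → List ℕ → Bool
listEqB []       []       = true
listEqB (x ∷ xs) (y ∷ ys) = (x ≡ᵇ y) ∧ listEqB xs ys
listEqB _        _        = false

orbit : (ℕ → ℕ) → ℕ → ℕ → List ℕ
orbit f s zero   = []
orbit f s (1+ k) = s ∷ orbit f (f s) k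

std : List ℕ → List ℕ
std w = map (λ i → count (λ j → at w j <ᵇ at w i) idx
                 + count (λ j → (j <ᵇ i) ∧ (at w j ≡ᵇ at w i)) idx) idx
  where
    open Data.Nat using (_+_)
    idx = upTo (length w)

stdInv : List ℕ → List ℕ
stdInv w = map (λ r → indexOf r (std w)) (upTo (length w))

module _ {n : ℕ} (σ : Perm n) where
  sameCycle : ℕ → ℕ → Bool
  sameCycle i j = memB j (orbit (app σ) i n)

  support : ℕ → List ℕ
  support p = filter (λ q → Data.Bool.T? (sameCycle p q)) (upTo n)
    where import Data.Bool

  cycleCond : List ℕ → ℕ → Bool
  cycleCond a p = any (λ s → listEqB w (orbit ct s k)) (upTo k)
    where
      ps = support p
      k  = length ps
      ct : ℕ → ℕ
      ct r = indexOf (app σ (at ps r)) ps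
      w  = stdInv (map (at a) ps)

  phiCond : List ℕ → List ℕ → Bool
  phiCond x a = (length x ≡ᵇ n) ∧ ((length a ≡ᵇ n) ∧
     (all (λ i → all (λ j → eqB (at x i ≡ᵇ at x j) (sameCycle i j)) (upTo n)) (upTo n)
      ∧ all (cycleCond a) (upTo n)))
    where
      eqB : Bool → Bool → Bool
      eqB true  b = b
      eqB false b = not b

-- Formal power series in the non-commuting variables a_{i j}.
-- The letter (i , j) : ℕ × ℕ stands for a_{i+1 j+1}; a monomial is a word
-- of letters; a series is its coefficient function.

Letter : Set
Letter = ℕ × ℕ

Monomial : Set
Monomial = List Letter

module Series {c ℓ} (K : CharZeroField c ℓ) where
  open CharZeroField K

  Ser : Set c
  Ser = Monomial → Carrier

  _≈ˢ_ : Ser → Ser → Set ℓ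
  f ≈ˢ g = ∀ m → f m ≈ g m

  0ˢ : Ser
  0ˢ _ = 0#

  1ˢ : Ser
  1ˢ []      = 1#
  1ˢ (_ ∷ _) = 0#

  _+ˢ_ : Ser → Ser → Ser
  (f +ˢ g) m = f m + g m

  _·ˢ_ : Carrier → Ser → Ser
  (k ·ˢ f) m = k * f m

  splits : Monomial → List (Monomial × Monomial)
  splits []       = ([] , []) ∷ []
  splits (l ∷ m)  = ([] , l ∷ m) ∷ map (λ uv → (l ∷ proj₁ uv , proj₂ uv)) (splits m)

  sumK : List Carrier → Carrier
  sumK = foldr _+_ 0#

  _*ˢ_ : Ser → Ser → Ser
  (f *ˢ g) m = sumK (map (λ uv → f (proj₁ uv) * g (proj₂ uv)) (splits m))

  sumˢ : List Ser → Ser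
  sumˢ = foldr _+ˢ_ 0ˢ

  prodˢ : List Ser → Ser
  prodˢ = foldr _*ˢ_ 1ˢ

  φ : ∀ {n} → Perm n → Ser
  φ σ m = if phiCond σ (map proj₁ m) (map proj₂ m) then 1# else 0#

  φ' : AnyPerm → Ser
  φ' (_ , σ) = φ σ

  φword : List AnyPerm → Ser
  φword ws = prodˢ (map φ' ws)

  lincomb : List (Carrier × List AnyPerm) → Ser
  lincomb L = sumˢ (map (λ p → proj₁ p ·ˢ φword (proj₂ p)) L)

-- Every biword (x, a) has a standard cycle: the permutation whose cycles are the fibres of x, each fibre
-- traversed in the order in which Std(a) ranks its positions. Conditions (i) and (ii) say precisely that
-- the standard cycle of (x, a) is σ, so the φ_σ are the indicator series of the fibres of this map.
-- Restricting a biword to a block of consecutive positions replaces its standard cycle by the first-return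
-- map on the block; hence whether a biword factors into blocks with prescribed standard cycles α, β is a
-- property of its own standard cycle, and φ_α φ_β is the sum of φ_σ over the σ having that property.
-- For freeness, let α₁, …, α_r be the connected components of σ. Then φ_{α₁} ⋯ φ_{α_r} = φ_σ + Σ φ_τ where
-- every τ has fewer connected components (a connected block cannot be cut), which expresses φ_σ through
-- words in connected permutations by induction. Conversely, at the canonical biword of a longest word w in
-- connected permutations, w is the only such word of that length or shorter that does not vanish, which
-- isolates its coefficient in any vanishing linear combination.

module Submission where

open import Defs
open import Data.List using (List; map)
open import Data.Product using (Σ; _×_; proj₁; proj₂)
open import Data.List.Relation.Unary.All using (All)
open import Data.List.Relation.Unary.Unique.Propositional using (Unique)
open import Data.Product using (_,_)

module Biwords where

  open import Data.Nat
  open import Data.Nat.Properties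
  open import Algebra.Properties.CommutativeSemigroup +-commutativeSemigroup using () renaming (interchange to +-interchange)
  open import Data.Bool using (Bool; true; false; _∧_; _∨_; not; if_then_else_; T)
  open import Data.Bool.ListAction using (all; any)
  open import Data.Fin using (Fin; toℕ; fromℕ<; punchOut)
  import Data.Fin.Properties as FP
  open import Data.List using (List; []; _∷_; map; length; filter; upTo; applyUpTo; _++_; take; drop; concatMap; deduplicate)
  open import Data.List.Properties using (upTo-∷ʳ; length-upTo; length-map; map-upTo; map-∘; length-take; length-drop; drop-drop; length-++; map-++)
  import Data.List.Properties as LP
  open import Data.Nat.ListAction using (sum)
  open import Data.List.Membership.Propositional using (_∈_)
  open import Data.List.Membership.Propositional.Properties using (∈-map⁺; ∈-map⁻; ∈-concat⁺′; ∈-concat⁻′; ∈-upTo⁺; ∈-upTo⁻; ∈-filter⁺; ∈-filter⁻; ∈-deduplicate⁺; ∈-deduplicate⁻)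
  open import Data.List.Relation.Unary.Any using (here; there)
  open import Data.List.Relation.Unary.All using (All; []; _∷_)
  import Data.List.Relation.Unary.All as All
  open import Data.List.Relation.Unary.AllPairs using (AllPairs; []; _∷_)
  import Data.List.Relation.Unary.AllPairs.Properties as AP
  open import Data.List.Relation.Unary.Unique.Propositional using (Unique)
  open import Data.Product using (Σ; _×_; _,_; proj₁; proj₂; uncurry)
  open import Data.Sum using (_⊎_; inj₁; inj₂; [_,_]′)
  open import Data.Empty using (⊥; ⊥-elim)
  open import Data.Unit using (tt; ⊤)
  open import Relation.Nullary using (¬_; Dec; yes; no)
  open import Relation.Nullary.Decidable using (T?)
  open import Relation.Binary.Definitions using (Tri; tri<; tri≈; tri>)
  open import Relation.Binary.PropositionalEquality
  open import Function.Bundles using (_⇔_; mk⇔; Equivalence)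
  open import Data.Bool.Properties using (T-irrelevant)
  open import Defs

  bit : Bool → ℕ
  bit true = 1
  bit false = 0

  T⇒≡true : ∀ {b} → T b → b ≡ true
  T⇒≡true {true} _ = refl

  ¬T⇒≡false : ∀ {b} → ¬ T b → b ≡ false
  ¬T⇒≡false {true} h = ⊥-elim (h tt)
  ¬T⇒≡false {false} _ = refl

  T-∧⁺ : ∀ {a b} → T a → T b → T (a ∧ b)
  T-∧⁺ {true} {true} _ _ = tt

  T-∧⁻ˡ : ∀ {a b} → T (a ∧ b) → T a
  T-∧⁻ˡ {true} _ = tt

  T-∧⁻ʳ : ∀ {a b} → T (a ∧ b) → T b
  T-∧⁻ʳ {true} h = h

  T-∨⁻ : ∀ {a b} → T (a ∨ b) → T a ⊎ T b
  T-∨⁻ {true} _ = inj₁ tt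
  T-∨⁻ {false} h = inj₂ h

  T-∨⁺ˡ : ∀ {a b} → T a → T (a ∨ b)
  T-∨⁺ˡ {true} _ = tt

  T-∨⁺ʳ : ∀ {a b} → T b → T (a ∨ b)
  T-∨⁺ʳ {true} _ = tt
  T-∨⁺ʳ {false} h = h

  T-not⁺ : ∀ {b} → ¬ T b → T (not b)
  T-not⁺ {false} _ = tt
  T-not⁺ {true} h = h tt

  T-not⁻ : ∀ {b} → T (not b) → ¬ T b
  T-not⁻ {true} () _

  T-injective : ∀ {a b : Bool} → (T a → T b) → (T b → T a) → a ≡ b
  T-injective {true} {true} f g = refl
  T-injective {true} {false} f g = ⊥-elim (f tt)
  T-injective {false} {true} f g = ⊥-elim (g tt)
  T-injective {false} {false} f g = refl

  +-cancelʳ-<ᵇ : ∀ a b s → (a + s <ᵇ b + s) ≡ (a <ᵇ b)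
  +-cancelʳ-<ᵇ a b s = T-injective (λ h → <⇒<ᵇ (+-cancelʳ-< s a b (<ᵇ⇒< _ _ h))) (λ h → <⇒<ᵇ (+-monoˡ-< s (<ᵇ⇒< a b h)))

  <-suc-cases : ∀ {z n} → z < suc n → z < n ⊎ z ≡ n
  <-suc-cases z<sn = m≤n⇒m<n∨m≡n (s≤s⁻¹ z<sn)

  search : ∀ (P : ℕ → Bool) n → (Σ ℕ λ i → i < n × T (P i)) ⊎ (∀ i → i < n → ¬ T (P i))
  search P zero = inj₂ (λ i ())
  search P (suc n) with search P n | T? (P n)
  ... | inj₁ (i , i<n , p) | _ = inj₁ (i , m<n⇒m<1+n i<n , p)
  ... | inj₂ _ | yes p = inj₁ (n , ≤-refl , p)
  ... | inj₂ none | no np = inj₂ λ i i<n → [ none i , (λ { refl → np }) ]′ (<-suc-cases i<n)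

  countBelow : (ℕ → Bool) → ℕ → ℕ
  countBelow p n = count p (upTo n)

  count-++ : ∀ p xs ys → count p (xs ++ ys) ≡ count p xs + count p ys
  count-++ p [] ys = refl
  count-++ p (x ∷ xs) ys with p x
  ... | true = cong suc (count-++ p xs ys)
  ... | false = count-++ p xs ys

  countBelow-suc : ∀ p n → countBelow p (suc n) ≡ countBelow p n + bit (p n)
  countBelow-suc p n = begin
    count p (upTo (suc n))              ≡⟨ cong (count p) (sym (upTo-∷ʳ n)) ⟩
    count p (upTo n ++ n ∷ [])          ≡⟨ count-++ p (upTo n) (n ∷ []) ⟩
    count p (upTo n) + count p (n ∷ []) ≡⟨ cong (count p (upTo n) +_) (count-singleton (p n)) ⟩
    count p (upTo n) + bit (p n)        ∎
    where
    open ≡-Reasoning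
    count-singleton : ∀ b → (if b then 1 else 0) ≡ bit b
    count-singleton true = refl
    count-singleton false = refl

  countBelow-cong : ∀ p q n → (∀ z → z < n → p z ≡ q z) → countBelow p n ≡ countBelow q n
  countBelow-cong p q zero h = refl
  countBelow-cong p q (suc n) h rewrite countBelow-suc p n | countBelow-suc q n
    | countBelow-cong p q n (λ z z<n → h z (m<n⇒m<1+n z<n)) | h n ≤-refl = refl

  bit-mono : ∀ {a b} → (T a → T b) → bit a ≤ bit b
  bit-mono {false} {b} h = z≤n
  bit-mono {true} {true} h = ≤-refl
  bit-mono {true} {false} h = ⊥-elim (h tt)

  countBelow-mono : ∀ p q n → (∀ z → z < n → T (p z) → T (q z)) → countBelow p n ≤ countBelow q n
  countBelow-mono p q zero h = z≤n
  countBelow-mono p q (suc n) h rewrite countBelow-suc p n | countBelow-suc q n =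
    +-mono-≤ (countBelow-mono p q n (λ z z<n → h z (m<n⇒m<1+n z<n))) (bit-mono (h n ≤-refl))

  bit-< : ∀ {a b} → T b → ¬ T a → bit a < bit b
  bit-< {false} {true} _ _ = s≤s z≤n
  bit-< {true} _ na = ⊥-elim (na tt)

  countBelow-< : ∀ p q n → (∀ z → z < n → T (p z) → T (q z)) →
    ∀ w → w < n → T (q w) → ¬ T (p w) → countBelow p n < countBelow q n
  countBelow-< p q (suc n) h w w<n qw npw rewrite countBelow-suc p n | countBelow-suc q n with <-suc-cases w<n
  ... | inj₁ w<n′ = +-mono-<-≤ (countBelow-< p q n (λ z z<n → h z (m<n⇒m<1+n z<n)) w w<n′ qw npw) (bit-mono (h n ≤-refl))
  ... | inj₂ refl = +-mono-≤-< (countBelow-mono p q n (λ z z<n → h z (m<n⇒m<1+n z<n))) (bit-< qw npw)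

  bit≤1 : ∀ b → bit b ≤ 1
  bit≤1 true = ≤-refl
  bit≤1 false = z≤n

  countBelow≤ : ∀ p n → countBelow p n ≤ n
  countBelow≤ p zero = z≤n
  countBelow≤ p (suc n) rewrite countBelow-suc p n | +-comm (countBelow p n) (bit (p n)) =
    +-mono-≤ (bit≤1 (p n)) (countBelow≤ p n)

  bit-∨ : ∀ a b → ¬ (T a × T b) → bit (a ∨ b) ≡ bit a + bit b
  bit-∨ true true h = ⊥-elim (h (tt , tt))
  bit-∨ true false h = refl
  bit-∨ false b h = refl

  countBelow-∨ : ∀ p q n → (∀ z → z < n → ¬ (T (p z) × T (q z))) →
    countBelow (λ z → p z ∨ q z) n ≡ countBelow p n + countBelow q n
  countBelow-∨ p q zero h = refl
  countBelow-∨ p q (suc n) h rewrite countBelow-suc (λ z → p z ∨ q z) n | countBelow-suc p n | countBelow-suc q n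
    | countBelow-∨ p q n (λ z z<n → h z (m<n⇒m<1+n z<n)) | bit-∨ (p n) (q n) (h n ≤-refl) =
    +-interchange (countBelow p n) (countBelow q n) (bit (p n)) (bit (q n))

  countBelow-none : ∀ p n → (∀ z → z < n → ¬ T (p z)) → countBelow p n ≡ 0
  countBelow-none p zero h = refl
  countBelow-none p (suc n) h rewrite countBelow-suc p n | ¬T⇒≡false (h n ≤-refl)
    | countBelow-none p n (λ z z<n → h z (m<n⇒m<1+n z<n)) = refl

  countBelow-≡ᵇ : ∀ y n → y < n → countBelow (λ z → z ≡ᵇ y) n ≡ 1
  countBelow-≡ᵇ y (suc n) y<n rewrite countBelow-suc (λ z → z ≡ᵇ y) n with <-suc-cases y<n
  ... | inj₁ y<n′ rewrite countBelow-≡ᵇ y n y<n′ | ¬T⇒≡false {n ≡ᵇ y} (λ e → <-irrefl (sym (≡ᵇ⇒≡ n y e)) y<n′) = refl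
  ... | inj₂ refl rewrite countBelow-none (λ z → z ≡ᵇ y) y (λ z z<y e → <-irrefl (≡ᵇ⇒≡ z y e) z<y)
    | T⇒≡true (≡⇒≡ᵇ y y refl) = refl

  firstFrom : (ℕ → Bool) → ℕ → ℕ → ℕ
  firstFrom p i zero = 0
  firstFrom p i (suc f) = if p i then i else firstFrom p (suc i) f

  first : (ℕ → Bool) → ℕ → ℕ
  first p n = firstFrom p 0 n

  firstFrom-spec : ∀ p i f z → (∀ w → w < i → ¬ T (p w)) → i ≤ z → z < i + f → T (p z) →
    firstFrom p i f ≤ z × T (p (firstFrom p i f)) × (∀ w → w < firstFrom p i f → ¬ T (p w))
  firstFrom-spec p i zero z below i≤z z<i pz = ⊥-elim (<-irrefl refl (≤-<-trans i≤z (subst (z <_) (+-identityʳ i) z<i)))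
  firstFrom-spec p i (suc f) z below i≤z z<if pz with T? (p i)
  ... | yes pi rewrite T⇒≡true pi = i≤z , subst T (sym (T⇒≡true pi)) tt , below
  ... | no npi rewrite ¬T⇒≡false npi = firstFrom-spec p (suc i) f z below′ i<z (subst (z <_) (+-suc i f) z<if) pz
    where
    i<z : suc i ≤ z
    i<z with m≤n⇒m<n∨m≡n i≤z
    ... | inj₁ x = x
    ... | inj₂ refl = ⊥-elim (npi pz)
    below′ : ∀ w → w < suc i → ¬ T (p w)
    below′ w w<si = [ below w , (λ { refl → npi }) ]′ (<-suc-cases w<si)

  first-spec : ∀ p n z → z < n → T (p z) → first p n ≤ z × T (p (first p n)) × (∀ w → w < first p n → ¬ T (p w))
  first-spec p n z z<n pz = firstFrom-spec p 0 n z (λ w ()) z≤n z<n pz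

  first-least : ∀ p n z → z < n → T (p z) → (∀ w → w < z → ¬ T (p w)) → first p n ≡ z
  first-least p n z z<n pz below with first-spec p n z z<n pz
  ... | le , pm , _ with m≤n⇒m<n∨m≡n le
  ...   | inj₁ lt = ⊥-elim (below _ lt pm)
  ...   | inj₂ e = e

  first-unique : ∀ p n z → z < n → T (p z) → (∀ w → w < n → T (p w) → w ≡ z) → first p n ≡ z
  first-unique p n z z<n pz u with first-spec p n z z<n pz
  ... | le , pm , _ = u _ (≤-<-trans le z<n) pm

  firstFrom-cong : ∀ p q i f → (∀ z → i ≤ z → z < i + f → p z ≡ q z) → firstFrom p i f ≡ firstFrom q i f
  firstFrom-cong p q i zero h = refl
  firstFrom-cong p q i (suc f) h rewrite h i ≤-refl (subst (i <_) (sym (+-suc i f)) (s≤s (m≤m+n i f)))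
    with q i
  ... | true = refl
  ... | false = firstFrom-cong p q (suc i) f (λ z i<z z<f → h z (<⇒≤ i<z) (subst (z <_) (sym (+-suc i f)) z<f))

  first-cong : ∀ p q n → (∀ z → z < n → p z ≡ q z) → first p n ≡ first q n
  first-cong p q n h = firstFrom-cong p q 0 n (λ z _ z<n → h z z<n)

  at-map : ∀ (f : ℕ → ℕ) l i → i < length l → at (map f l) i ≡ f (at l i)
  at-map f (x ∷ l) zero _ = refl
  at-map f (x ∷ l) (suc i) h = at-map f l i (s≤s⁻¹ h)

  at-applyUpTo : ∀ (g : ℕ → ℕ) n i → i < n → at (applyUpTo g n) i ≡ g i
  at-applyUpTo g (suc n) zero _ = refl
  at-applyUpTo g (suc n) (suc i) h = at-applyUpTo (λ k → g (suc k)) n i (s≤s⁻¹ h)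

  at-upTo : ∀ n i → i < n → at (upTo n) i ≡ i
  at-upTo = at-applyUpTo (λ k → k)

  at-mapUpTo : ∀ (f : ℕ → ℕ) n i → i < n → at (map f (upTo n)) i ≡ f i
  at-mapUpTo f n i h rewrite at-map f (upTo n) i (subst (i <_) (sym (length-upTo n)) h) | at-upTo n i h = refl

  length-mapUpTo : ∀ (f : ℕ → ℕ) n → length (map f (upTo n)) ≡ n
  length-mapUpTo f n rewrite length-map f (upTo n) = length-upTo n

  at-ext : ∀ (l l′ : List ℕ) → length l ≡ length l′ → (∀ i → i < length l → at l i ≡ at l′ i) → l ≡ l′
  at-ext [] [] _ _ = refl
  at-ext (x ∷ l) (y ∷ l′) e h = cong₂ _∷_ (h 0 (s≤s z≤n)) (at-ext l l′ (suc-injective e) (λ i i<n → h (suc i) (s≤s i<n)))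

  iter : (ℕ → ℕ) → ℕ → ℕ → ℕ
  iter f zero y = y
  iter f (suc n) y = iter f n (f y)

  iter-suc : ∀ f n y → iter f (suc n) y ≡ f (iter f n y)
  iter-suc f zero y = refl
  iter-suc f (suc n) y = iter-suc f n (f y)

  iter-+ : ∀ f m n y → iter f (m + n) y ≡ iter f n (iter f m y)
  iter-+ f zero n y = refl
  iter-+ f (suc m) n y = iter-+ f m n (f y)

  at-orbit : ∀ f s k t → t < k → at (orbit f s k) t ≡ iter f t s
  at-orbit f s (suc k) zero _ = refl
  at-orbit f s (suc k) (suc t) h = at-orbit f (f s) k t (s≤s⁻¹ h)

  length-orbit : ∀ f s k → length (orbit f s k) ≡ k
  length-orbit f s zero = refl
  length-orbit f s (suc k) = cong suc (length-orbit f (f s) k)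

  ∈⇒at : ∀ {x : ℕ} {l} → x ∈ l → Σ ℕ λ i → i < length l × at l i ≡ x
  ∈⇒at (here refl) = 0 , s≤s z≤n , refl
  ∈⇒at (there h) with ∈⇒at h
  ... | i , i<l , e = suc i , s≤s i<l , e

  at⇒∈ : ∀ (l : List ℕ) i → i < length l → at l i ∈ l
  at⇒∈ (x ∷ l) zero _ = here refl
  at⇒∈ (x ∷ l) (suc i) h = there (at⇒∈ l i (s≤s⁻¹ h))

  all⇒at : ∀ p (l : List ℕ) → T (all p l) → ∀ i → i < length l → T (p (at l i))
  all⇒at p (x ∷ l) h zero _ = T-∧⁻ˡ h
  all⇒at p (x ∷ l) h (suc i) i< = all⇒at p l (T-∧⁻ʳ {p x} h) i (s≤s⁻¹ i<)

  at⇒all : ∀ p (l : List ℕ) → (∀ i → i < length l → T (p (at l i))) → T (all p l)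
  at⇒all p [] h = tt
  at⇒all p (x ∷ l) h = T-∧⁺ (h 0 (s≤s z≤n)) (at⇒all p l (λ i i< → h (suc i) (s≤s i<)))

  all-upTo⁻ : ∀ p n → T (all p (upTo n)) → ∀ i → i < n → T (p i)
  all-upTo⁻ p n h i i<n = subst (λ t → T (p t)) (at-upTo n i i<n)
    (all⇒at p (upTo n) h i (subst (i <_) (sym (length-upTo n)) i<n))

  all-upTo⁺ : ∀ p n → (∀ i → i < n → T (p i)) → T (all p (upTo n))
  all-upTo⁺ p n h = at⇒all p (upTo n) (λ i i< → let i<n = subst (i <_) (length-upTo n) i< in
    subst (λ t → T (p t)) (sym (at-upTo n i i<n)) (h i i<n))

  any⇒at : ∀ p (l : List ℕ) → T (any p l) → Σ ℕ λ i → i < length l × T (p (at l i))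
  any⇒at p (x ∷ l) h with T-∨⁻ {p x} h
  ... | inj₁ a = 0 , s≤s z≤n , a
  ... | inj₂ b with any⇒at p l b
  ...   | i , i< , c = suc i , s≤s i< , c

  at⇒any : ∀ p (l : List ℕ) i → i < length l → T (p (at l i)) → T (any p l)
  at⇒any p (x ∷ l) zero _ h = T-∨⁺ˡ h
  at⇒any p (x ∷ l) (suc i) i< h = T-∨⁺ʳ {p x} (at⇒any p l i (s≤s⁻¹ i<) h)

  any-upTo⁻ : ∀ p n → T (any p (upTo n)) → Σ ℕ λ i → i < n × T (p i)
  any-upTo⁻ p n h with any⇒at p (upTo n) h
  ... | i , i< , c = let i<n = subst (i <_) (length-upTo n) i< in i , i<n , subst (λ t → T (p t)) (at-upTo n i i<n) c

  any-upTo⁺ : ∀ p n i → i < n → T (p i) → T (any p (upTo n))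
  any-upTo⁺ p n i i<n h = at⇒any p (upTo n) i (subst (i <_) (sym (length-upTo n)) i<n)
    (subst (λ t → T (p t)) (sym (at-upTo n i i<n)) h)

  memB⇒at : ∀ x l → T (memB x l) → Σ ℕ λ i → i < length l × at l i ≡ x
  memB⇒at x l h with any⇒at (λ y → x ≡ᵇ y) l h
  ... | i , i< , c = i , i< , sym (≡ᵇ⇒≡ x (at l i) c)

  at⇒memB : ∀ x l i → i < length l → at l i ≡ x → T (memB x l)
  at⇒memB x l i i< e = at⇒any (λ y → x ≡ᵇ y) l i i< (≡⇒≡ᵇ x (at l i) (sym e))

  listEqB⇒≡ : ∀ l l′ → T (listEqB l l′) → l ≡ l′
  listEqB⇒≡ [] [] _ = refl
  listEqB⇒≡ (x ∷ l) (y ∷ l′) h = cong₂ _∷_ (≡ᵇ⇒≡ x y (T-∧⁻ˡ h)) (listEqB⇒≡ l l′ (T-∧⁻ʳ {x ≡ᵇ y} h))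

  listEqB-refl : ∀ l → T (listEqB l l)
  listEqB-refl [] = tt
  listEqB-refl (x ∷ l) = T-∧⁺ (≡⇒≡ᵇ x x refl) (listEqB-refl l)

  indexOf-first : ∀ t (l : List ℕ) r → r < length l → at l r ≡ t → (∀ j → j < r → at l j ≢ t) → indexOf t l ≡ r
  indexOf-first t (x ∷ l) zero _ e _ rewrite T⇒≡true (≡⇒≡ᵇ t x (sym e)) = refl
  indexOf-first t (x ∷ l) (suc r) r< e h rewrite ¬T⇒≡false {t ≡ᵇ x} (λ c → h 0 (s≤s z≤n) (sym (≡ᵇ⇒≡ t x c))) =
    cong suc (indexOf-first t l r (s≤s⁻¹ r<) e (λ j j<r → h (suc j) (s≤s j<r)))

  indexOf-∈ : ∀ t (l : List ℕ) → Σ ℕ (λ i → i < length l × at l i ≡ t) → indexOf t l < length l × at l (indexOf t l) ≡ t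
  indexOf-∈ t (x ∷ l) (i , i< , e) with T? (t ≡ᵇ x)
  ... | yes c rewrite T⇒≡true c = s≤s z≤n , sym (≡ᵇ⇒≡ t x c)
  ... | no c rewrite ¬T⇒≡false c with i
  ...   | zero = ⊥-elim (c (≡⇒≡ᵇ t x (sym e)))
  ...   | suc i′ with indexOf-∈ t l (i′ , s≤s⁻¹ i< , e)
  ...     | a , b = s≤s a , b

  count-∷ : ∀ g x l → count g (x ∷ l) ≡ bit (g x) + count g l
  count-∷ g x l with g x
  ... | true = refl
  ... | false = refl

  count-map : ∀ g (f : ℕ → ℕ) l → count g (map f l) ≡ count (λ z → g (f z)) l
  count-map g f [] = refl
  count-map g f (x ∷ l) rewrite count-∷ g (f x) (map f l) | count-∷ (λ z → g (f z)) x l | count-map g f l = refl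

  countBelow-sucˡ : ∀ p n → countBelow p (suc n) ≡ bit (p 0) + countBelow (λ j → p (suc j)) n
  countBelow-sucˡ p n = trans (count-∷ p 0 (applyUpTo suc n))
    (cong (bit (p 0) +_) (trans (cong (count p) (sym (map-upTo suc n))) (count-map p suc (upTo n))))

  count-at : ∀ (g : ℕ → Bool) (l : List ℕ) → count g l ≡ countBelow (λ j → g (at l j)) (length l)
  count-at g [] = refl
  count-at g (x ∷ l) = trans (count-∷ g x l)
    (trans (cong (bit (g x) +_) (count-at g l)) (sym (countBelow-sucˡ (λ j → g (at (x ∷ l) j)) (length l))))

  count-filter : ∀ (g h : ℕ → Bool) (l : List ℕ) → count g (filter (λ z → T? (h z)) l) ≡ count (λ z → h z ∧ g z) l
  count-filter g h [] = refl
  count-filter g h (x ∷ l) with h x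
  ... | false = count-filter g h l
  ... | true with g x
  ...   | true = cong suc (count-filter g h l)
  ...   | false = count-filter g h l

  length-filter : ∀ (h : ℕ → Bool) (l : List ℕ) → length (filter (λ z → T? (h z)) l) ≡ count h l
  length-filter h [] = refl
  length-filter h (x ∷ l) with h x
  ... | false = length-filter h l
  ... | true = cong suc (length-filter h l)

  filter-cong : ∀ (P Q : ℕ → Bool) (l : List ℕ) → (∀ z → z ∈ l → P z ≡ Q z) →
    filter (λ z → T? (P z)) l ≡ filter (λ z → T? (Q z)) l
  filter-cong P Q [] h = refl
  filter-cong P Q (x ∷ l) h rewrite h x (here refl) with Q x
  ... | true = cong (x ∷_) (filter-cong P Q l (λ z m → h z (there m)))
  ... | false = filter-cong P Q l (λ z m → h z (there m))

  AllPairs<⇒at-mono : ∀ (l : List ℕ) → AllPairs _<_ l → ∀ i j → i < j → j < length l → at l i < at l j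
  AllPairs<⇒at-mono (x ∷ l) (h ∷ hs) zero (suc j) _ j< = All.lookup h (at⇒∈ l j (s≤s⁻¹ j<))
  AllPairs<⇒at-mono (x ∷ l) (h ∷ hs) (suc i) (suc j) i<j j< = AllPairs<⇒at-mono l hs i j (s≤s⁻¹ i<j) (s≤s⁻¹ j<)

  AllPairs<⇒at-injective : ∀ (l : List ℕ) → AllPairs _<_ l → ∀ i j → i < length l → j < length l → at l i ≡ at l j → i ≡ j
  AllPairs<⇒at-injective l ap i j i< j< e with <-cmp i j
  ... | tri< a _ _ = ⊥-elim (<-irrefl e (AllPairs<⇒at-mono l ap i j a j<))
  ... | tri≈ _ b _ = b
  ... | tri> _ _ c = ⊥-elim (<-irrefl (sym e) (AllPairs<⇒at-mono l ap j i c i<))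

  AllPairs<-upTo : ∀ n → AllPairs _<_ (upTo n)
  AllPairs<-upTo n = AP.applyUpTo⁺₁ (λ i → i) n (λ i<j _ → i<j)

  module FilteredRange (P : ℕ → Bool) (n : ℕ) where
    range : List ℕ
    range = filter (λ z → T? (P z)) (upTo n)

    length-range : length range ≡ countBelow P n
    length-range = length-filter P (upTo n)

    range-sorted : AllPairs _<_ range
    range-sorted = AP.filter⁺ (λ z → T? (P z)) (AllPairs<-upTo n)

    range-elem : ∀ r → r < length range → at range r < n × T (P (at range r))
    range-elem r r< with ∈-filter⁻ (λ z → T? (P z)) {xs = upTo n} (at⇒∈ range r r<)
    ... | a , b = ∈-upTo⁻ a , b

    range-find : ∀ z → z < n → T (P z) → Σ ℕ λ r → r < length range × at range r ≡ z
    range-find z z<n pz = ∈⇒at (∈-filter⁺ (λ z → T? (P z)) (∈-upTo⁺ z<n) pz)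

    range-mono : ∀ i j → i < j → j < length range → at range i < at range j
    range-mono = AllPairs<⇒at-mono range range-sorted

    range-injective : ∀ i j → i < length range → j < length range → at range i ≡ at range j → i ≡ j
    range-injective = AllPairs<⇒at-injective range range-sorted

    indexOf-range : ∀ r → r < length range → indexOf (at range r) range ≡ r
    indexOf-range r r< = indexOf-first (at range r) range r r< refl (λ j j<r e → <-irrefl e (range-mono j r j<r r<))

    indexOf-range-∈ : ∀ z → z < n → T (P z) → indexOf z range < length range × at range (indexOf z range) ≡ z
    indexOf-range-∈ z z<n pz = indexOf-∈ z range (range-find z z<n pz)

  at-take : ∀ (l : List ℕ) c z → z < c → at (take c l) z ≡ at l z
  at-take [] zero z _ = refl
  at-take [] (suc c) z _ = refl
  at-take (x ∷ l) (suc c) zero _ = refl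
  at-take (x ∷ l) (suc c) (suc z) h = at-take l c z (s≤s⁻¹ h)

  at-drop : ∀ (l : List ℕ) c z → at (drop c l) z ≡ at l (z + c)
  at-drop l zero z = cong (at l) (sym (+-identityʳ z))
  at-drop [] (suc c) z = refl
  at-drop (x ∷ l) (suc c) z = trans (at-drop l c z) (sym (cong (at (x ∷ l)) (+-suc z c)))

  at-++ˡ : ∀ (l₁ l₂ : List ℕ) i → i < length l₁ → at (l₁ ++ l₂) i ≡ at l₁ i
  at-++ˡ (x ∷ l₁) l₂ zero _ = refl
  at-++ˡ (x ∷ l₁) l₂ (suc i) h = at-++ˡ l₁ l₂ i (s≤s⁻¹ h)

  at-++ʳ : ∀ (l₁ l₂ : List ℕ) j → at (l₁ ++ l₂) (length l₁ + j) ≡ at l₂ j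
  at-++ʳ [] l₂ j = refl
  at-++ʳ (x ∷ l₁) l₂ j = at-++ʳ l₁ l₂ j

  private
    module Squeeze (k′ : ℕ) (f : ℕ → ℕ) (j : ℕ) (j<k : j < suc k′) (into : ∀ i → i < suc k′ → f i < suc k′)
      (misses : ∀ i → i < suc k′ → ¬ T (f i ≡ᵇ j)) where
      fᶠ : Fin (suc k′) → Fin (suc k′)
      fᶠ i = fromℕ< (into (toℕ i) (FP.toℕ<n i))
      j≢f : ∀ i → fromℕ< j<k ≢ fᶠ i
      j≢f i e = misses (toℕ i) (FP.toℕ<n i) (≡⇒≡ᵇ (f (toℕ i)) j
        (sym (trans (sym (FP.toℕ-fromℕ< j<k)) (trans (cong toℕ e) (FP.toℕ-fromℕ< (into (toℕ i) (FP.toℕ<n i)))))))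
      squeeze : Fin (suc k′) → Fin k′
      squeeze i = punchOut (j≢f i)
      squeeze-collision : ∀ i i′ → squeeze i ≡ squeeze i′ → f (toℕ i) ≡ f (toℕ i′)
      squeeze-collision i i′ e = trans (sym (FP.toℕ-fromℕ< (into (toℕ i) (FP.toℕ<n i))))
        (trans (cong toℕ (FP.punchOut-injective (j≢f i) (j≢f i′) e)) (FP.toℕ-fromℕ< (into (toℕ i′) (FP.toℕ<n i′))))

  injective⇒surjective : ∀ k (f : ℕ → ℕ) → (∀ i → i < k → f i < k) → (∀ i j → i < k → j < k → f i ≡ f j → i ≡ j) →
    ∀ j → j < k → Σ ℕ λ i → i < k × f i ≡ j
  injective⇒surjective k f into inj j j<k with search (λ i → f i ≡ᵇ j) k
  ... | inj₁ (i , i<k , e) = i , i<k , ≡ᵇ⇒≡ (f i) j e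
  ... | inj₂ misses = ⊥-elim (pigeonhole k j<k into inj misses)
    where
    pigeonhole : ∀ k → j < k → (∀ i → i < k → f i < k) → (∀ i j → i < k → j < k → f i ≡ f j → i ≡ j) →
      (∀ i → i < k → ¬ T (f i ≡ᵇ j)) → ⊥
    pigeonhole (suc k′) j<k into inj misses with FP.pigeonhole (n<1+n k′) (Squeeze.squeeze k′ f j j<k into misses)
    ... | i , i′ , i<i′ , e = FP.<⇒≢ i<i′ (FP.toℕ-injective (inj (toℕ i) (toℕ i′) (FP.toℕ<n i) (FP.toℕ<n i′)
          (Squeeze.squeeze-collision k′ f j j<k into misses i i′ e)))

  -- Standard cycles

  module KeyOrder (A : ℕ → ℕ) where
    beforeᵇ : ℕ → ℕ → Bool
    beforeᵇ z y = (A z <ᵇ A y) ∨ ((z <ᵇ y) ∧ (A z ≡ᵇ A y))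

    Before : ℕ → ℕ → Set
    Before z y = T (beforeᵇ z y)

    Before′ : ℕ → ℕ → Set
    Before′ z y = A z < A y ⊎ (z < y × A z ≡ A y)

    Before⇒Before′ : ∀ {z y} → Before z y → Before′ z y
    Before⇒Before′ {z} {y} h with T-∨⁻ {A z <ᵇ A y} h
    ... | inj₁ a = inj₁ (<ᵇ⇒< _ _ a)
    ... | inj₂ b = inj₂ (<ᵇ⇒< _ _ (T-∧⁻ˡ b) , ≡ᵇ⇒≡ _ _ (T-∧⁻ʳ {z <ᵇ y} b))

    Before′⇒Before : ∀ {z y} → Before′ z y → Before z y
    Before′⇒Before (inj₁ a) = T-∨⁺ˡ (<⇒<ᵇ a)
    Before′⇒Before {z} {y} (inj₂ (a , b)) = T-∨⁺ʳ {A z <ᵇ A y} (T-∧⁺ (<⇒<ᵇ a) (≡⇒≡ᵇ _ _ b))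

    Before-irrefl : ∀ {y} → ¬ Before y y
    Before-irrefl h with Before⇒Before′ h
    ... | inj₁ a = <-irrefl refl a
    ... | inj₂ (a , _) = <-irrefl refl a

    Before-trans : ∀ {a b c} → Before a b → Before b c → Before a c
    Before-trans h1 h2 = Before′⇒Before (go (Before⇒Before′ h1) (Before⇒Before′ h2))
      where
      go : ∀ {a b c} → Before′ a b → Before′ b c → Before′ a c
      go (inj₁ x) (inj₁ y) = inj₁ (<-trans x y)
      go {a} (inj₁ x) (inj₂ (_ , e)) = inj₁ (subst (λ t → A a < t) e x)
      go {c = c} (inj₂ (_ , e)) (inj₁ y) = inj₁ (subst (λ t → t < A c) (sym e) y)
      go (inj₂ (x , e)) (inj₂ (y , e′)) = inj₂ (<-trans x y , trans e e′)

    Before-connex : ∀ a b → a ≢ b → Before a b ⊎ Before b a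
    Before-connex a b ne with <-cmp (A a) (A b)
    ... | tri< x _ _ = inj₁ (Before′⇒Before (inj₁ x))
    ... | tri> _ _ x = inj₂ (Before′⇒Before (inj₁ x))
    ... | tri≈ _ e _ with <-cmp a b
    ...   | tri< x _ _ = inj₁ (Before′⇒Before (inj₂ (x , e)))
    ...   | tri≈ _ e′ _ = ⊥-elim (ne e′)
    ...   | tri> _ _ x = inj₂ (Before′⇒Before (inj₂ (x , sym e)))

    Before-minimum? : ∀ (P : ℕ → Bool) n → (∀ z → z < n → ¬ T (P z)) ⊎
        (Σ ℕ λ z → z < n × T (P z) × (∀ w → w < n → T (P w) → ¬ Before w z))
    Before-minimum? P zero = inj₁ (λ z ())
    Before-minimum? P (suc n) with Before-minimum? P n | T? (P n)
    ... | inj₁ none | no np = inj₁ λ z z<n → [ none z , (λ { refl → np }) ]′ (<-suc-cases z<n)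
    ... | inj₁ none | yes pn = inj₂ (n , ≤-refl , pn , λ w w<n pw →
          [ (λ w<n′ _ → none w w<n′ pw) , (λ { refl → Before-irrefl }) ]′ (<-suc-cases w<n))
    ... | inj₂ (m , m<n , pm , mm) | no np = inj₂ (m , m<n⇒m<1+n m<n , pm , λ w w<n pw →
          [ mm w , (λ { refl → ⊥-elim (np pw) }) ]′ (<-suc-cases w<n) pw)
    ... | inj₂ (m , m<n , pm , mm) | yes pn with T? (beforeᵇ n m)
    ...   | yes nm = inj₂ (n , ≤-refl , pn , λ w w<n pw →
            [ (λ w<n′ w≺n → mm w w<n′ pw (Before-trans w≺n nm)) , (λ { refl → Before-irrefl }) ]′ (<-suc-cases w<n))
    ...   | no nm = inj₂ (m , m<n⇒m<1+n m<n , pm , λ w w<n pw →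
            [ (λ w<n′ → mm w w<n′ pw) , (λ { refl → nm }) ]′ (<-suc-cases w<n))

    Before-minimum : ∀ (P : ℕ → Bool) n z → z < n → T (P z) →
        Σ ℕ λ m → m < n × T (P m) × (∀ w → w < n → T (P w) → ¬ Before w m)
    Before-minimum P n z z<n pz with Before-minimum? P n
    ... | inj₁ none = ⊥-elim (none z z<n pz)
    ... | inj₂ r = r

  -- Positions [0, N) carry letters X and A; next y is the position of the X-fibre of y whose rank in the
  -- order of Std(A) follows that of y, cyclically.
  module StdCycle (N : ℕ) (X A : ℕ → ℕ) where
    open KeyOrder A public

    sameFibreᵇ : ℕ → ℕ → Bool
    sameFibreᵇ y z = X z ≡ᵇ X y

    SameFibre : ℕ → ℕ → Set
    SameFibre y z = T (sameFibreᵇ y z)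

    SameFibre-refl : ∀ y → SameFibre y y
    SameFibre-refl y = ≡⇒≡ᵇ (X y) (X y) refl

    SameFibre-sym : ∀ {y z} → SameFibre y z → SameFibre z y
    SameFibre-sym {y} {z} h = ≡⇒≡ᵇ (X y) (X z) (sym (≡ᵇ⇒≡ (X z) (X y) h))

    SameFibre-trans : ∀ {a b c} → SameFibre a b → SameFibre b c → SameFibre a c
    SameFibre-trans {a} {b} {c} h1 h2 = ≡⇒≡ᵇ (X c) (X a) (trans (≡ᵇ⇒≡ (X c) (X b) h2) (≡ᵇ⇒≡ (X b) (X a) h1))

    sameFibreᵇ-cong : ∀ {y y′} → SameFibre y y′ → ∀ z → sameFibreᵇ y z ≡ sameFibreᵇ y′ z
    sameFibreᵇ-cong {y} {y′} h z rewrite ≡ᵇ⇒≡ (X y′) (X y) h = refl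

    rank : ℕ → ℕ
    rank y = countBelow (λ z → sameFibreᵇ y z ∧ beforeᵇ z y) N

    fibreSize : ℕ → ℕ
    fibreSize y = countBelow (sameFibreᵇ y) N

    fibreSize-cong : ∀ {y y′} → SameFibre y y′ → fibreSize y ≡ fibreSize y′
    fibreSize-cong h = countBelow-cong _ _ N (λ z _ → sameFibreᵇ-cong h z)

    fibreSize≤N : ∀ y → fibreSize y ≤ N
    fibreSize≤N y = countBelow≤ _ N

    rank<fibreSize : ∀ y → y < N → rank y < fibreSize y
    rank<fibreSize y y<N = countBelow-< _ _ N (λ z _ h → T-∧⁻ˡ h) y y<N (SameFibre-refl y) (λ h → Before-irrefl (T-∧⁻ʳ {sameFibreᵇ y y} h))

    rank-mono : ∀ {y z} → y < N → SameFibre y z → Before y z → rank y < rank z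
    rank-mono {y} {z} y<N f lt = countBelow-< _ _ N
      (λ w _ h → T-∧⁺ (SameFibre-trans (SameFibre-sym f) (T-∧⁻ˡ h)) (Before-trans (T-∧⁻ʳ {sameFibreᵇ y w} h) lt)) y
      y<N (T-∧⁺ (SameFibre-sym f) lt) (λ h → Before-irrefl (T-∧⁻ʳ {sameFibreᵇ y y} h))

    rank-injective : ∀ {y z} → y < N → z < N → SameFibre y z → rank y ≡ rank z → y ≡ z
    rank-injective {y} {z} y<N z<N f e with y ≟ z
    ... | yes p = p
    ... | no ne with Before-connex y z ne
    ...   | inj₁ lt = ⊥-elim (<-irrefl e (rank-mono y<N f lt))
    ...   | inj₂ lt = ⊥-elim (<-irrefl (sym e) (rank-mono z<N (SameFibre-sym f) lt))

    rank-<⇒Before : ∀ {y z} → y < N → z < N → SameFibre y z → rank y < rank z → Before y z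
    rank-<⇒Before {y} {z} y<N z<N f r with y ≟ z
    ... | yes refl = ⊥-elim (<-irrefl refl r)
    ... | no ne with Before-connex y z ne
    ...   | inj₁ lt = lt
    ...   | inj₂ lt = ⊥-elim (<-asym r (rank-mono z<N (SameFibre-sym f) lt))

    private
      not-before-self : ∀ y w → ¬ (T (sameFibreᵇ y w ∧ beforeᵇ w y) × T (w ≡ᵇ y))
      not-before-self y w (h , e) rewrite ≡ᵇ⇒≡ w y e = Before-irrefl (T-∧⁻ʳ {sameFibreᵇ y y} h)

      count-up-to-self : ∀ y → y < N → countBelow (λ w → (sameFibreᵇ y w ∧ beforeᵇ w y) ∨ (w ≡ᵇ y)) N ≡ suc (rank y)
      count-up-to-self y y<N rewrite countBelow-∨ (λ w → sameFibreᵇ y w ∧ beforeᵇ w y) (λ w → w ≡ᵇ y) N (λ w _ → not-before-self y w)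
         | countBelow-≡ᵇ y N y<N = +-comm (rank y) 1

    rank-successor : ∀ {y z} → y < N → z < N → SameFibre y z → Before y z →
      (∀ w → w < N → SameFibre y w → Before y w → ¬ Before w z) → rank z ≡ suc (rank y)
    rank-successor {y} {z} y<N z<N f lt nb = trans (countBelow-cong _ _ N same-set) (count-up-to-self y y<N)
      where
      same-set : ∀ w → w < N → (sameFibreᵇ z w ∧ beforeᵇ w z) ≡ ((sameFibreᵇ y w ∧ beforeᵇ w y) ∨ (w ≡ᵇ y))
      same-set w w<N = T-injective to from
        where
        to : T (sameFibreᵇ z w ∧ beforeᵇ w z) → T ((sameFibreᵇ y w ∧ beforeᵇ w y) ∨ (w ≡ᵇ y))
        to h with w ≟ y
        ... | yes e = T-∨⁺ʳ {sameFibreᵇ y w ∧ beforeᵇ w y} (≡⇒≡ᵇ w y e)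
        ... | no ne with Before-connex w y ne
        ...   | inj₁ l = T-∨⁺ˡ (T-∧⁺ (SameFibre-trans f (T-∧⁻ˡ h)) l)
        ...   | inj₂ l = ⊥-elim (nb w w<N (SameFibre-trans f (T-∧⁻ˡ h)) l (T-∧⁻ʳ {sameFibreᵇ z w} h))
        from : T ((sameFibreᵇ y w ∧ beforeᵇ w y) ∨ (w ≡ᵇ y)) → T (sameFibreᵇ z w ∧ beforeᵇ w z)
        from h with T-∨⁻ {sameFibreᵇ y w ∧ beforeᵇ w y} h
        ... | inj₁ a = T-∧⁺ (SameFibre-trans (SameFibre-sym f) (T-∧⁻ˡ a)) (Before-trans (T-∧⁻ʳ {sameFibreᵇ y w} a) lt)
        ... | inj₂ e rewrite ≡ᵇ⇒≡ w y e = T-∧⁺ (SameFibre-sym f) lt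

    rank-maximum : ∀ {y} → y < N → (∀ w → w < N → SameFibre y w → ¬ Before y w) → suc (rank y) ≡ fibreSize y
    rank-maximum {y} y<N mx = trans (sym (count-up-to-self y y<N)) (countBelow-cong _ _ N same-set)
      where
      same-set : ∀ w → w < N → ((sameFibreᵇ y w ∧ beforeᵇ w y) ∨ (w ≡ᵇ y)) ≡ sameFibreᵇ y w
      same-set w w<N = T-injective to from
        where
        from : T (sameFibreᵇ y w) → T ((sameFibreᵇ y w ∧ beforeᵇ w y) ∨ (w ≡ᵇ y))
        from h with w ≟ y
        ... | yes e = T-∨⁺ʳ {sameFibreᵇ y w ∧ beforeᵇ w y} (≡⇒≡ᵇ w y e)
        ... | no ne with Before-connex w y ne
        ...   | inj₁ l = T-∨⁺ˡ (T-∧⁺ h l)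
        ...   | inj₂ l = ⊥-elim (mx w w<N h l)
        to : T ((sameFibreᵇ y w ∧ beforeᵇ w y) ∨ (w ≡ᵇ y)) → T (sameFibreᵇ y w)
        to h with T-∨⁻ {sameFibreᵇ y w ∧ beforeᵇ w y} h
        ... | inj₁ a = T-∧⁻ˡ a
        ... | inj₂ e rewrite ≡ᵇ⇒≡ w y e = SameFibre-refl y

    suc-rank<fibreSize : ∀ {y w} → y < N → w < N → SameFibre y w → Before y w → suc (rank y) < fibreSize y
    suc-rank<fibreSize {y} {w} y<N w<N f l = ≤-trans (s≤s (rank-mono y<N f l)) (subst (suc (rank w) ≤_) (sym (fibreSize-cong f)) (rank<fibreSize w w<N))

    rank-minimum : ∀ {z} → (∀ w → w < N → SameFibre z w → ¬ Before w z) → rank z ≡ 0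
    rank-minimum {z} mn = countBelow-none _ N (λ w w<N h → mn w w<N (T-∧⁻ˡ h) (T-∧⁻ʳ {sameFibreᵇ z w} h))

    rank-surjective : ∀ y → y < N → ∀ r → r < fibreSize y → Σ ℕ λ z → z < N × SameFibre y z × rank z ≡ r
    rank-surjective y y<N zero _ with Before-minimum (sameFibreᵇ y) N y y<N (SameFibre-refl y)
    ... | m , m<N , fm , mm = m , m<N , fm , rank-minimum (λ w w<N f l → mm w w<N (SameFibre-trans fm f) l)
    rank-surjective y y<N (suc r) r<sz with rank-surjective y y<N r (<-trans (n<1+n r) r<sz)
    ... | z , z<N , fz , rz with Before-minimum? (λ w → sameFibreᵇ z w ∧ beforeᵇ z w) N
    ...   | inj₁ none = ⊥-elim (<-irrefl (trans (cong suc (sym rz)) (trans (rank-maximum z<N (λ w w<N f l → none w w<N (T-∧⁺ f l))) (sym (fibreSize-cong fz)))) r<sz)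
    ...   | inj₂ (m , m<N , pm , mm) = m , m<N , SameFibre-trans fz (T-∧⁻ˡ pm) ,
            trans (rank-successor z<N m<N (T-∧⁻ˡ pm) (T-∧⁻ʳ {sameFibreᵇ z m} pm)
                    (λ w w<N f l l′ → mm w w<N (T-∧⁺ f l) l′)) (cong suc rz)

    nextRank : ℕ → ℕ
    nextRank y = if suc (rank y) ≡ᵇ fibreSize y then 0 else suc (rank y)

    nextRank<fibreSize : ∀ y → y < N → nextRank y < fibreSize y
    nextRank<fibreSize y y<N with T? (suc (rank y) ≡ᵇ fibreSize y)
    ... | yes e rewrite T⇒≡true e = ≤-<-trans z≤n (rank<fibreSize y y<N)
    ... | no ne rewrite ¬T⇒≡false ne = ≤∧≢⇒< (rank<fibreSize y y<N) (λ e → ne (≡⇒≡ᵇ _ _ e))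

    next : ℕ → ℕ
    next y = first (λ z → sameFibreᵇ y z ∧ (rank z ≡ᵇ nextRank y)) N

    next-unique : ∀ y → y < N → ∀ z → z < N → SameFibre y z → rank z ≡ nextRank y → next y ≡ z
    next-unique y y<N z z<N f e = first-unique _ N z z<N (T-∧⁺ f (≡⇒≡ᵇ _ _ e))
      (λ w w<N h → rank-injective w<N z<N (SameFibre-trans (SameFibre-sym (T-∧⁻ˡ h)) f) (trans (≡ᵇ⇒≡ (rank w) (nextRank y) (T-∧⁻ʳ {sameFibreᵇ y w} h)) (sym e)))

    next-spec : ∀ y → y < N → next y < N × SameFibre y (next y) × rank (next y) ≡ nextRank y
    next-spec y y<N with rank-surjective y y<N (nextRank y) (nextRank<fibreSize y y<N)
    ... | z , z<N , f , e rewrite next-unique y y<N z z<N f e = z<N , f , e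

    nextRank-suc : ∀ y → suc (rank y) ≢ fibreSize y → nextRank y ≡ suc (rank y)
    nextRank-suc y ne rewrite ¬T⇒≡false {suc (rank y) ≡ᵇ fibreSize y} (λ e → ne (≡ᵇ⇒≡ (suc (rank y)) (fibreSize y) e)) = refl

    nextRank-wrap : ∀ y → suc (rank y) ≡ fibreSize y → nextRank y ≡ 0
    nextRank-wrap y e rewrite T⇒≡true (≡⇒≡ᵇ (suc (rank y)) (fibreSize y) e) = refl

    next< : ∀ y → y < N → next y < N
    next< y y<N = proj₁ (next-spec y y<N)

    next-sameFibre : ∀ y → y < N → SameFibre y (next y)
    next-sameFibre y y<N = proj₁ (proj₂ (next-spec y y<N))

    rank-next : ∀ y → y < N → suc (rank y) < fibreSize y → rank (next y) ≡ suc (rank y)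
    rank-next y y<N h = trans (proj₂ (proj₂ (next-spec y y<N))) (nextRank-suc y (λ e → <-irrefl e h))

    rank-next-wrap : ∀ y → y < N → suc (rank y) ≡ fibreSize y → rank (next y) ≡ 0
    rank-next-wrap y y<N e = trans (proj₂ (proj₂ (next-spec y y<N))) (nextRank-wrap y e)

    next-successor : ∀ {y z} → y < N → z < N → SameFibre y z → Before y z →
      (∀ w → w < N → SameFibre y w → Before y w → ¬ Before w z) → next y ≡ z
    next-successor {y} {z} y<N z<N f l nb = next-unique y y<N z z<N f
      (trans (rank-successor y<N z<N f l nb) (sym (nextRank-suc y (λ e → <-irrefl e (suc-rank<fibreSize y<N z<N f l)))))

    next-wrap : ∀ {y z} → y < N → z < N → SameFibre y z →
      (∀ w → w < N → SameFibre y w → ¬ Before y w) → (∀ w → w < N → SameFibre y w → ¬ Before w z) → next y ≡ z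
    next-wrap {y} {z} y<N z<N f mx mn = next-unique y y<N z z<N f
      (trans (rank-minimum (λ w w<N f′ l → mn w w<N (SameFibre-trans f f′) l)) (sym (nextRank-wrap y (rank-maximum y<N mx))))

    next-cases : ∀ y → y < N →
      (Before y (next y) × (∀ w → w < N → SameFibre y w → Before y w → ¬ Before w (next y))) ⊎
      ((∀ w → w < N → SameFibre y w → ¬ Before y w) × (∀ w → w < N → SameFibre y w → ¬ Before w (next y)))
    next-cases y y<N with next-spec y y<N | suc (rank y) ≟ fibreSize y
    ... | z<N , f , e | yes eq = inj₂ (mx , mn)
      where
      mx : ∀ w → w < N → SameFibre y w → ¬ Before y w
      mx w w<N fw l = <-irrefl eq (suc-rank<fibreSize y<N w<N fw l)
      mn : ∀ w → w < N → SameFibre y w → ¬ Before w (next y)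
      mn w w<N fw l = <-irrefl refl (≤-<-trans z≤n (subst (rank w <_) (trans e (nextRank-wrap y eq))
          (rank-mono w<N (SameFibre-trans (SameFibre-sym fw) f) l)))
    ... | z<N , f , e | no ne = inj₁ (lt , nb)
      where
      e′ : rank (next y) ≡ suc (rank y)
      e′ = trans e (nextRank-suc y ne)
      lt : Before y (next y)
      lt = rank-<⇒Before y<N z<N f (subst (rank y <_) (sym e′) (n<1+n (rank y)))
      nb : ∀ w → w < N → SameFibre y w → Before y w → ¬ Before w (next y)
      nb w w<N fw l1 l2 with rank-mono y<N fw l1 | rank-mono w<N (SameFibre-trans (SameFibre-sym fw) f) l2
      ... | r1 | r2 rewrite e′ = <-irrefl refl (<-≤-trans r2 r1)

    next-injective : ∀ {y y′} → y < N → y′ < N → next y ≡ next y′ → y ≡ y′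
    next-injective {y} {y′} y<N y′<N e = rank-injective y<N y′<N fyy′ (lemma (suc (rank y) ≟ fibreSize y) (suc (rank y′) ≟ fibreSize y′))
      where
      fyy′ : SameFibre y y′
      fyy′ = SameFibre-trans (next-sameFibre y y<N) (subst (λ t → SameFibre t y′) (sym e) (SameFibre-sym (next-sameFibre y′ y′<N)))
      szE : fibreSize y ≡ fibreSize y′
      szE = fibreSize-cong fyy′
      r : rank (next y) ≡ rank (next y′)
      r = cong rank e
      lemma : Dec (suc (rank y) ≡ fibreSize y) → Dec (suc (rank y′) ≡ fibreSize y′) → rank y ≡ rank y′
      lemma (yes a) (yes b) = suc-injective (trans a (trans szE (sym b)))
      lemma (yes a) (no b) = ⊥-elim (0≢1+n (trans (sym (rank-next-wrap y y<N a)) (trans r (rank-next y′ y′<N (≤∧≢⇒< (rank<fibreSize y′ y′<N) b)))))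
      lemma (no a) (yes b) = ⊥-elim (0≢1+n (trans (sym (rank-next-wrap y′ y′<N b)) (trans (sym r) (rank-next y y<N (≤∧≢⇒< (rank<fibreSize y y<N) a)))))
      lemma (no a) (no b) = suc-injective (trans (sym (rank-next y y<N (≤∧≢⇒< (rank<fibreSize y y<N) a))) (trans r (rank-next y′ y′<N (≤∧≢⇒< (rank<fibreSize y′ y′<N) b))))

    iter-next-sameFibre : ∀ t y → y < N → iter next t y < N × SameFibre y (iter next t y)
    iter-next-sameFibre zero y y<N = y<N , SameFibre-refl y
    iter-next-sameFibre (suc t) y y<N with iter-next-sameFibre t (next y) (next< y y<N)
    ... | a , b = a , SameFibre-trans (next-sameFibre y y<N) b

    rank-iter-next : ∀ t y → y < N → rank y + t < fibreSize y → rank (iter next t y) ≡ rank y + t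
    rank-iter-next zero y y<N h = sym (+-identityʳ (rank y))
    rank-iter-next (suc t) y y<N h = trans (rank-iter-next t (next y) (next< y y<N) h′) (trans (cong (_+ t) e) (sym (+-suc (rank y) t)))
      where
      h1 : suc (rank y) < fibreSize y
      h1 = ≤-<-trans (subst (suc (rank y) ≤_) (sym (+-suc (rank y) t)) (s≤s (m≤m+n (rank y) t))) h
      e : rank (next y) ≡ suc (rank y)
      e = rank-next y y<N h1
      h′ : rank (next y) + t < fibreSize (next y)
      h′ = subst₂ _<_ (trans (+-suc (rank y) t) (cong (_+ t) (sym e))) (fibreSize-cong (next-sameFibre y y<N)) h

    rank<fibreSize-of : ∀ {i j} → j < N → SameFibre i j → rank j < fibreSize i
    rank<fibreSize-of j<N f = subst (_ <_) (sym (fibreSize-cong f)) (rank<fibreSize _ j<N)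

    iter-next-hits : ∀ {i j} t → i < N → j < N → SameFibre i j → rank (iter next t i) ≡ rank j → iter next t i ≡ j
    iter-next-hits {i} t i<N j<N f e = rank-injective (proj₁ it) j<N (SameFibre-trans (SameFibre-sym (proj₂ it)) f) e
      where it = iter-next-sameFibre t i i<N

    rank-iter-next-wrap : ∀ i → i < N → rank (iter next (suc (fibreSize i ∸ suc (rank i))) i) ≡ 0
    rank-iter-next-wrap i i<N = trans (cong rank (iter-suc next t i)) (rank-next-wrap y (proj₁ y-spec) top)
      where
      t = fibreSize i ∸ suc (rank i)
      y = iter next t i
      y-spec = iter-next-sameFibre t i i<N
      r+t : suc (rank i + t) ≡ fibreSize i
      r+t = m+[n∸m]≡n (rank<fibreSize i i<N)
      top : suc (rank y) ≡ fibreSize y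
      top = trans (cong suc (rank-iter-next t i i<N (subst (rank i + t <_) r+t ≤-refl)))
                  (trans r+t (fibreSize-cong (proj₂ y-spec)))

    rank-iter-from-wrap : ∀ i j → i < N → j < fibreSize i → rank (iter next j (iter next (suc (fibreSize i ∸ suc (rank i))) i)) ≡ j
    rank-iter-from-wrap i j i<N j<S = trans
      (rank-iter-next j bottom (proj₁ bottom-spec)
        (subst₂ _<_ (cong (_+ j) (sym (rank-iter-next-wrap i i<N))) (fibreSize-cong (proj₂ bottom-spec)) j<S))
      (cong (_+ j) (rank-iter-next-wrap i i<N))
      where
      bottom = iter next (suc (fibreSize i ∸ suc (rank i))) i
      bottom-spec = iter-next-sameFibre (suc (fibreSize i ∸ suc (rank i))) i i<N

    iter-next-covers : ∀ i j → i < N → j < N → SameFibre i j → Σ ℕ λ t → t < fibreSize i × iter next t i ≡ j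
    iter-next-covers i j i<N j<N f with rank i ≤? rank j
    ... | yes ri≤rj = rank j ∸ rank i , ≤-<-trans (m∸n≤m (rank j) (rank i)) (rank<fibreSize-of j<N f) ,
          iter-next-hits (rank j ∸ rank i) i<N j<N f
            (trans (rank-iter-next (rank j ∸ rank i) i i<N (subst (_< fibreSize i) (sym climb) (rank<fibreSize-of j<N f))) climb)
      where
      climb : rank i + (rank j ∸ rank i) ≡ rank j
      climb = m+[n∸m]≡n ri≤rj
    ... | no ri≰rj = suc t + rank j , t+rj<S ,
          iter-next-hits (suc t + rank j) i<N j<N f
            (trans (cong rank (iter-+ next (suc t) (rank j) i)) (rank-iter-from-wrap i (rank j) i<N (rank<fibreSize-of j<N f)))
      where
      t = fibreSize i ∸ suc (rank i)
      t+rj<S : suc t + rank j < fibreSize i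
      t+rj<S = subst (suc t + rank j <_) (m+[n∸m]≡n (rank<fibreSize i i<N))
                 (s≤s (subst (_< rank i + t) (+-comm (rank j) t) (+-monoˡ-< t (≰⇒> ri≰rj))))

  module StdCycleCong (N : ℕ) (X A X′ A′ : ℕ → ℕ)
    (hf : ∀ y z → y < N → z < N → (X z ≡ᵇ X y) ≡ (X′ z ≡ᵇ X′ y))
    (ha : ∀ z → z < N → A z ≡ A′ z) where
    private
      module P = StdCycle N X A
      module Q = StdCycle N X′ A′

    beforeᵇ-cong : ∀ z y → z < N → y < N → P.beforeᵇ z y ≡ Q.beforeᵇ z y
    beforeᵇ-cong z y z<N y<N rewrite ha z z<N | ha y y<N = refl

    rank-cong : ∀ y → y < N → P.rank y ≡ Q.rank y
    rank-cong y y<N = countBelow-cong _ _ N (λ z z<N → cong₂ _∧_ (hf y z y<N z<N) (beforeᵇ-cong z y z<N y<N))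

    fibreSize-cong : ∀ y → y < N → P.fibreSize y ≡ Q.fibreSize y
    fibreSize-cong y y<N = countBelow-cong _ _ N (λ z z<N → hf y z y<N z<N)

    nextRank-cong : ∀ y → y < N → P.nextRank y ≡ Q.nextRank y
    nextRank-cong y y<N rewrite rank-cong y y<N | fibreSize-cong y y<N = refl

    next-cong : ∀ y → y < N → P.next y ≡ Q.next y
    next-cong y y<N = first-cong _ _ N (λ z z<N → cong₂ _∧_ (hf y z y<N z<N)
      (cong₂ _≡ᵇ_ (rank-cong z z<N) (nextRank-cong y y<N)))

  -- First-return maps on blocks

  inBlock : ℕ → ℕ → ℕ → Bool
  inBlock s l y = (s ≤ᵇ y) ∧ (y <ᵇ s + l)

  firstReturn : (ℕ → ℕ) → ℕ → ℕ → ℕ → ℕ → ℕ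
  firstReturn τ s l y zero = y
  firstReturn τ s l y (suc f) = if inBlock s l y then y else firstReturn τ s l (τ y) f

  firstReturn-in : ∀ τ s l y f → T (inBlock s l y) → firstReturn τ s l y (suc f) ≡ y
  firstReturn-in τ s l y f h rewrite T⇒≡true h = refl

  firstReturn-out : ∀ τ s l y f → ¬ T (inBlock s l y) → firstReturn τ s l y (suc f) ≡ firstReturn τ s l (τ y) f
  firstReturn-out τ s l y f h rewrite ¬T⇒≡false h = refl

  firstReturn-skip : ∀ τ s l k y f → (∀ j → j < k → ¬ T (inBlock s l (iter τ j y))) →
    firstReturn τ s l y (k + f) ≡ firstReturn τ s l (iter τ k y) f
  firstReturn-skip τ s l zero y f out = refl
  firstReturn-skip τ s l (suc k) y f out =
    trans (firstReturn-out τ s l y (k + f) (out 0 (s≤s z≤n)))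
          (firstReturn-skip τ s l k (τ y) f (λ j j<k → out (suc j) (s≤s j<k)))

  firstReturn-reaches : ∀ τ s l k y N → k < N → T (inBlock s l (iter τ k y)) →
    (∀ j → j < k → ¬ T (inBlock s l (iter τ j y))) → firstReturn τ s l y N ≡ iter τ k y
  firstReturn-reaches τ s l k y N k<N hit out = begin
    firstReturn τ s l y N                          ≡⟨ cong (firstReturn τ s l y) (sym (m+[n∸m]≡n (<⇒≤ k<N))) ⟩
    firstReturn τ s l y (k + (N ∸ k))              ≡⟨ cong (λ f → firstReturn τ s l y (k + f)) N∸k≡1+f ⟩
    firstReturn τ s l y (k + suc (N ∸ suc k))      ≡⟨ firstReturn-skip τ s l k y _ out ⟩
    firstReturn τ s l (iter τ k y) (suc (N ∸ suc k)) ≡⟨ firstReturn-in τ s l (iter τ k y) (N ∸ suc k) hit ⟩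
    iter τ k y                                     ∎
    where
    open ≡-Reasoning
    N∸k≡1+f : N ∸ k ≡ suc (N ∸ suc k)
    N∸k≡1+f = +-cancelˡ-≡ k _ _ (trans (m+[n∸m]≡n (<⇒≤ k<N)) (trans (sym (m+[n∸m]≡n k<N)) (sym (+-suc k _))))

  firstReturn-cong : ∀ N (f g : ℕ → ℕ) s l y fuel → (∀ z → z < N → f z ≡ g z) → (∀ z → z < N → g z < N) → y < N →
    firstReturn f s l y fuel ≡ firstReturn g s l y fuel
  firstReturn-cong N f g s l y zero h1 h2 y<N = refl
  firstReturn-cong N f g s l y (suc fuel) h1 h2 y<N with inBlock s l y
  ... | true = refl
  ... | false = trans (cong (λ v → firstReturn f s l v fuel) (h1 y y<N)) (firstReturn-cong N f g s l (g y) fuel h1 h2 (h2 y y<N))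

  inBlock⁺ : ∀ {s l y} → s ≤ y → y < s + l → T (inBlock s l y)
  inBlock⁺ h1 h2 = T-∧⁺ (≤⇒≤ᵇ h1) (<⇒<ᵇ h2)

  inBlock⁻ : ∀ {s l y} → T (inBlock s l y) → s ≤ y × y < s + l
  inBlock⁻ {s} {l} {y} h = ≤ᵇ⇒≤ s y (T-∧⁻ˡ h) , <ᵇ⇒< y (s + l) (T-∧⁻ʳ {s ≤ᵇ y} h)

  inBlock-shift : ∀ {s l z} → z < l → T (inBlock s l (z + s))
  inBlock-shift {s} {l} {z} z<l = inBlock⁺ (m≤n+m s z) (subst (_< s + l) (+-comm s z) (+-monoʳ-< s z<l))

  inBlock-unshift : ∀ {s l w} → T (inBlock s l w) → Σ ℕ λ w′ → w′ < l × w ≡ w′ + s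
  inBlock-unshift {s} {l} {w} b with inBlock⁻ {s} {l} {w} b
  ... | s≤w , w<s+l = w ∸ s , +-cancelʳ-< s (w ∸ s) l (subst₂ _<_ (sym (m∸n+n≡m s≤w)) (+-comm s l) w<s+l) ,
                      sym (m∸n+n≡m s≤w)

  -- The standard cycle of the block [s, s+l) of a biword is the first-return map of the standard cycle of the
  -- whole biword: walking from q along the whole cycle, the positions met before the next block position are
  -- exactly the non-block positions of the fibre lying between q and its block successor in the cyclic order.
  module FirstReturn (N : ℕ) (X A : ℕ → ℕ) (s l : ℕ) (s+l≤N : s + l ≤ N) where
    open StdCycle N X A
    module Block = StdCycle l (λ z → X (z + s)) (λ z → A (z + s))

    shift< : ∀ {z} → z < l → z + s < N
    shift< z<l = <-≤-trans (+-monoˡ-< _ z<l) (subst (_≤ N) (+-comm s l) s+l≤N)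

    beforeᵇ-shift : ∀ a b → Block.beforeᵇ a b ≡ beforeᵇ (a + s) (b + s)
    beforeᵇ-shift a b rewrite +-cancelʳ-<ᵇ a b s = refl

    Before⇒Block : ∀ {a b} → Before (a + s) (b + s) → Block.Before a b
    Before⇒Block {a} {b} = subst T (sym (beforeᵇ-shift a b))

    Block⇒Before : ∀ {a b} → Block.Before a b → Before (a + s) (b + s)
    Block⇒Before {a} {b} = subst T (beforeᵇ-shift a b)

    module _ (q′ : ℕ) (q′<l : q′ < l) where
      private
        q = q′ + s
        q<N = shift< q′<l
        z′ = Block.next q′
        y* = z′ + s
        y*<N = shift< (Block.next< q′ q′<l)
        fy* : SameFibre q y*
        fy* = Block.next-sameFibre q′ q′<l
        y*-in : T (inBlock s l y*)
        y*-in = inBlock-shift {s} {l} (Block.next< q′ q′<l)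

        outside : ∀ (P : ℕ → Set) → (∀ w′ → w′ < l → Block.SameFibre q′ w′ → ¬ P (w′ + s)) →
          ∀ w → SameFibre q w → P w → ¬ T (inBlock s l w)
        outside P h w fw pw b with inBlock-unshift {s} {l} {w} b
        ... | w′ , w′<l , refl = h w′ w′<l fw pw

        reaches : ∀ k → k < N → iter next k (next q) ≡ y* →
          (∀ j → j < k → ¬ T (inBlock s l (iter next j (next q)))) → firstReturn next s l (next q) N ≡ y*
        reaches k k<N hit out = trans (firstReturn-reaches next s l k (next q) N k<N (subst T (cong (inBlock s l) (sym hit)) y*-in) out) hit

      firstReturn-forward : Block.Before q′ z′ →
        (∀ w → w < l → Block.SameFibre q′ w → Block.Before q′ w → ¬ Block.Before w z′) →
        firstReturn next s l (next q) N ≡ y*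
      firstReturn-forward q′≺z′ between = reaches k k<N hit skipped
        where
        k = rank y* ∸ suc (rank q)
        rank-y* : rank q + suc k ≡ rank y*
        rank-y* = trans (+-suc (rank q) k) (m+[n∸m]≡n (rank-mono q<N fy* (Block⇒Before q′≺z′)))
        below-y* : ∀ {j} → j ≤ k → rank q + suc j < fibreSize q
        below-y* {j} j≤k = ≤-<-trans (subst (rank q + suc j ≤_) rank-y* (+-monoʳ-≤ (rank q) (s≤s j≤k))) (rank<fibreSize-of y*<N fy*)
        k<N : k < N
        k<N = ≤-<-trans (m∸n≤m (rank y*) (suc (rank q))) (<-≤-trans (rank<fibreSize y* y*<N) (fibreSize≤N y*))
        hit : iter next k (next q) ≡ y*
        hit = iter-next-hits (suc k) q<N y*<N fy* (trans (rank-iter-next (suc k) q q<N (below-y* ≤-refl)) rank-y*)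
        skipped : ∀ j → j < k → ¬ T (inBlock s l (iter next j (next q)))
        skipped j j<k = outside (λ w → Before q w × Before w y*)
          (λ w′ w′<l f (q≺w , w≺y*) → between w′ w′<l f (Before⇒Block q≺w) (Before⇒Block w≺y*)) w fw
          (rank-<⇒Before q<N w<N fw (subst (rank q <_) (sym rw) (m<m+n _ (s≤s z≤n))) ,
           rank-<⇒Before w<N y*<N (SameFibre-trans (SameFibre-sym fw) fy*)
             (subst₂ _<_ (sym rw) rank-y* (+-monoʳ-< (rank q) (s≤s j<k))))
          where
          w = iter next j (next q)
          w<N = proj₁ (iter-next-sameFibre (suc j) q q<N)
          fw = proj₂ (iter-next-sameFibre (suc j) q q<N)
          rw : rank w ≡ rank q + suc j
          rw = rank-iter-next (suc j) q q<N (below-y* (<⇒≤ j<k))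

      firstReturn-wrapping : (∀ w → w < l → Block.SameFibre q′ w → ¬ Block.Before q′ w) →
        (∀ w → w < l → Block.SameFibre q′ w → ¬ Block.Before w z′) →
        firstReturn next s l (next q) N ≡ y*
      firstReturn-wrapping last first = reaches (t + rank y*) k<N hit skipped
        where
        t = fibreSize q ∸ suc (rank q)
        bottom = iter next t (next q)
        bottom-spec = iter-next-sameFibre (suc t) q q<N
        not-after-q : ∀ w → w < N → SameFibre q w → rank q < rank w → ¬ T (inBlock s l w)
        not-after-q w w<N fw rq<rw = outside (Before q) (λ w′ w′<l f q≺w → last w′ w′<l f (Before⇒Block q≺w)) w fw
          (rank-<⇒Before q<N w<N fw rq<rw)
        not-before-y* : ∀ w → w < N → SameFibre q w → rank w < rank y* → ¬ T (inBlock s l w)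
        not-before-y* w w<N fw rw<ry* = outside (λ w → Before w y*) (λ w′ w′<l f w≺y* → first w′ w′<l f (Before⇒Block w≺y*)) w fw
          (rank-<⇒Before w<N y*<N (SameFibre-trans (SameFibre-sym fw) fy*) rw<ry*)
        k<N : t + rank y* < N
        k<N = <-≤-trans (subst (t + rank y* <_) (trans (cong suc (+-comm t (rank q))) (m+[n∸m]≡n (rank<fibreSize q q<N)))
                                (s≤s (+-monoʳ-≤ t (≮⇒≥ (λ rq<ry* → not-after-q y* y*<N fy* rq<ry* y*-in)))))
                        (fibreSize≤N q)
        hit : iter next (t + rank y*) (next q) ≡ y*
        hit = trans (iter-+ next t (rank y*) (next q)) (iter-next-hits (rank y*) (proj₁ bottom-spec) y*<N
                (SameFibre-trans (SameFibre-sym (proj₂ bottom-spec)) fy*) (rank-iter-from-wrap q (rank y*) q<N (rank<fibreSize-of y*<N fy*)))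
        skipped : ∀ j → j < t + rank y* → ¬ T (inBlock s l (iter next j (next q)))
        skipped j j<k with j <? t
        ... | yes j<t = not-after-q _ (proj₁ w-spec) (proj₂ w-spec)
                          (subst (rank q <_) (sym (rank-iter-next (suc j) q q<N j-bound)) (m<m+n _ (s≤s z≤n)))
          where
          w-spec = iter-next-sameFibre (suc j) q q<N
          j-bound : rank q + suc j < fibreSize q
          j-bound = subst (rank q + suc j <_) (m+[n∸m]≡n (rank<fibreSize q q<N)) (s≤s (+-monoʳ-≤ (rank q) j<t))
        ... | no j≮t = subst (λ w → ¬ T (inBlock s l w)) (sym (trans (cong (λ i → iter next i (next q)) (sym t+j′≡j)) (iter-+ next t j′ (next q))))
                         (not-before-y* _ (proj₁ w-spec) (SameFibre-trans (proj₂ bottom-spec) (proj₂ w-spec))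
                           (subst (_< rank y*) (sym (rank-iter-from-wrap q j′ q<N (<-≤-trans j′<ry* (<⇒≤ (rank<fibreSize-of y*<N fy*))))) j′<ry*))
          where
          j′ = j ∸ t
          t+j′≡j : t + j′ ≡ j
          t+j′≡j = m+[n∸m]≡n (≮⇒≥ j≮t)
          j′<ry* : j′ < rank y*
          j′<ry* = +-cancelˡ-< t j′ (rank y*) (subst (_< t + rank y*) (sym t+j′≡j) j<k)
          w-spec = iter-next-sameFibre j′ bottom (proj₁ bottom-spec)

    firstReturn-next : ∀ q′ → q′ < l → firstReturn next s l (next (q′ + s)) N ≡ Block.next q′ + s
    firstReturn-next q′ q′<l =
      [ uncurry (firstReturn-forward q′ q′<l) , uncurry (firstReturn-wrapping q′ q′<l) ]′ (Block.next-cases q′ q′<l)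

  -- φ_σ is the indicator of the biwords with standard cycle σ

  noDupB⇒at-injective : ∀ l → T (noDupB l) → ∀ i j → i < length l → j < length l → at l i ≡ at l j → i ≡ j
  noDupB⇒at-injective (x ∷ l) h zero zero _ _ _ = refl
  noDupB⇒at-injective (x ∷ l) h zero (suc j) _ j< e = ⊥-elim (T-not⁻ (T-∧⁻ˡ h) (at⇒memB x l j (s≤s⁻¹ j<) (sym e)))
  noDupB⇒at-injective (x ∷ l) h (suc i) zero i< _ e = ⊥-elim (T-not⁻ (T-∧⁻ˡ h) (at⇒memB x l i (s≤s⁻¹ i<) e))
  noDupB⇒at-injective (x ∷ l) h (suc i) (suc j) i< j< e = cong suc (noDupB⇒at-injective l (T-∧⁻ʳ {not (memB x l)} h) i j (s≤s⁻¹ i<) (s≤s⁻¹ j<) e)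

  at-injective⇒noDupB : ∀ l → (∀ i j → i < length l → j < length l → at l i ≡ at l j → i ≡ j) → T (noDupB l)
  at-injective⇒noDupB [] h = tt
  at-injective⇒noDupB (x ∷ l) h = T-∧⁺ (T-not⁺ λ m → case (memB⇒at x l m))
    (at-injective⇒noDupB l (λ i j i< j< e → suc-injective (h (suc i) (suc j) (s≤s i<) (s≤s j<) e)))
    where
    case : Σ ℕ (λ i → i < length l × at l i ≡ x) → ⊥
    case (i , i< , e) with h 0 (suc i) (s≤s z≤n) (s≤s i<) (sym e)
    ... | ()

  module Valid {n : ℕ} (σ : Perm n) where
    private
      v = valid σ
    length-images : length (images σ) ≡ n
    length-images = ≡ᵇ⇒≡ _ _ (T-∧⁻ˡ v)

    app< : ∀ i → i < n → app σ i < n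
    app< i i<n = <ᵇ⇒< _ _ (all⇒at (λ v → v <ᵇ n) (images σ) (T-∧⁻ˡ (T-∧⁻ʳ {length (images σ) ≡ᵇ n} v)) i
       (subst (i <_) (sym length-images) i<n))

    app-injective : ∀ i j → i < n → j < n → app σ i ≡ app σ j → i ≡ j
    app-injective i j i<n j<n e = noDupB⇒at-injective (images σ) (T-∧⁻ʳ {all (λ v → v <ᵇ n) (images σ)} (T-∧⁻ʳ {length (images σ) ≡ᵇ n} v)) i j
      (subst (i <_) (sym length-images) i<n) (subst (j <_) (sym length-images) j<n) e

  isPermB⁺ : ∀ n l → length l ≡ n → (∀ i → i < n → at l i < n) →
    (∀ i j → i < n → j < n → at l i ≡ at l j → i ≡ j) → T (isPermB n l)
  isPermB⁺ n l e h1 h2 = T-∧⁺ (≡⇒≡ᵇ _ _ e) (T-∧⁺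
    (at⇒all (λ v → v <ᵇ n) l (λ i i< → <⇒<ᵇ (h1 i (subst (i <_) e i<))))
    (at-injective⇒noDupB l (λ i j i< j< → h2 i j (subst (i <_) e i<) (subst (j <_) e j<))))

  orbit-cong : ∀ (f g : ℕ → ℕ) n s k → (∀ z → z < n → f z ≡ g z) → (∀ z → z < n → f z < n) → s < n →
    orbit f s k ≡ orbit g s k
  orbit-cong f g n s zero h1 h2 s<n = refl
  orbit-cong f g n s (suc k) h1 h2 s<n rewrite h1 s s<n = cong (s ∷_) (orbit-cong f g n (g s) k h1 h2 (subst (_< n) (h1 s s<n) (h2 s s<n)))

  -- Within the fibre of p, listed increasingly as ps, Std of the a-letters sends i to the rank of ps[i];
  -- so Std⁻¹ lists the fibre in standard order (byRank), and condition (ii) of φ_σ says exactly that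
  -- σ steps through this list cyclically, i.e. that σ agrees with the standard cycle.
  module PhiSupport {n : ℕ} (σ : Perm n) (x a : List ℕ) where
    open StdCycle n (at x) (at a)
    τ = app σ

    XMatchesCycles : Set
    XMatchesCycles = ∀ i j → i < n → j < n → (at x i ≡ at x j → T (sameCycle σ i j)) × (T (sameCycle σ i j) → at x i ≡ at x j)

    cycleCondOn : ℕ → List ℕ → Bool
    cycleCondOn p ps = any (λ s → listEqB (stdInv (map (at a) ps)) (orbit (λ r → indexOf (τ (at ps r)) ps) s (length ps))) (upTo (length ps))

    module Fibre (p : ℕ) (p<n : p < n) where
      open FilteredRange (sameFibreᵇ p) n public renaming (range to ps)
      k = length ps
      k≡fibreSize : k ≡ fibreSize p
      k≡fibreSize = length-range
      w = map (at a) ps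
      W = stdInv w
      length-w : length w ≡ k
      length-w = length-map (at a) ps

      c̃ : ℕ → ℕ
      c̃ r = indexOf (τ (at ps r)) ps

      std-rank : ∀ i → i < k → at (std w) i ≡ rank (at ps i)
      std-rank i i<k = begin
        at (std w) i                                          ≡⟨ at-mapUpTo _ (length w) i (subst (i <_) (sym length-w) i<k) ⟩
        countBelow P₁ (length w) + countBelow P₂ (length w)   ≡⟨ cong (λ m → countBelow P₁ m + countBelow P₂ m) length-w ⟩
        countBelow P₁ k + countBelow P₂ k                     ≡⟨ sym (countBelow-∨ P₁ P₂ k disjoint) ⟩
        countBelow (λ j → P₁ j ∨ P₂ j) k                      ≡⟨ countBelow-cong _ _ k std-order ⟩
        countBelow (λ j → beforeᵇ (at ps j) y) k              ≡⟨ sym (count-at (λ z → beforeᵇ z y) ps) ⟩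
        count (λ z → beforeᵇ z y) ps                          ≡⟨ count-filter (λ z → beforeᵇ z y) (sameFibreᵇ p) (upTo n) ⟩
        countBelow (λ z → sameFibreᵇ p z ∧ beforeᵇ z y) n     ≡⟨ countBelow-cong _ _ n (λ z _ → cong (_∧ beforeᵇ z y) (sameFibreᵇ-cong fpy z)) ⟩
        rank y                                                ∎
        where
        open ≡-Reasoning
        y = at ps i
        fpy : SameFibre p y
        fpy = proj₂ (range-elem i i<k)
        P₁ P₂ : ℕ → Bool
        P₁ j = at w j <ᵇ at w i
        P₂ j = (j <ᵇ i) ∧ (at w j ≡ᵇ at w i)
        disjoint : ∀ j → j < k → ¬ (T (P₁ j) × T (P₂ j))
        disjoint j _ (h₁ , h₂) = <-irrefl (≡ᵇ⇒≡ (at w j) (at w i) (T-∧⁻ʳ {j <ᵇ i} h₂)) (<ᵇ⇒< _ _ h₁)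
        index-order : ∀ j → j < k → (j <ᵇ i) ≡ (at ps j <ᵇ at ps i)
        index-order j j<k = T-injective (λ h → <⇒<ᵇ (range-mono j i (<ᵇ⇒< j i h) i<k)) (λ h → <⇒<ᵇ (back (<ᵇ⇒< _ _ h)))
          where
          back : at ps j < at ps i → j < i
          back lt with <-cmp j i
          ... | tri< j<i _ _ = j<i
          ... | tri≈ _ refl _ = ⊥-elim (<-irrefl refl lt)
          ... | tri> _ _ i<j = ⊥-elim (<-asym lt (range-mono i j i<j j<k))
        std-order : ∀ j → j < k → (P₁ j ∨ P₂ j) ≡ beforeᵇ (at ps j) y
        std-order j j<k rewrite at-map (at a) ps j j<k | at-map (at a) ps i i<k | index-order j j<k = refl

      length-stdInv : length W ≡ k
      length-stdInv = trans (length-mapUpTo _ (length w)) length-w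

      private
        stdInv-rank : ∀ t → t < k → Σ ℕ λ z → z < n × SameFibre p z × rank z ≡ t × at W t < k × at ps (at W t) ≡ z
        stdInv-rank t t<k with rank-surjective p p<n t (subst (t <_) k≡fibreSize t<k)
        ... | z , z<n , fz , rz with range-find z z<n fz
        ...   | r , r<k , er = z , z<n , fz , rz , subst (_< k) (sym W[t]≡r) r<k , trans (cong (at ps) W[t]≡r) er
          where
          earlier-rank : ∀ j → j < r → at (std w) j ≢ t
          earlier-rank j j<r e = <-irrefl (range-injective j r (<-trans j<r r<k) r<k
            (trans (rank-injective (proj₁ (range-elem j (<-trans j<r r<k))) z<n
                     (SameFibre-trans (SameFibre-sym (proj₂ (range-elem j (<-trans j<r r<k)))) fz)
                     (trans (sym (std-rank j (<-trans j<r r<k))) (trans e (sym rz)))) (sym er))) j<r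
          W[t]≡r : at W t ≡ r
          W[t]≡r = trans (at-mapUpTo _ (length w) t (subst (t <_) (sym length-w) t<k))
            (indexOf-first t (std w) r (subst (r <_) (sym (trans (length-mapUpTo _ (length w)) length-w)) r<k)
              (trans (std-rank r r<k) (trans (cong rank er) rz)) earlier-rank)

      byRank : ℕ → ℕ
      byRank t = at ps (at W t)

      at-stdInv< : ∀ t → t < k → at W t < k
      at-stdInv< t t<k = proj₁ (proj₂ (proj₂ (proj₂ (proj₂ (stdInv-rank t t<k)))))

      byRank< : ∀ t → t < k → byRank t < n
      byRank< t t<k = subst (_< n) (sym (proj₂ (proj₂ (proj₂ (proj₂ (proj₂ (stdInv-rank t t<k))))))) (proj₁ (proj₂ (stdInv-rank t t<k)))

      byRank-sameFibre : ∀ t → t < k → SameFibre p (byRank t)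
      byRank-sameFibre t t<k = subst (SameFibre p) (sym (proj₂ (proj₂ (proj₂ (proj₂ (proj₂ (stdInv-rank t t<k)))))))
        (proj₁ (proj₂ (proj₂ (stdInv-rank t t<k))))

      rank-byRank : ∀ t → t < k → rank (byRank t) ≡ t
      rank-byRank t t<k = trans (cong rank (proj₂ (proj₂ (proj₂ (proj₂ (proj₂ (stdInv-rank t t<k)))))))
        (proj₁ (proj₂ (proj₂ (proj₂ (stdInv-rank t t<k)))))

      byRank-unique : ∀ {t z} → t < k → z < n → SameFibre p z → rank z ≡ t → byRank t ≡ z
      byRank-unique {t} t<k z<n fz rz =
        rank-injective (byRank< t t<k) z<n (SameFibre-trans (SameFibre-sym (byRank-sameFibre t t<k)) fz) (trans (rank-byRank t t<k) (sym rz))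

      next-byRank : ∀ t → suc t < k → next (byRank t) ≡ byRank (suc t)
      next-byRank t st<k = sym (byRank-unique st<k (next< _ z<n) (SameFibre-trans fz (next-sameFibre _ z<n))
        (trans (rank-next _ z<n (subst₂ _<_ (cong suc (sym (rank-byRank t t<k))) (trans k≡fibreSize (fibreSize-cong fz)) st<k))
               (cong suc (rank-byRank t t<k))))
        where
        t<k = <-trans (n<1+n t) st<k
        z<n = byRank< t t<k
        fz = byRank-sameFibre t t<k

      indexOf-byRank : ∀ t → t < k → indexOf (byRank t) ps ≡ at W t
      indexOf-byRank t t<k = indexOf-range (at W t) (at-stdInv< t t<k)

      fibre-nonempty : 0 < k
      fibre-nonempty = subst (0 <_) (sym k≡fibreSize) (≤-<-trans z≤n (rank<fibreSize p p<n))

      stdInv-orbit : (∀ t → suc t < k → at W (suc t) ≡ c̃ (at W t)) → W ≡ orbit c̃ (at W 0) k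
      stdInv-orbit step = at-ext W (orbit c̃ (at W 0) k) (trans length-stdInv (sym (length-orbit c̃ (at W 0) k)))
          (λ t t< → let t<k = subst (t <_) length-stdInv t< in trans (iterated t t<k) (sym (at-orbit c̃ (at W 0) k t t<k)))
        where
        iterated : ∀ t → t < k → at W t ≡ iter c̃ t (at W 0)
        iterated zero _ = refl
        iterated (suc t) st<k = trans (step t st<k) (trans (cong c̃ (iterated t (<-trans (n<1+n t) st<k))) (sym (iter-suc c̃ t (at W 0))))

      orbit-stdInv : ∀ s → W ≡ orbit c̃ s k → ∀ t → suc t < k → at W (suc t) ≡ c̃ (at W t)
      orbit-stdInv s W≡ t st<k = begin
        at W (suc t)              ≡⟨ cong (λ o → at o (suc t)) W≡ ⟩
        at (orbit c̃ s k) (suc t)  ≡⟨ at-orbit c̃ s k (suc t) st<k ⟩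
        iter c̃ (suc t) s          ≡⟨ iter-suc c̃ t s ⟩
        c̃ (iter c̃ t s)            ≡⟨ cong c̃ (sym (trans (cong (λ o → at o t) W≡) (at-orbit c̃ s k t (<-trans (n<1+n t) st<k)))) ⟩
        c̃ (at W t)                ∎
        where open ≡-Reasoning

    support-fibre : XMatchesCycles → ∀ p → p < n → support σ p ≡ filter (λ z → T? (sameFibreᵇ p z)) (upTo n)
    support-fibre matches p p<n = filter-cong _ _ (upTo n) (λ z z∈ → let z<n = ∈-upTo⁻ z∈ in
      T-injective (λ h → ≡⇒≡ᵇ _ _ (sym (proj₂ (matches p z p<n z<n) h))) (λ h → proj₁ (matches p z p<n z<n) (sym (≡ᵇ⇒≡ _ _ h))))

    sameCycle-app : ∀ i → i < n → T (sameCycle σ i (τ i))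
    sameCycle-app i i<n with 2 ≤? n
    ... | yes 2≤n = at⇒memB (τ i) (orbit τ i n) 1 (subst (1 <_) (sym (length-orbit τ i n)) 2≤n) (at-orbit τ i n 1 2≤n)
    ... | no n≱2 = at⇒memB (τ i) (orbit τ i n) 0 (subst (0 <_) (sym (length-orbit τ i n)) (≤-<-trans z≤n i<n))
         (trans (at-orbit τ i n 0 (≤-<-trans z≤n i<n)) (trans (only-0 i<n) (sym (only-0 (Valid.app< σ i i<n)))))
      where
      only-0 : ∀ {v} → v < n → v ≡ 0
      only-0 {zero} _ = refl
      only-0 {suc v} h = ⊥-elim (n≱2 (<-≤-trans (s≤s (s≤s z≤n)) h))

    -- The test eqB of condition (i) is local to phiCond, so in the types of eqB-intro and eqB-elim its instance
    -- is left to unification, which solves it from the mutually defined lemma checked before their clauses.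
    mutual
      eqB-intro : ∀ i j → (at x i ≡ at x j → T (sameCycle σ i j)) → (T (sameCycle σ i j) → at x i ≡ at x j) → T _
      next⇒phiCond : length x ≡ n → length a ≡ n → (∀ i → i < n → τ i ≡ next i) → T (phiCond σ x a)
      next⇒phiCond lx la τ≡next = T-∧⁺ (≡⇒≡ᵇ _ _ lx) (T-∧⁺ (≡⇒≡ᵇ _ _ la) (T-∧⁺
          (all-upTo⁺ _ n (λ i i<n → all-upTo⁺ _ n (λ j j<n → eqB-intro i j (proj₁ (matches i j i<n j<n)) (proj₂ (matches i j i<n j<n)))))
          (all-upTo⁺ _ n cycles)))
        where
        orbit-next : ∀ i → i < n → orbit τ i n ≡ orbit next i n
        orbit-next i i<n = orbit-cong τ next n i n τ≡next (Valid.app< σ) i<n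
        matches : XMatchesCycles
        matches i j i<n j<n = to , from
          where
          to : at x i ≡ at x j → T (sameCycle σ i j)
          to e with iter-next-covers i j i<n j<n (≡⇒≡ᵇ (at x j) (at x i) (sym e))
          ... | t , t<sz , hit = at⇒memB j (orbit τ i n) t (subst (t <_) (sym (length-orbit τ i n)) t<n)
                (trans (cong (λ o → at o t) (orbit-next i i<n)) (trans (at-orbit next i n t t<n) hit))
            where t<n = <-≤-trans t<sz (fibreSize≤N i)
          from : T (sameCycle σ i j) → at x i ≡ at x j
          from h with memB⇒at j (orbit τ i n) h
          ... | t , t< , hit = sym (≡ᵇ⇒≡ (at x j) (at x i) (subst (SameFibre i)
                 (trans (sym (at-orbit next i n t t<n)) (trans (cong (λ o → at o t) (sym (orbit-next i i<n))) hit))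
                 (proj₂ (iter-next-sameFibre t i i<n))))
            where t<n = subst (t <_) (length-orbit τ i n) t<
        cycles : ∀ p → p < n → T (cycleCond σ a p)
        cycles p p<n = subst T (sym (cong (cycleCondOn p) (support-fibre matches p p<n)))
            (any-upTo⁺ _ k (at W 0) (at-stdInv< 0 fibre-nonempty)
              (subst (λ o → T (listEqB W o)) (stdInv-orbit step) (listEqB-refl W)))
          where
          open Fibre p p<n
          step : ∀ t → suc t < k → at W (suc t) ≡ c̃ (at W t)
          step t st<k = sym (trans (cong (λ v → indexOf v ps) (trans (τ≡next _ (byRank< t (<-trans (n<1+n t) st<k))) (next-byRank t st<k)))
                                   (indexOf-byRank (suc t) st<k))

      eqB-intro i j to from with at x i ≡ᵇ at x j in eq
      ... | true = to (≡ᵇ⇒≡ _ _ (subst T (sym eq) tt))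
      ... | false with sameCycle σ i j in eq′
      ...   | true = ⊥-elim (subst T eq (≡⇒≡ᵇ _ _ (from tt)))
      ...   | false = tt

    mutual
      eqB-elim : ∀ i j → T _ → (at x i ≡ at x j → T (sameCycle σ i j)) × (T (sameCycle σ i j) → at x i ≡ at x j)
      phiCond⇒matches : T (phiCond σ x a) → XMatchesCycles
      phiCond⇒matches h i j i<n j<n = eqB-elim i j
        (all-upTo⁻ _ n (all-upTo⁻ _ n (T-∧⁻ˡ (T-∧⁻ʳ {length a ≡ᵇ n} (T-∧⁻ʳ {length x ≡ᵇ n} h))) i i<n) j j<n)
      eqB-elim i j r with at x i ≡ᵇ at x j in eq
      ... | true = (λ _ → r) , (λ _ → ≡ᵇ⇒≡ _ _ (subst T (sym eq) tt))
      ... | false = (λ e → ⊥-elim (subst T eq (≡⇒≡ᵇ _ _ e))) , (λ s → ⊥-elim (T-not⁻ r s))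

    module PhiCond (h : T (phiCond σ x a)) where
      length-x : length x ≡ n
      length-x = ≡ᵇ⇒≡ _ _ (T-∧⁻ˡ h)

      matches : XMatchesCycles
      matches = phiCond⇒matches h

      cycles : ∀ p → p < n → T (cycleCondOn p (filter (λ z → T? (sameFibreᵇ p z)) (upTo n)))
      cycles p p<n = subst T (cong (cycleCondOn p) (support-fibre matches p p<n))
        (all-upTo⁻ _ n (T-∧⁻ʳ {all _ (upTo n)} (T-∧⁻ʳ {length a ≡ᵇ n} (T-∧⁻ʳ {length x ≡ᵇ n} h))) p p<n)

      app-sameFibre : ∀ z → z < n → SameFibre z (τ z)
      app-sameFibre z z<n = ≡⇒≡ᵇ _ _ (sym (proj₂ (matches z (τ z) z<n (Valid.app< σ z z<n)) (sameCycle-app z z<n)))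

      module _ (y : ℕ) (y<n : y < n) where
        open Fibre y y<n
        private
          τy<n = Valid.app< σ y y<n
          fτy = app-sameFibre y y<n

        app-byRank : ∀ t → suc t < k → τ (byRank t) ≡ byRank (suc t)
        app-byRank t st<k with any-upTo⁻ _ k (cycles y y<n)
        ... | s , _ , W≡ = begin
          τ z                         ≡⟨ sym (proj₂ (indexOf-range-∈ (τ z) (Valid.app< σ z z<n) (SameFibre-trans fz (app-sameFibre z z<n)))) ⟩
          at ps (c̃ (at W t))          ≡⟨ cong (at ps) (sym (orbit-stdInv s (listEqB⇒≡ _ _ W≡) t st<k)) ⟩
          byRank (suc t)              ∎
          where
          open ≡-Reasoning
          z = byRank t
          z<n = byRank< t (<-trans (n<1+n t) st<k)
          fz = byRank-sameFibre t (<-trans (n<1+n t) st<k)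

        app≡next-inner : ∀ z → z < n → SameFibre y z → suc (rank z) < k → τ z ≡ next z
        app≡next-inner z z<n fz sr<k = begin
          τ z                          ≡⟨ cong τ (sym z≡) ⟩
          τ (byRank (rank z))          ≡⟨ app-byRank (rank z) sr<k ⟩
          byRank (suc (rank z))        ≡⟨ sym (next-byRank (rank z) sr<k) ⟩
          next (byRank (rank z))       ≡⟨ cong next z≡ ⟩
          next z                       ∎
          where
          open ≡-Reasoning
          z≡ : byRank (rank z) ≡ z
          z≡ = byRank-unique (<-trans (n<1+n _) sr<k) z<n fz refl

        -- The last element of the fibre must be sent to its first one: any other target is already
        -- the image of an earlier element.
        app≡next-last : suc (rank y) ≡ k → τ y ≡ next y
        app≡next-last last with rank (τ y) in rτy
        ... | zero = rank-injective τy<n (next< y y<n) (SameFibre-trans (SameFibre-sym fτy) (next-sameFibre y y<n))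
                       (trans rτy (sym (rank-next-wrap y y<n (trans last k≡fibreSize))))
        ... | suc r = ⊥-elim (<-irrefl (trans (cong suc (sym ry≡r)) last) r+1<k)
          where
          r+1<k : suc r < k
          r+1<k = subst (_< k) rτy (subst (rank (τ y) <_) (sym (trans k≡fibreSize (fibreSize-cong fτy))) (rank<fibreSize (τ y) τy<n))
          r<k = <-trans (n<1+n r) r+1<k
          y≡byRank : y ≡ byRank r
          y≡byRank = sym (Valid.app-injective σ (byRank r) y (byRank< r r<k) y<n
                       (trans (app-byRank r r+1<k) (byRank-unique r+1<k τy<n fτy rτy)))
          ry≡r : rank y ≡ r
          ry≡r = trans (cong rank y≡byRank) (rank-byRank r r<k)

      app≡next : ∀ y → y < n → τ y ≡ next y
      app≡next y y<n with suc (rank y) ≟ Fibre.k y y<n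
      ... | yes last = app≡next-last y y<n last
      ... | no ne = app≡next-inner y y<n y y<n (SameFibre-refl y)
                      (≤∧≢⇒< (subst (rank y <_) (sym (Fibre.k≡fibreSize y y<n)) (rank<fibreSize y y<n)) ne)

  module Cycles {N : ℕ} (σ : Perm N) where
    τ = app σ
    τ< = Valid.app< σ
    τinj = Valid.app-injective σ

    iter< : ∀ t i → i < N → iter τ t i < N
    iter< zero i i<N = i<N
    iter< (suc t) i i<N = iter< t (τ i) (τ< i i<N)

    iter-cancel : ∀ t i j → i < N → j < N → iter τ t i ≡ iter τ t j → i ≡ j
    iter-cancel zero i j _ _ e = e
    iter-cancel (suc t) i j i<N j<N e = τinj i j i<N j<N (iter-cancel t (τ i) (τ j) (τ< i i<N) (τ< j j<N) e)

    period : ∀ i → i < N → Σ ℕ λ p → 0 < p × p ≤ N × iter τ p i ≡ i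
    period i i<N with FP.pigeonhole (n<1+n N) (λ t → fromℕ< (iter< (toℕ t) i i<N))
    ... | t , t′ , t<t′ , e = d , d>0 , d≤N , sym (iter-cancel (toℕ t) i (iter τ d i) i<N (iter< d i i<N) eq)
      where
      a = toℕ t
      b = toℕ t′
      a<b : a < b
      a<b = FP.toℕ-mono-< t<t′
      d = b ∸ a
      d>0 : 0 < d
      d>0 = m<n⇒0<n∸m a<b
      d≤N : d ≤ N
      d≤N = ≤-trans (m∸n≤m b a) (s≤s⁻¹ (FP.toℕ<n t′))
      e′ : iter τ a i ≡ iter τ b i
      e′ = trans (sym (FP.toℕ-fromℕ< (iter< a i i<N))) (trans (cong toℕ e) (FP.toℕ-fromℕ< (iter< b i i<N)))
      eq : iter τ a i ≡ iter τ a (iter τ d i)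
      eq = trans e′ (trans (cong (λ v → iter τ v i) (sym (trans (+-comm d a) (m+[n∸m]≡n (<⇒≤ a<b))))) (iter-+ τ d a i))

    iter-mod-period : ∀ i p → iter τ p i ≡ i → 0 < p → ∀ t → Σ ℕ λ t′ → t′ < p × iter τ t′ i ≡ iter τ t i
    iter-mod-period i p e p>0 zero = 0 , p>0 , refl
    iter-mod-period i p e p>0 (suc t) with iter-mod-period i p e p>0 t
    ... | t′ , t′<p , e′ with suc t′ ≟ p
    ...   | yes sp = 0 , p>0 , trans (sym e) (trans (cong (λ v → iter τ v i) (sym sp)) (trans (iter-suc τ t′ i) (trans (cong τ e′) (sym (iter-suc τ t i)))))
    ...   | no ne = suc t′ , ≤∧≢⇒< t′<p ne , trans (iter-suc τ t′ i) (trans (cong τ e′) (sym (iter-suc τ t i)))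

    Orbit : ℕ → ℕ → Set
    Orbit i j = Σ ℕ λ t → iter τ t i ≡ j

    Orbit-bounded : ∀ {i j} → i < N → Orbit i j → Σ ℕ λ t → t < N × iter τ t i ≡ j
    Orbit-bounded {i} i<N (t , e) with period i i<N
    ... | p , p>0 , p≤N , ep with iter-mod-period i p ep p>0 t
    ...   | t′ , t′<p , e′ = t′ , <-≤-trans t′<p p≤N , trans e′ e

    Orbit-sym : ∀ {i j} → i < N → Orbit i j → Orbit j i
    Orbit-sym {i} {j} i<N (t , e) with period i i<N
    ... | p , p>0 , p≤N , ep with iter-mod-period i p ep p>0 t
    ...   | t′ , t′<p , e′ = p ∸ t′ , trans (cong (iter τ (p ∸ t′)) (sym (trans e′ e)))
            (trans (sym (iter-+ τ t′ (p ∸ t′) i)) (trans (cong (λ v → iter τ v i) (m+[n∸m]≡n (<⇒≤ t′<p))) ep))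

    Orbit-trans : ∀ {i j k} → Orbit i j → Orbit j k → Orbit i k
    Orbit-trans {i} (t1 , e1) (t2 , e2) = t1 + t2 , trans (iter-+ τ t1 t2 i) (trans (cong (iter τ t2) e1) e2)

    sameCycle⇒Orbit : ∀ i j → T (sameCycle σ i j) → Orbit i j
    sameCycle⇒Orbit i j h with memB⇒at j (orbit τ i N) h
    ... | t , t< , e = t , trans (sym (at-orbit τ i N t (subst (t <_) (length-orbit τ i N) t<))) e

    Orbit⇒sameCycle : ∀ i j → i < N → Orbit i j → T (sameCycle σ i j)
    Orbit⇒sameCycle i j i<N o with Orbit-bounded i<N o
    ... | t , t<N , e = at⇒memB j (orbit τ i N) t (subst (t <_) (sym (length-orbit τ i N)) t<N)
          (trans (at-orbit τ i N t t<N) e)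

    leader : ℕ → ℕ
    leader i = first (sameCycle σ i) N

    leader-spec : ∀ i → i < N → leader i ≤ i × T (sameCycle σ i (leader i)) × (∀ w → w < leader i → ¬ T (sameCycle σ i w))
    leader-spec i i<N = first-spec (sameCycle σ i) N i i<N (Orbit⇒sameCycle i i i<N (0 , refl))

    leader< : ∀ i → i < N → leader i < N
    leader< i i<N = ≤-<-trans (proj₁ (leader-spec i i<N)) i<N

    Orbit-leader : ∀ i → i < N → Orbit i (leader i)
    Orbit-leader i i<N = sameCycle⇒Orbit i (leader i) (proj₁ (proj₂ (leader-spec i i<N)))

    Orbit⇒leader≡ : ∀ i j → i < N → j < N → Orbit i j → leader i ≡ leader j
    Orbit⇒leader≡ i j i<N j<N o = first-cong _ _ N (λ z z<N → T-injective
      (λ h → Orbit⇒sameCycle j z j<N (Orbit-trans (Orbit-sym i<N o) (sameCycle⇒Orbit i z h)))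
      (λ h → Orbit⇒sameCycle i z i<N (Orbit-trans o (sameCycle⇒Orbit j z h))))

    offset : ℕ → ℕ
    offset i = first (λ t → iter τ t (leader i) ≡ᵇ i) N

    offset-spec : ∀ i → i < N → offset i < N × iter τ (offset i) (leader i) ≡ i × (∀ t → t < offset i → iter τ t (leader i) ≢ i)
    offset-spec i i<N = ≤-<-trans (proj₁ fs) t<N , ≡ᵇ⇒≡ (iter τ (offset i) (leader i)) i (proj₁ (proj₂ fs)) ,
        λ w w< e′ → proj₂ (proj₂ fs) w w< (≡⇒≡ᵇ (iter τ w (leader i)) i e′)
      where
      P : ℕ → Bool
      P t = iter τ t (leader i) ≡ᵇ i
      o : Σ ℕ λ t → t < N × iter τ t (leader i) ≡ i
      o = Orbit-bounded (leader< i i<N) (Orbit-sym i<N (Orbit-leader i i<N))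
      t = proj₁ o
      t<N : t < N
      t<N = proj₁ (proj₂ o)
      fs : first P N ≤ t × T (P (first P N)) × (∀ w → w < first P N → ¬ T (P w))
      fs = first-spec P N t t<N (≡⇒≡ᵇ (iter τ t (leader i)) i (proj₂ (proj₂ o)))

    offset-unique : ∀ z r t0 → z < N → leader z ≡ r → t0 < N → iter τ t0 r ≡ z → (∀ t → t < t0 → iter τ t r ≢ z) → offset z ≡ t0
    offset-unique z r t0 z<N er t0<N e mn = trans (first-cong P Q N (λ t _ → cong (λ v → iter τ t v ≡ᵇ z) er))
        (first-least Q N t0 t0<N (≡⇒≡ᵇ (iter τ t0 r) z e) (λ w w< h → mn w w< (≡ᵇ⇒≡ (iter τ w r) z h)))
      where
      P Q : ℕ → Bool
      P t = iter τ t (leader z) ≡ᵇ z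
      Q t = iter τ t r ≡ᵇ z

    cycleLength : ℕ → ℕ
    cycleLength r = suc (first (λ t → iter τ (suc t) r ≡ᵇ r) N)

    cycleLength-spec : ∀ r → r < N → cycleLength r ≤ N × iter τ (cycleLength r) r ≡ r × (∀ t → t < N → iter τ (suc t) r ≡ r → cycleLength r ≤ suc t)
    cycleLength-spec r r<N = ≤-trans (s≤s (proj₁ found)) (subst (_≤ N) (sym p-1+1) p≤N) ,
        ≡ᵇ⇒≡ (iter τ (cycleLength r) r) r (proj₁ (proj₂ found)) ,
        λ t t<N e → s≤s (proj₁ (first-spec P N t t<N (≡⇒≡ᵇ (iter τ (suc t) r) r e)))
      where
      P : ℕ → Bool
      P t = iter τ (suc t) r ≡ᵇ r
      p-spec = period r r<N
      p = proj₁ p-spec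
      p≤N : p ≤ N
      p≤N = proj₁ (proj₂ (proj₂ p-spec))
      p-1+1 : suc (p ∸ 1) ≡ p
      p-1+1 = trans (+-comm 1 (p ∸ 1)) (m∸n+n≡m (proj₁ (proj₂ p-spec)))
      found : first P N ≤ p ∸ 1 × T (P (first P N)) × (∀ w → w < first P N → ¬ T (P w))
      found = first-spec P N (p ∸ 1) (subst (_≤ N) (sym p-1+1) p≤N)
        (≡⇒≡ᵇ (iter τ (suc (p ∸ 1)) r) r (trans (cong (λ v → iter τ v r) p-1+1) (proj₂ (proj₂ (proj₂ p-spec)))))

    offset<cycleLength : ∀ i → i < N → offset i < cycleLength (leader i)
    offset<cycleLength i i<N = ≰⇒> λ L≤d → proj₂ (proj₂ (offset-spec i i<N)) (d ∸ L) (∸-monoʳ-< (s≤s z≤n) L≤d)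
          (trans (sym (cong (iter τ (d ∸ L)) back)) (trans (sym (iter-+ τ L (d ∸ L) r))
            (trans (cong (λ v → iter τ v r) (m+[n∸m]≡n L≤d)) (proj₁ (proj₂ (offset-spec i i<N))))))
      where
      r = leader i
      d = offset i
      L = cycleLength r
      back : iter τ L r ≡ r
      back = proj₁ (proj₂ (cycleLength-spec r (leader< i i<N)))

    -- In the biword (leader, offset) the fibres are the cycles of σ, each ordered by offset, i.e. along the cycle.
    module CanonStd = StdCycle N leader offset

    sameFibre⇒leader≡ : ∀ {y z} → CanonStd.SameFibre y z → leader z ≡ leader y
    sameFibre⇒leader≡ {y} {z} = ≡ᵇ⇒≡ (leader z) (leader y)

    leader-offset-injective : ∀ {y z} → y < N → z < N → leader y ≡ leader z → offset y ≡ offset z → y ≡ z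
    leader-offset-injective {y} {z} y<N z<N er ed = trans (sym (proj₁ (proj₂ (offset-spec y y<N))))
      (trans (cong₂ (iter τ) ed er) (proj₁ (proj₂ (offset-spec z z<N))))

    Before⇒offset< : ∀ {y w} → y < N → w < N → CanonStd.SameFibre y w → CanonStd.Before y w → offset y < offset w
    Before⇒offset< {y} {w} y<N w<N f l with CanonStd.Before⇒Before′ l
    ... | inj₁ d<d′ = d<d′
    ... | inj₂ (y<w , e) = ⊥-elim (<-irrefl (leader-offset-injective y<N w<N (sym (sameFibre⇒leader≡ f)) e) y<w)

    module _ (y : ℕ) (y<N : y < N) where
      private
        r = leader y
        d = offset y
        r<N = leader< y y<N
        τy<N = τ< y y<N
        leader-app : leader y ≡ leader (τ y)
        leader-app = Orbit⇒leader≡ y (τ y) y<N τy<N (1 , refl)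
        fτ : CanonStd.SameFibre y (τ y)
        fτ = ≡⇒≡ᵇ (leader (τ y)) (leader y) (sym leader-app)
        iter-suc-offset : iter τ (suc d) r ≡ τ y
        iter-suc-offset = trans (iter-suc τ d r) (cong τ (proj₁ (proj₂ (offset-spec y y<N))))

      next-canonical-step : τ y ≢ r → CanonStd.next y ≡ τ y
      next-canonical-step τy≢r = CanonStd.next-successor y<N τy<N fτ y≺τy nothing-between
        where
        suc-d<N : suc d < N
        suc-d<N = <-≤-trans (≤∧≢⇒< (offset<cycleLength y y<N)
                    (λ e → τy≢r (trans (sym iter-suc-offset) (trans (cong (λ v → iter τ v r) e) (proj₁ (proj₂ (cycleLength-spec r r<N)))))))
                  (proj₁ (cycleLength-spec r r<N))
        not-earlier : ∀ t → t < suc d → iter τ t r ≢ τ y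
        not-earlier zero _ e = τy≢r (sym e)
        not-earlier (suc t) t<sd e = proj₂ (proj₂ (offset-spec y y<N)) t (s≤s⁻¹ t<sd)
          (τinj (iter τ t r) y (iter< t r r<N) y<N (trans (sym (iter-suc τ t r)) e))
        offset-τy : offset (τ y) ≡ suc d
        offset-τy = offset-unique (τ y) r (suc d) τy<N (sym leader-app) suc-d<N iter-suc-offset not-earlier
        y≺τy : CanonStd.Before y (τ y)
        y≺τy = CanonStd.Before′⇒Before (inj₁ (subst (d <_) (sym offset-τy) ≤-refl))
        nothing-between : ∀ w → w < N → CanonStd.SameFibre y w → CanonStd.Before y w → ¬ CanonStd.Before w (τ y)
        nothing-between w w<N fw y≺w w≺τy = <-irrefl refl (<-≤-trans (Before⇒offset< y<N w<N fw y≺w)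
          (s≤s⁻¹ (subst (offset w <_) offset-τy (Before⇒offset< w<N τy<N (CanonStd.SameFibre-trans (CanonStd.SameFibre-sym fw) fτ) w≺τy))))

      next-canonical-wrap : τ y ≡ r → CanonStd.next y ≡ τ y
      next-canonical-wrap τy≡r = CanonStd.next-wrap y<N τy<N fτ y-last τy-first
        where
        cycle≤suc-d : cycleLength r ≤ suc d
        cycle≤suc-d = proj₂ (proj₂ (cycleLength-spec r r<N)) d (proj₁ (offset-spec y y<N)) (trans iter-suc-offset τy≡r)
        y-last : ∀ w → w < N → CanonStd.SameFibre y w → ¬ CanonStd.Before y w
        y-last w w<N fw y≺w = <-irrefl refl (<-≤-trans (Before⇒offset< y<N w<N fw y≺w)
          (s≤s⁻¹ (≤-trans (subst (λ v → offset w < cycleLength v) (sameFibre⇒leader≡ fw) (offset<cycleLength w w<N)) cycle≤suc-d)))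
        offset-τy : offset (τ y) ≡ 0
        offset-τy = trans (cong offset τy≡r)
          (offset-unique r r 0 r<N (sym (Orbit⇒leader≡ y r y<N r<N (Orbit-leader y y<N))) (≤-<-trans z≤n r<N) refl (λ t ()))
        τy-first : ∀ w → w < N → CanonStd.SameFibre y w → ¬ CanonStd.Before w (τ y)
        τy-first w w<N fw w≺τy = n≮0 (subst (offset w <_) offset-τy
          (Before⇒offset< w<N τy<N (CanonStd.SameFibre-trans (CanonStd.SameFibre-sym fw) fτ) w≺τy))

    next-canonical : ∀ y → y < N → CanonStd.next y ≡ τ y
    next-canonical y y<N with τ y ≟ leader y
    ... | yes τy≡r = next-canonical-wrap y y<N τy≡r
    ... | no τy≢r = next-canonical-step y y<N τy≢r

  xWord : Monomial → List ℕ
  xWord m = map proj₁ m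

  aWord : Monomial → List ℕ
  aWord m = map proj₂ m

  X[_] : Monomial → ℕ → ℕ
  X[ m ] = at (xWord m)

  A[_] : Monomial → ℕ → ℕ
  A[ m ] = at (aWord m)

  module Std (m : Monomial) = StdCycle (length m) X[ m ] A[ m ]

  next-length-cong : ∀ {N N′} (X A : ℕ → ℕ) → N ≡ N′ → ∀ i → StdCycle.next N X A i ≡ StdCycle.next N′ X A i
  next-length-cong X A refl i = refl

  stdCycle : Monomial → List ℕ
  stdCycle m = map (Std.next m) (upTo (length m))

  at-stdCycle : ∀ m i → i < length m → at (stdCycle m) i ≡ Std.next m i
  at-stdCycle m i i< = at-mapUpTo (Std.next m) (length m) i i<

  length-stdCycle : ∀ m → length (stdCycle m) ≡ length m
  length-stdCycle m = length-mapUpTo (Std.next m) (length m)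

  stdCycle-isPerm : ∀ m → T (isPermB (length m) (stdCycle m))
  stdCycle-isPerm m = isPermB⁺ (length m) (stdCycle m) (length-stdCycle m)
    (λ i i< → subst (_< length m) (sym (at-stdCycle m i i<)) (Std.next< m i i<))
    (λ i j i< j< e → Std.next-injective m i< j< (trans (sym (at-stdCycle m i i<)) (trans e (at-stdCycle m j j<))))

  stdPerm : ∀ m → Perm (length m)
  stdPerm m = perm (stdCycle m) (stdCycle-isPerm m)

  length-xWord : ∀ m → length (xWord m) ≡ length m
  length-xWord m = length-map proj₁ m

  length-aWord : ∀ m → length (aWord m) ≡ length m
  length-aWord m = length-map proj₂ m

  phiCond⇒stdCycle : ∀ {n} (σ : Perm n) m → T (phiCond σ (xWord m) (aWord m)) → Σ (length m ≡ n) λ e → images σ ≡ stdCycle m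
  phiCond⇒stdCycle {n} σ m h = length-m , at-ext (images σ) (stdCycle m)
      (trans (Valid.length-images σ) (trans (sym length-m) (sym (length-stdCycle m))))
      (λ i i< → let i<n = subst (i <_) (Valid.length-images σ) i< in
        trans (PhiCond.app≡next i i<n)
              (trans (next-length-cong X[ m ] A[ m ] (sym length-m) i) (sym (at-stdCycle m i (subst (i <_) (sym length-m) i<n)))))
    where
    module PhiCond = PhiSupport.PhiCond σ (xWord m) (aWord m) h
    length-m : length m ≡ n
    length-m = trans (sym (length-xWord m)) PhiCond.length-x

  stdCycle⇒phiCond : ∀ {n} (σ : Perm n) m → length m ≡ n → images σ ≡ stdCycle m → T (phiCond σ (xWord m) (aWord m))
  stdCycle⇒phiCond {n} σ m length-m σ≡ = PhiSupport.next⇒phiCond σ (xWord m) (aWord m)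
    (trans (length-xWord m) length-m) (trans (length-aWord m) length-m)
    (λ i i<n → trans (cong (λ l → at l i) σ≡)
                 (trans (at-stdCycle m i (subst (i <_) (sym length-m) i<n)) (next-length-cong X[ m ] A[ m ] length-m i)))

  canonical : ∀ {n} → Perm n → Monomial
  canonical {n} σ = map (λ i → Cycles.leader σ i , Cycles.offset σ i) (upTo n)

  length-canonical : ∀ {n} (σ : Perm n) → length (canonical σ) ≡ n
  length-canonical {n} σ = trans (length-map _ (upTo n)) (length-upTo n)

  xWord-canonical : ∀ {n} (σ : Perm n) i → i < n → X[ canonical σ ] i ≡ Cycles.leader σ i
  xWord-canonical {n} σ i i<n = trans (cong (λ l → at l i) (sym (map-∘ {g = proj₁} {f = λ i → Cycles.leader σ i , Cycles.offset σ i} (upTo n))))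
    (at-mapUpTo (λ i → Cycles.leader σ i) n i i<n)

  aWord-canonical : ∀ {n} (σ : Perm n) i → i < n → A[ canonical σ ] i ≡ Cycles.offset σ i
  aWord-canonical {n} σ i i<n = trans (cong (λ l → at l i) (sym (map-∘ {g = proj₂} {f = λ i → Cycles.leader σ i , Cycles.offset σ i} (upTo n))))
    (at-mapUpTo (λ i → Cycles.offset σ i) n i i<n)

  stdCycle-canonical : ∀ {n} (σ : Perm n) → stdCycle (canonical σ) ≡ images σ
  stdCycle-canonical {n} σ = at-ext (stdCycle (canonical σ)) (images σ) (trans (length-stdCycle (canonical σ)) (trans (length-canonical σ) (sym (Valid.length-images σ))))
    (λ i i< → let i<n = subst (i <_) (trans (length-stdCycle (canonical σ)) (length-canonical σ)) i< in
      trans (at-stdCycle (canonical σ) i (subst (i <_) (sym (length-canonical σ)) i<n))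
        (trans (next-length-cong X[ canonical σ ] A[ canonical σ ] (length-canonical σ) i)
          (trans (StdCycleCong.next-cong n X[ canonical σ ] A[ canonical σ ] (Cycles.leader σ) (Cycles.offset σ) hf ha i i<n) (Cycles.next-canonical σ i i<n))))
    where
    hf : ∀ y z → y < n → z < n → (X[ canonical σ ] z ≡ᵇ X[ canonical σ ] y) ≡ (Cycles.leader σ z ≡ᵇ Cycles.leader σ y)
    hf y z y<n z<n = cong₂ _≡ᵇ_ (xWord-canonical σ z z<n) (xWord-canonical σ y y<n)
    ha : ∀ z → z < n → A[ canonical σ ] z ≡ Cycles.offset σ z
    ha z z<n = aWord-canonical σ z z<n

  X-take : ∀ (m : Monomial) c z → z < c → X[ take c m ] z ≡ X[ m ] z
  X-take m c z z<c = trans (cong (λ l → at l z) (sym (LP.take-map {f = proj₁} c m))) (at-take (xWord m) c z z<c)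

  A-take : ∀ (m : Monomial) c z → z < c → A[ take c m ] z ≡ A[ m ] z
  A-take m c z z<c = trans (cong (λ l → at l z) (sym (LP.take-map {f = proj₂} c m))) (at-take (aWord m) c z z<c)

  X-drop : ∀ (m : Monomial) c z → X[ drop c m ] z ≡ X[ m ] (z + c)
  X-drop m c z = trans (cong (λ l → at l z) (sym (LP.drop-map {f = proj₁} c m))) (at-drop (xWord m) c z)

  A-drop : ∀ (m : Monomial) c z → A[ drop c m ] z ≡ A[ m ] (z + c)
  A-drop m c z = trans (cong (λ l → at l z) (sym (LP.drop-map {f = proj₂} c m))) (at-drop (aWord m) c z)

  length-take≡ : ∀ (m : Monomial) c → c ≤ length m → length (take c m) ≡ c
  length-take≡ m c h = trans (length-take c m) (m≤n⇒m⊓n≡m h)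

  length-take≡⇒≤ : ∀ (m : Monomial) c → length (take c m) ≡ c → c ≤ length m
  length-take≡⇒≤ m c e = subst (_≤ length m) e (subst (_≤ length m) (sym (length-take c m)) (m⊓n≤n c (length m)))

  restrict : List ℕ → ℕ → ℕ → List ℕ
  restrict τ s l = map (λ q → firstReturn (at τ) s l (at τ (q + s)) (length τ) ∸ s) (upTo l)

  module Restrict (m : Monomial) where
    private
      N = length m
      τ = stdCycle m
    open Std m

    stdCycle-block : ∀ u s → s + length u ≤ N → (∀ z → z < length u → X[ u ] z ≡ X[ m ] (z + s)) →
      (∀ z → z < length u → A[ u ] z ≡ A[ m ] (z + s)) → stdCycle u ≡ restrict τ s (length u)
    stdCycle-block u s s+l≤N X≡ A≡ = at-ext (stdCycle u) (restrict τ s l)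
        (trans (length-stdCycle u) (sym (length-mapUpTo _ l))) at-block
      where
      l = length u
      at-block : ∀ q → q < length (stdCycle u) → at (stdCycle u) q ≡ at (restrict τ s l) q
      at-block q q< = begin
        at (stdCycle u) q                                          ≡⟨ at-stdCycle u q q<l ⟩
        StdCycle.next l X[ u ] A[ u ] q                            ≡⟨ StdCycleCong.next-cong l X[ u ] A[ u ] (λ z → X[ m ] (z + s)) (λ z → A[ m ] (z + s)) X-fibres A≡ q q<l ⟩
        StdCycle.next l (λ z → X[ m ] (z + s)) (λ z → A[ m ] (z + s)) q ≡⟨ sym (m+n∸n≡m _ s) ⟩
        StdCycle.next l (λ z → X[ m ] (z + s)) (λ z → A[ m ] (z + s)) q + s ∸ s
          ≡⟨ cong (_∸ s) (sym (FirstReturn.firstReturn-next N X[ m ] A[ m ] s l s+l≤N q q<l)) ⟩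
        firstReturn next s l (next (q + s)) N ∸ s                   ≡⟨ cong (_∸ s) (sym (firstReturn-cong N (at τ) next s l _ N
                                                                        (at-stdCycle m) next< (next< (q + s) q+s<N))) ⟩
        firstReturn (at τ) s l (next (q + s)) N ∸ s                 ≡⟨ cong (λ v → firstReturn (at τ) s l v N ∸ s) (sym (at-stdCycle m (q + s) q+s<N)) ⟩
        firstReturn (at τ) s l (at τ (q + s)) N ∸ s                 ≡⟨ cong (λ L → firstReturn (at τ) s l (at τ (q + s)) L ∸ s) (sym (length-stdCycle m)) ⟩
        firstReturn (at τ) s l (at τ (q + s)) (length τ) ∸ s        ≡⟨ sym (at-mapUpTo _ l q q<l) ⟩
        at (restrict τ s l) q                                      ∎
        where
        open ≡-Reasoning
        q<l : q < l
        q<l = subst (q <_) (length-stdCycle u) q<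
        q+s<N : q + s < N
        q+s<N = <-≤-trans (subst (_< s + l) (+-comm s q) (+-monoʳ-< s q<l)) s+l≤N
        X-fibres : ∀ y z → y < l → z < l → (X[ u ] z ≡ᵇ X[ u ] y) ≡ (X[ m ] (z + s) ≡ᵇ X[ m ] (y + s))
        X-fibres y z y<l z<l = cong₂ _≡ᵇ_ (X≡ z z<l) (X≡ y y<l)

    stdCycle-take : ∀ c → c ≤ N → stdCycle (take c m) ≡ restrict τ 0 c
    stdCycle-take c c≤N = trans
      (stdCycle-block (take c m) 0 (subst (_≤ N) (sym (length-take≡ m c c≤N)) c≤N)
        (λ z z< → trans (X-take m c z (subst (z <_) (length-take≡ m c c≤N) z<)) (cong X[ m ] (sym (+-identityʳ z))))
        (λ z z< → trans (A-take m c z (subst (z <_) (length-take≡ m c c≤N) z<)) (cong A[ m ] (sym (+-identityʳ z)))))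
      (cong (restrict τ 0) (length-take≡ m c c≤N))

    stdCycle-drop : ∀ c → c ≤ N → stdCycle (drop c m) ≡ restrict τ c (length τ ∸ c)
    stdCycle-drop c c≤N = trans
      (stdCycle-block (drop c m) c (≤-reflexive (trans (cong (c +_) (length-drop c m)) (m+[n∸m]≡n c≤N)))
        (λ z _ → X-drop m c z) (λ z _ → A-drop m c z))
      (cong (restrict τ c) (trans (length-drop c m) (cong (_∸ c) (sym (length-stdCycle m)))))

  -- Factorisations of biwords and connected components

  Factors : List AnyPerm → Monomial → Bool
  Factors [] m = length m ≡ᵇ 0
  Factors ((c , α) ∷ w) m = phiCond α (xWord (take c m)) (aWord (take c m)) ∧ Factors w (drop c m)

  -- Factors w, read off the standard cycle τ alone: its first-return restrictions to consecutive blocks are w.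
  PermFactors : List AnyPerm → List ℕ → Bool
  PermFactors [] τ = length τ ≡ᵇ 0
  PermFactors ((c , α) ∷ w) τ = (c ≤ᵇ length τ) ∧ (listEqB (restrict τ 0 c) (images α) ∧ PermFactors w (restrict τ c (length τ ∸ c)))

  Factors⇒PermFactors : ∀ w m → T (Factors w m) → T (PermFactors w (stdCycle m))
  Factors⇒PermFactors [] m h = subst (λ L → T (L ≡ᵇ 0)) (sym (length-stdCycle m)) h
  Factors⇒PermFactors ((c , α) ∷ w) m h =
    T-∧⁺ (≤⇒≤ᵇ (subst (c ≤_) (sym (length-stdCycle m)) c≤N))
      (T-∧⁺ (subst (λ l → T (listEqB l (images α))) (trans (proj₂ first-block) (Restrict.stdCycle-take m c c≤N)) (listEqB-refl (images α)))
            (subst (λ l → T (PermFactors w l)) (Restrict.stdCycle-drop m c c≤N)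
              (Factors⇒PermFactors w (drop c m) (T-∧⁻ʳ {phiCond α (xWord (take c m)) (aWord (take c m))} h))))
    where
    first-block = phiCond⇒stdCycle α (take c m) (T-∧⁻ˡ h)
    c≤N : c ≤ length m
    c≤N = length-take≡⇒≤ m c (proj₁ first-block)

  PermFactors⇒Factors : ∀ w m → T (PermFactors w (stdCycle m)) → T (Factors w m)
  PermFactors⇒Factors [] m h = subst (λ L → T (L ≡ᵇ 0)) (length-stdCycle m) h
  PermFactors⇒Factors ((c , α) ∷ w) m h =
    T-∧⁺ (stdCycle⇒phiCond α (take c m) (length-take≡ m c c≤N) (sym (trans (Restrict.stdCycle-take m c c≤N) first-block)))
      (PermFactors⇒Factors w (drop c m) (subst (λ l → T (PermFactors w l)) (sym (Restrict.stdCycle-drop m c c≤N))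
        (T-∧⁻ʳ {listEqB (restrict (stdCycle m) 0 c) (images α)} rest)))
    where
    rest = T-∧⁻ʳ {c ≤ᵇ length (stdCycle m)} h
    c≤N : c ≤ length m
    c≤N = subst (c ≤_) (length-stdCycle m) (≤ᵇ⇒≤ c (length (stdCycle m)) (T-∧⁻ˡ h))
    first-block : restrict (stdCycle m) 0 c ≡ images α
    first-block = listEqB⇒≡ _ _ (T-∧⁻ˡ rest)

  Perm-≡ : ∀ {n} (σ σ′ : Perm n) → images σ ≡ images σ′ → σ ≡ σ′
  Perm-≡ (perm l p) (perm .l q) refl = cong (perm l) (T-irrelevant p q)

  AnyPerm-≡ : ∀ {n n′} (σ : Perm n) (σ′ : Perm n′) → n ≡ n′ → images σ ≡ images σ′ → _≡_ {A = AnyPerm} (n , σ) (n′ , σ′)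
  AnyPerm-≡ σ σ′ refl e = cong (_ ,_) (Perm-≡ σ σ′ e)

  Factors-unique : ∀ w₁ w₂ m → T (Factors w₁ m) → T (Factors w₂ m) → map proj₁ w₁ ≡ map proj₁ w₂ → w₁ ≡ w₂
  Factors-unique [] [] m _ _ _ = refl
  Factors-unique ((c , α) ∷ w₁) ((c′ , α′) ∷ w₂) m h₁ h₂ e with LP.∷-injective e
  ... | refl , e′ = cong₂ _∷_
        (AnyPerm-≡ α α′ refl (trans (proj₂ (phiCond⇒stdCycle α (take c m) (T-∧⁻ˡ h₁)))
                                    (sym (proj₂ (phiCond⇒stdCycle α′ (take c m) (T-∧⁻ˡ h₂))))))
        (Factors-unique w₁ w₂ (drop c m) (T-∧⁻ʳ {phiCond α (xWord (take c m)) (aWord (take c m))} h₁)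
                                          (T-∧⁻ʳ {phiCond α′ (xWord (take c m)) (aWord (take c m))} h₂) e′)

  Splits : Monomial → ℕ → Set
  Splits m n = ∀ i j → i < length m → j < length m → X[ m ] i ≡ X[ m ] j → i < n → j < n

  SplitsAll : Monomial → List ℕ → Set
  SplitsAll m [] = ⊤
  SplitsAll m (n ∷ ns) = Splits m n × SplitsAll (drop n m) ns

  -- The standard cycle α′ of the block preserves x-fibres, which do not cross n, so α′ maps [0, n) onto itself.
  connected-unsplittable : ∀ m n n′ (α′ : Perm n′) → 0 < n → n < n′ → T (phiCond α′ (xWord (take n′ m)) (aWord (take n′ m))) →
    Splits m n → Connected α′ → ⊥
  connected-unsplittable m n n′ α′ n>0 n<n′ h splits conn =
    proj₂ conn n n>0 n<n′ (λ j → mk⇔ (λ j<n → onto j j<n) (λ p → subst (_< n) (proj₂ (proj₂ p)) (into (proj₁ p) (proj₁ (proj₂ p)))))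
    where
    u = take n′ m
    α′≡ = phiCond⇒stdCycle α′ u h
    length-u : length u ≡ n′
    length-u = proj₁ α′≡
    n′≤N : n′ ≤ length m
    n′≤N = length-take≡⇒≤ m n′ length-u
    into : ∀ i → i < n → app α′ i < n
    into i i<n = subst (_< n) (sym α′i≡) i⁺<n
      where
      i<n′ = <-trans i<n n<n′
      i<u : i < length u
      i<u = subst (i <_) (sym length-u) i<n′
      α′i≡ : app α′ i ≡ Std.next u i
      α′i≡ = trans (cong (λ l → at l i) (proj₂ α′≡)) (at-stdCycle u i i<u)
      i⁺ = Std.next u i
      i⁺<u : i⁺ < length u
      i⁺<u = Std.next< u i i<u
      i⁺<n′ : i⁺ < n′
      i⁺<n′ = subst (i⁺ <_) length-u i⁺<u
      same-x : X[ u ] i⁺ ≡ X[ u ] i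
      same-x = ≡ᵇ⇒≡ (X[ u ] i⁺) (X[ u ] i) (Std.next-sameFibre u i i<u)
      same-x′ : X[ m ] i⁺ ≡ X[ m ] i
      same-x′ = trans (sym (X-take m n′ i⁺ i⁺<n′)) (trans same-x (X-take m n′ i i<n′))
      i⁺<n : i⁺ < n
      i⁺<n = splits i i⁺ (<-≤-trans i<n′ n′≤N) (<-≤-trans i⁺<n′ n′≤N) (sym same-x′) i<n
    onto : ∀ j → j < n → Σ ℕ λ i → i < n × app α′ i ≡ j
    onto = injective⇒surjective n (app α′) into (λ i j i<n j<n e → Valid.app-injective α′ i j (<-trans i<n n<n′) (<-trans j<n n<n′) e)

  connectedFactors-refine : ∀ w′ ns m → SplitsAll m ns → All (0 <_) ns → sum ns ≡ length m → T (Factors w′ m) →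
    All (λ q → Connected (proj₂ q)) w′ → length ns ≤ length w′ × (length ns ≡ length w′ → map proj₁ w′ ≡ ns)
  connectedFactors-refine [] [] m _ _ _ _ _ = z≤n , λ _ → refl
  connectedFactors-refine [] (n ∷ ns) m _ (p ∷ _) s h _ = ⊥-elim (<-irrefl refl (<-≤-trans p (subst (n ≤_) (trans s (≡ᵇ⇒≡ (length m) 0 h)) (m≤m+n n (sum ns)))))
  connectedFactors-refine ((n′ , α′) ∷ w′′) [] m _ _ _ _ _ = z≤n , λ ()
  connectedFactors-refine ((n′ , α′) ∷ w′′) (n ∷ ns) m resp (p ∷ ps) s h (conn ∷ conns) = compare-first (<-cmp n′ n)
    where
    first-factor = T-∧⁻ˡ {phiCond α′ (xWord (take n′ m)) (aWord (take n′ m))} h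
    rest-factors = T-∧⁻ʳ {phiCond α′ (xWord (take n′ m)) (aWord (take n′ m))} h
    n′≤N : n′ ≤ length m
    n′≤N = length-take≡⇒≤ m n′ (proj₁ (phiCond⇒stdCycle α′ (take n′ m) first-factor))
    compare-first : Tri (n′ < n) (n′ ≡ n) (n′ > n) → suc (length ns) ≤ suc (length w′′) × (suc (length ns) ≡ suc (length w′′) → n′ ∷ map proj₁ w′′ ≡ n ∷ ns)
    compare-first (tri≈ _ refl _) = s≤s (proj₁ ih) , λ e → cong (n ∷_) (proj₂ ih (suc-injective e))
      where
      ih = connectedFactors-refine w′′ ns (drop n m) (proj₂ resp) ps
             (trans (sym (m+n∸m≡n n (sum ns))) (trans (cong (_∸ n) s) (sym (length-drop n m)))) rest-factors conns
    compare-first (tri> _ _ n<n′) = ⊥-elim (connected-unsplittable m n n′ α′ p n<n′ first-factor (proj₁ resp) conn)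
    compare-first (tri< n′<n _ _) = m≤n⇒m≤1+n (proj₁ ih) , λ e → ⊥-elim (<-irrefl (suc-injective e) (proj₁ ih))
      where
      d = n ∸ n′
      n′≤n = <⇒≤ n′<n
      shift< : ∀ {i} → i < length (drop n′ m) → i + n′ < length m
      shift< {i} i< = subst (i + n′ <_) (m∸n+n≡m n′≤N) (+-monoˡ-< n′ (subst (i <_) (length-drop n′ m) i<))
      splits-d : Splits (drop n′ m) d
      splits-d i j i< j< e i<d = subst (_< d) (m+n∸n≡m j n′) (∸-monoˡ-< (proj₁ resp (i + n′) (j + n′) (shift< i<) (shift< j<)
          (trans (sym (X-drop m n′ i)) (trans e (X-drop m n′ j)))
          (subst (i + n′ <_) (m∸n+n≡m n′≤n) (+-monoˡ-< n′ i<d))) (m≤n+m n′ j))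
      splits-rest : SplitsAll (drop d (drop n′ m)) ns
      splits-rest = subst (λ a → SplitsAll a ns) (sym (trans (drop-drop n′ d m) (cong (λ v → drop v m) (m+[n∸m]≡n n′≤n)))) (proj₂ resp)
      sizes : d + sum ns ≡ length (drop n′ m)
      sizes = trans (sym (+-∸-comm (sum ns) n′≤n)) (trans (cong (_∸ n′) s) (sym (length-drop n′ m)))
      ih = connectedFactors-refine w′′ (d ∷ ns) (drop n′ m) (splits-d , splits-rest) (m<n⇒0<n∸m n′<n ∷ ps) sizes rest-factors conns

  firstReturn-here : ∀ τ s l y f → T (inBlock s l y) → firstReturn τ s l y f ≡ y
  firstReturn-here τ s l y zero _ = refl
  firstReturn-here τ s l y (suc f) h = firstReturn-in τ s l y f h

  at-restrict-here : ∀ τ s l j → j < l → T (inBlock s l (at τ (j + s))) → at (restrict τ s l) j ≡ at τ (j + s) ∸ s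
  at-restrict-here τ s l j j<l h = trans (at-mapUpTo _ l j j<l) (cong (_∸ s) (firstReturn-here (at τ) s l _ (length τ) h))

  module _ (m : Monomial) (c : ℕ) (c≤N : c ≤ length m) (splits : Splits m c) where
    private
      N = length m
      τ = stdCycle m
      open Std m using (next; next<; next-sameFibre)
      same-x : ∀ p → p < N → X[ m ] p ≡ X[ m ] (next p)
      same-x p p<N = sym (≡ᵇ⇒≡ (X[ m ] (next p)) (X[ m ] p) (next-sameFibre p p<N))

    stdCycle-prefix : ∀ p → p < c → at (stdCycle (take c m)) p ≡ at τ p
    stdCycle-prefix p p<c = begin
      at (stdCycle (take c m)) p   ≡⟨ cong (λ l → at l p) (Restrict.stdCycle-take m c c≤N) ⟩
      at (restrict τ 0 c) p        ≡⟨ at-restrict-here τ 0 c p p<c (inBlock⁺ z≤n (subst (_< c) τp≡ next<c)) ⟩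
      at τ (p + 0) ∸ 0             ≡⟨ cong (at τ) (+-identityʳ p) ⟩
      at τ p                       ∎
      where
      open ≡-Reasoning
      p<N = <-≤-trans p<c c≤N
      τp≡ : next (p + 0) ≡ at τ (p + 0)
      τp≡ = sym (at-stdCycle m (p + 0) (subst (_< N) (sym (+-identityʳ p)) p<N))
      next<c : next (p + 0) < c
      next<c = subst (λ q → next q < c) (sym (+-identityʳ p)) (splits p (next p) p<N (next< p p<N) (same-x p p<N) p<c)

    stdCycle-suffix : ∀ j → j < N ∸ c → at (stdCycle (drop c m)) j + c ≡ at τ (j + c)
    stdCycle-suffix j j<N∸c = begin
      at (stdCycle (drop c m)) j + c            ≡⟨ cong (λ l → at l j + c) (Restrict.stdCycle-drop m c c≤N) ⟩
      at (restrict τ c (length τ ∸ c)) j + c    ≡⟨ cong (_+ c) (at-restrict-here τ c (length τ ∸ c) j j<L∸c in-suffix) ⟩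
      at τ (j + c) ∸ c + c                      ≡⟨ m∸n+n≡m c≤τp ⟩
      at τ (j + c)                              ∎
      where
      open ≡-Reasoning
      p = j + c
      p<N : p < N
      p<N = subst (j + c <_) (m∸n+n≡m c≤N) (+-monoˡ-< c j<N∸c)
      j<L∸c : j < length τ ∸ c
      j<L∸c = subst (λ L → j < L ∸ c) (sym (length-stdCycle m)) j<N∸c
      τp≡ : at τ p ≡ next p
      τp≡ = at-stdCycle m p p<N
      c≤τp : c ≤ at τ p
      c≤τp = subst (c ≤_) (sym τp≡) (≮⇒≥ (λ next<c → <⇒≱ (splits (next p) p (next< p p<N) p<N (sym (same-x p p<N)) next<c) (m≤n+m c j)))
      in-suffix : T (inBlock c (length τ ∸ c) (at τ p))
      in-suffix = inBlock⁺ c≤τp (subst (at τ p <_) (sym (trans (cong (λ L → c + (L ∸ c)) (length-stdCycle m)) (m+[n∸m]≡n c≤N)))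
                                  (subst (_< N) (sym τp≡) (next< p p<N)))

  stdCycle-split : ∀ m c → c ≤ length m → Splits m c → stdCycle m ≡ stdCycle (take c m) ++ map (_+ c) (stdCycle (drop c m))
  stdCycle-split m c c≤N splits = at-ext τ (τ₁ ++ τ₂) lengths at-split
    where
    τ = stdCycle m
    τ₁ = stdCycle (take c m)
    τ₂ = map (_+ c) (stdCycle (drop c m))
    length-τ₁ : length τ₁ ≡ c
    length-τ₁ = trans (length-stdCycle (take c m)) (length-take≡ m c c≤N)
    length-drop-τ : length (stdCycle (drop c m)) ≡ length m ∸ c
    length-drop-τ = trans (length-stdCycle (drop c m)) (length-drop c m)
    lengths : length τ ≡ length (τ₁ ++ τ₂)
    lengths = trans (length-stdCycle m) (sym (trans (length-++ τ₁)
      (trans (cong₂ _+_ length-τ₁ (trans (length-map (_+ c) (stdCycle (drop c m))) length-drop-τ)) (m+[n∸m]≡n c≤N))))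
    at-split : ∀ p → p < length τ → at τ p ≡ at (τ₁ ++ τ₂) p
    at-split p p< with p <? c
    ... | yes p<c = sym (trans (at-++ˡ τ₁ τ₂ p (subst (p <_) (sym length-τ₁) p<c)) (stdCycle-prefix m c c≤N splits p p<c))
    ... | no p≮c = sym (begin
        at (τ₁ ++ τ₂) p                   ≡⟨ cong (at (τ₁ ++ τ₂)) (trans (sym (m+[n∸m]≡n c≤p)) (cong (_+ (p ∸ c)) (sym length-τ₁))) ⟩
        at (τ₁ ++ τ₂) (length τ₁ + (p ∸ c)) ≡⟨ at-++ʳ τ₁ τ₂ (p ∸ c) ⟩
        at τ₂ (p ∸ c)                     ≡⟨ at-map (_+ c) (stdCycle (drop c m)) (p ∸ c) (subst (p ∸ c <_) (sym length-drop-τ) j<N∸c) ⟩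
        at (stdCycle (drop c m)) (p ∸ c) + c ≡⟨ stdCycle-suffix m c c≤N splits (p ∸ c) j<N∸c ⟩
        at τ (p ∸ c + c)                  ≡⟨ cong (at τ) (m∸n+n≡m c≤p) ⟩
        at τ p                            ∎)
      where
      open ≡-Reasoning
      c≤p = ≮⇒≥ p≮c
      j<N∸c : p ∸ c < length m ∸ c
      j<N∸c = ∸-monoˡ-< (subst (p <_) (length-stdCycle m) p<) c≤p

  directSum : List AnyPerm → List ℕ
  directSum [] = []
  directSum ((c , α) ∷ w) = images α ++ map (_+ c) (directSum w)

  length≡0 : ∀ (m : Monomial) → length m ≡ 0 → m ≡ []
  length≡0 [] _ = refl

  Factors⇒directSum : ∀ w m → T (Factors w m) → SplitsAll m (map proj₁ w) → stdCycle m ≡ directSum w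
  Factors⇒directSum [] m h _ rewrite length≡0 m (≡ᵇ⇒≡ (length m) 0 h) = refl
  Factors⇒directSum ((c , α) ∷ w) m h (nc , rs) = trans (stdCycle-split m c c≤N nc)
      (cong₂ _++_ (sym (proj₂ ph)) (cong (map (_+ c)) (Factors⇒directSum w (drop c m) (T-∧⁻ʳ {phiCond α (xWord (take c m)) (aWord (take c m))} h) rs)))
    where
    ph = phiCond⇒stdCycle α (take c m) (T-∧⁻ˡ h)
    c≤N : c ≤ length m
    c≤N = length-take≡⇒≤ m c (proj₁ ph)

  splitsᵇ : Monomial → ℕ → Bool
  splitsᵇ m c = all (λ i → all (λ j → not (c ≤ᵇ j) ∨ not (X[ m ] i ≡ᵇ X[ m ] j)) (upTo (length m))) (upTo c)

  splitsᵇ⇒Splits : ∀ m c → T (splitsᵇ m c) → Splits m c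
  splitsᵇ⇒Splits m c h i j i<N j<N e i<c with j <? c
  ... | yes j<c = j<c
  ... | no j≮c with T-∨⁻ {not (c ≤ᵇ j)} (all-upTo⁻ _ (length m) (all-upTo⁻ _ c h i i<c) j j<N)
  ...   | inj₁ a = ⊥-elim (T-not⁻ a (≤⇒≤ᵇ (≮⇒≥ j≮c)))
  ...   | inj₂ b = ⊥-elim (T-not⁻ b (≡⇒≡ᵇ (X[ m ] i) (X[ m ] j) e))

  Splits⇒splitsᵇ : ∀ m c → c ≤ length m → Splits m c → T (splitsᵇ m c)
  Splits⇒splitsᵇ m c c≤N nc = all-upTo⁺ _ c (λ i i<c → all-upTo⁺ _ (length m) (λ j j<N → lem i j i<c j<N))
    where
    lem : ∀ i j → i < c → j < length m → T (not (c ≤ᵇ j) ∨ not (X[ m ] i ≡ᵇ X[ m ] j))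
    lem i j i<c j<N with T? (X[ m ] i ≡ᵇ X[ m ] j)
    ... | no ne = T-∨⁺ʳ {not (c ≤ᵇ j)} (T-not⁺ ne)
    ... | yes e = T-∨⁺ˡ (T-not⁺ (λ c≤j → <-irrefl refl (<-≤-trans (nc i j (<-≤-trans i<c c≤N) j<N (≡ᵇ⇒≡ _ _ e) i<c) (≤ᵇ⇒≤ c j c≤j))))

  opaque
    firstSplit : Monomial → ℕ
    firstSplit m = suc (first (λ c′ → splitsᵇ m (suc c′)) (length m))

    firstSplit-pos : ∀ m → 0 < firstSplit m
    firstSplit-pos m = s≤s z≤n

    firstSplit-spec : ∀ m → 0 < length m → firstSplit m ≤ length m × Splits m (firstSplit m) × (∀ k → 0 < k → k < firstSplit m → ¬ T (splitsᵇ m k))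
    firstSplit-spec m 0<N = ≤-trans (s≤s (proj₁ found)) (≤-reflexive N-1+1) ,
        splitsᵇ⇒Splits m (firstSplit m) (proj₁ (proj₂ found)) , earlier
      where
      P : ℕ → Bool
      P c = splitsᵇ m (suc c)
      N-1+1 : suc (length m ∸ 1) ≡ length m
      N-1+1 = trans (+-comm 1 (length m ∸ 1)) (m∸n+n≡m 0<N)
      whole : T (P (length m ∸ 1))
      whole = subst (λ v → T (splitsᵇ m v)) (sym N-1+1) (Splits⇒splitsᵇ m (length m) ≤-refl (λ i j i<N j<N _ _ → j<N))
      found : first P (length m) ≤ length m ∸ 1 × T (P (first P (length m))) × (∀ w → w < first P (length m) → ¬ T (P w))
      found = first-spec P (length m) (length m ∸ 1) (subst (length m ∸ 1 <_) N-1+1 ≤-refl) whole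
      earlier : ∀ k → 0 < k → k < firstSplit m → ¬ T (splitsᵇ m k)
      earlier (suc k) _ k<c = proj₂ (proj₂ found) k (s≤s⁻¹ k<c)

  components : ℕ → Monomial → List AnyPerm
  components zero m = []
  components (suc f) [] = []
  components (suc f) m@(_ ∷ _) = (length u , stdPerm u) ∷ components f (drop (length u) m)
    where u = take (firstSplit m) m

  -- An initial segment [0,k) stable under the standard cycle of the first component is a union of its cycles,
  -- i.e. of x-fibres, so m would already split at k < firstSplit m.
  firstComponent-connected : ∀ m → 0 < length m → Connected (stdPerm (take (firstSplit m) m))
  firstComponent-connected m 0<N = subst (1 ≤_) (sym L≡c) (firstSplit-pos m) , λ k 0<k k<L stable →
      earlier k 0<k (subst (k <_) L≡c k<L) (Splits⇒splitsᵇ m k (<⇒≤ (<-≤-trans (subst (k <_) L≡c k<L) c≤N)) (stable⇒Splits k k<L stable))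
    where
    spec = firstSplit-spec m 0<N
    c = firstSplit m
    c≤N : c ≤ length m
    c≤N = proj₁ spec
    earlier = proj₂ (proj₂ spec)
    u = take c m
    L≡c : length u ≡ c
    L≡c = length-take≡ m c c≤N
    stable⇒Splits : ∀ k → k < length u → (∀ j → (j < k) ⇔ Σ ℕ (λ i → (i < k) × (app (stdPerm u) i ≡ j))) → Splits m k
    stable⇒Splits k k<L stable i j i<N j<N e i<k = subst (_< k) (proj₂ (proj₂ cover)) (stays (proj₁ cover) i i<k)
      where
      j<c : j < c
      j<c = proj₁ (proj₂ spec) i j i<N j<N e (<-trans i<k (subst (k <_) L≡c k<L))
      into : ∀ y → y < k → Std.next u y < k
      into y y<k = subst (_< k) (at-stdCycle u y (<-trans y<k k<L)) (Equivalence.from (stable (app (stdPerm u) y)) (y , y<k , refl))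
      stays : ∀ t y → y < k → iter (Std.next u) t y < k
      stays zero y y<k = y<k
      stays (suc t) y y<k = stays t (Std.next u y) (into y y<k)
      i<c = <-trans i<k (subst (k <_) L≡c k<L)
      cover = Std.iter-next-covers u i j (subst (i <_) (sym L≡c) i<c) (subst (j <_) (sym L≡c) j<c)
        (≡⇒≡ᵇ (X[ u ] j) (X[ u ] i) (trans (X-take m c j j<c) (trans (sym e) (sym (X-take m c i i<c)))))

  record IsDecomposition (w : List AnyPerm) (m : Monomial) : Set where
    field
      factors : T (Factors w m)
      splits : SplitsAll m (map proj₁ w)
      connected : All (λ q → Connected (proj₂ q)) w

  components-isDecomposition : ∀ f m → length m ≤ f → IsDecomposition (components f m) m
  components-isDecomposition zero [] _ = record { factors = tt ; splits = tt ; connected = [] }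
  components-isDecomposition (suc f) [] _ = record { factors = tt ; splits = tt ; connected = [] }
  components-isDecomposition (suc f) m@(e ∷ m′) (s≤s le) = record
    { factors = T-∧⁺ first-factor (IsDecomposition.factors rest)
    ; splits = subst (Splits m) (sym L≡c) (proj₁ (proj₂ spec)) , IsDecomposition.splits rest
    ; connected = firstComponent-connected m (s≤s z≤n) ∷ IsDecomposition.connected rest
    }
    where
    spec = firstSplit-spec m (s≤s z≤n)
    c = firstSplit m
    u = take c m
    L = length u
    L≡c : L ≡ c
    L≡c = length-take≡ m c (proj₁ spec)
    first-factor : T (phiCond (stdPerm u) (xWord (take L m)) (aWord (take L m)))
    first-factor = subst (λ v → T (phiCond (stdPerm u) (xWord v) (aWord v))) (sym (cong (λ v → take v m) L≡c))
      (stdCycle⇒phiCond (stdPerm u) u refl refl)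
    rest = components-isDecomposition f (drop L m)
      (subst (_≤ f) (sym (length-drop L m)) (≤-trans (∸-monoʳ-≤ {1} {L} (length m) (subst (0 <_) (sym L≡c) (firstSplit-pos m))) le))

  Factors-length : ∀ w m → T (Factors w m) → length m ≡ sum (map proj₁ w)
  Factors-length [] m h = ≡ᵇ⇒≡ (length m) 0 h
  Factors-length ((c , α) ∷ w) m h = trans (sym (m+[n∸m]≡n c≤N))
      (cong (c +_) (trans (sym (length-drop c m)) (Factors-length w (drop c m) (T-∧⁻ʳ {phiCond α (xWord (take c m)) (aWord (take c m))} h))))
    where
    c≤N : c ≤ length m
    c≤N = length-take≡⇒≤ m c (proj₁ (phiCond⇒stdCycle α (take c m) (T-∧⁻ˡ h)))

  connected-sizes-pos : ∀ w → All (λ q → Connected (proj₂ q)) w → All (0 <_) (map proj₁ w)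
  connected-sizes-pos [] [] = []
  connected-sizes-pos ((c , α) ∷ w) (cn ∷ cs) = proj₁ cn ∷ connected-sizes-pos w cs

  decomposition : ∀ {n} → Perm n → List AnyPerm
  decomposition σ = components (length (canonical σ)) (canonical σ)

  decomposition-isDecomposition : ∀ {n} (σ : Perm n) → IsDecomposition (decomposition σ) (canonical σ)
  decomposition-isDecomposition σ = components-isDecomposition (length (canonical σ)) (canonical σ) ≤-refl

  module Decomposition {n : ℕ} (σ : Perm n) = IsDecomposition (decomposition-isDecomposition σ)

  decomposition-size : ∀ {n} (σ : Perm n) → sum (map proj₁ (decomposition σ)) ≡ n
  decomposition-size σ = trans (sym (Factors-length (decomposition σ) (canonical σ) (Decomposition.factors σ))) (length-canonical σ)

  decomposition-directSum : ∀ {n} (σ : Perm n) → images σ ≡ directSum (decomposition σ)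
  decomposition-directSum σ =
    trans (sym (stdCycle-canonical σ)) (Factors⇒directSum _ (canonical σ) (Decomposition.factors σ) (Decomposition.splits σ))

  -- The blocks of the connected components of σ cannot be cut, so they refine the components of such a τ.
  PermFactors-components : ∀ {n n′} (σ : Perm n) (τ : Perm n′) → T (PermFactors (decomposition σ) (images τ)) →
    length (decomposition τ) ≤ length (decomposition σ) × (length (decomposition τ) ≡ length (decomposition σ) → images τ ≡ images σ)
  PermFactors-components σ τ hτ = ≤-length , same-length
    where
    w = decomposition σ
    factors-τ : T (Factors w (canonical τ))
    factors-τ = PermFactors⇒Factors w (canonical τ) (subst (λ l → T (PermFactors w l)) (sym (stdCycle-canonical τ)) hτ)
    refine = connectedFactors-refine w (map proj₁ (decomposition τ)) (canonical τ) (Decomposition.splits τ)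
      (connected-sizes-pos _ (Decomposition.connected τ)) (trans (decomposition-size τ) (sym (length-canonical τ)))
      factors-τ (Decomposition.connected σ)
    length-sizes : length (map proj₁ (decomposition τ)) ≡ length (decomposition τ)
    length-sizes = length-map proj₁ (decomposition τ)
    ≤-length : length (decomposition τ) ≤ length w
    ≤-length = subst (_≤ length w) length-sizes (proj₁ refine)
    same-length : length (decomposition τ) ≡ length w → images τ ≡ images σ
    same-length e = trans (decomposition-directSum τ) (trans (cong directSum (sym same))
      (trans (sym (Factors⇒directSum w (canonical σ) (Decomposition.factors σ) (Decomposition.splits σ))) (stdCycle-canonical σ)))
      where
      same : w ≡ decomposition τ
      same = Factors-unique w (decomposition τ) (canonical τ) factors-τ (Decomposition.factors τ) (proj₂ refine (trans length-sizes e))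

  -- Finite sets of permutations and test biwords

  words : ℕ → ℕ → List (List ℕ)
  words N zero = [] ∷ []
  words N (suc k) = concatMap (λ v → map (v ∷_) (words N k)) (upTo N)

  words-complete : ∀ N (l : List ℕ) → (∀ i → i < length l → at l i < N) → l ∈ words N (length l)
  words-complete N [] h = here refl
  words-complete N (v ∷ l) h = ∈-concat⁺′ (∈-map⁺ (v ∷_) (words-complete N l (λ i i< → h (suc i) (s≤s i<))))
    (∈-map⁺ (λ v → map (v ∷_) (words N (length l))) (∈-upTo⁺ (h 0 (s≤s z≤n))))

  asPerm-dec : ∀ N l → Dec (T (isPermB N l)) → List AnyPerm
  asPerm-dec N l (yes p) = (N , perm l p) ∷ []
  asPerm-dec N l (no _) = []

  asPerm : ℕ → List ℕ → List AnyPerm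
  asPerm N l = asPerm-dec N l (T? (isPermB N l))

  perms : ℕ → List AnyPerm
  perms N = concatMap (asPerm N) (words N N)

  imagesOf : AnyPerm → List ℕ
  imagesOf p = images (proj₂ p)

  perms-complete : ∀ {N} (σ : Perm N) → (N , σ) ∈ perms N
  perms-complete {N} σ = ∈-concat⁺′ (∈-asPerm (T? (isPermB N (images σ))))
      (∈-map⁺ (asPerm N) (subst (λ k → images σ ∈ words N k) (Valid.length-images σ)
        (words-complete N (images σ) (λ i i< → Valid.app< σ i (subst (i <_) (Valid.length-images σ) i<)))))
    where
    ∈-asPerm : (d : Dec (T (isPermB N (images σ)))) → (N , σ) ∈ asPerm-dec N (images σ) d
    ∈-asPerm (yes p) = here (AnyPerm-≡ σ (perm (images σ) p) refl refl)
    ∈-asPerm (no np) = ⊥-elim (np (valid σ))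

  asPerm-size : ∀ N l d p → p ∈ asPerm-dec N l d → proj₁ p ≡ N
  asPerm-size N l (yes _) p (here refl) = refl

  perms-size : ∀ N p → p ∈ perms N → proj₁ p ≡ N
  perms-size N p h with ∈-concat⁻′ (map (asPerm N) (words N N)) h
  ... | xs , p∈xs , xs∈ with ∈-map⁻ (asPerm N) xs∈
  ...   | l , _ , refl = asPerm-size N l (T? (isPermB N l)) p p∈xs

  _≟ₚ_ : (p q : AnyPerm) → Dec (p ≡ q)
  (n , σ) ≟ₚ (n′ , σ′) with n ≟ n′
  ... | no ne = no (λ e → ne (cong proj₁ e))
  ... | yes refl with LP.≡-dec _≟_ (images σ) (images σ′)
  ...   | yes e = yes (AnyPerm-≡ σ σ′ refl e)
  ...   | no ne = no (λ e → ne (cong imagesOf e))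

  select : ℕ → (AnyPerm → Bool) → List AnyPerm
  select N Q = deduplicate _≟ₚ_ (filter (λ p → T? (Q p)) (perms N))

  select⁺ : ∀ N Q {n} (σ : Perm n) → n ≡ N → T (Q (n , σ)) → (n , σ) ∈ select N Q
  select⁺ N Q σ refl q = ∈-deduplicate⁺ _≟ₚ_ (∈-filter⁺ (λ p → T? (Q p)) (perms-complete σ) q)

  select⁻ : ∀ N Q p → p ∈ select N Q → proj₁ p ≡ N × T (Q p)
  select⁻ N Q p h with ∈-filter⁻ (λ p → T? (Q p)) {xs = perms N} (∈-deduplicate⁻ _≟ₚ_ _ h)
  ... | a , b = perms-size N p a , b

  select-unique : ∀ N Q → Unique (select N Q)
  select-unique N Q = UP.deduplicate-! (filter (λ p → T? (Q p)) (perms N))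
    where import Data.List.Relation.Unary.Unique.DecPropositional.Properties _≟ₚ_ as UP

  otherTermᵇ : ∀ {n} → Perm n → AnyPerm → Bool
  otherTermᵇ σ p = PermFactors (decomposition σ) (imagesOf p) ∧ not (listEqB (imagesOf p) (images σ))

  otherTerms : ∀ {n} → Perm n → List AnyPerm
  otherTerms {n} σ = select n (otherTermᵇ σ)

  otherTerms-fewerComponents : ∀ {n} (σ : Perm n) p → p ∈ otherTerms σ →
    length (decomposition (proj₂ p)) < length (decomposition σ)
  otherTerms-fewerComponents {n} σ (n′ , τ) p∈ = ≤∧≢⇒< (proj₁ components-τ) (λ e → differs (proj₂ components-τ e))
    where
    q = proj₂ (select⁻ n (otherTermᵇ σ) (n′ , τ) p∈)
    components-τ = PermFactors-components σ τ (T-∧⁻ˡ q)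
    differs : images τ ≢ images σ
    differs e = T-not⁻ (T-∧⁻ʳ {PermFactors (decomposition σ) (images τ)} q)
      (subst (λ l → T (listEqB (images τ) l)) e (listEqB-refl (images τ)))

  shiftX : ℕ → Monomial → Monomial
  shiftX off m = map (λ p → (proj₁ p + off , proj₂ p)) m

  length-shiftX : ∀ off m → length (shiftX off m) ≡ length m
  length-shiftX off m = length-map _ m

  X-shiftX : ∀ off m i → i < length m → X[ shiftX off m ] i ≡ X[ m ] i + off
  X-shiftX off (p ∷ m) zero _ = refl
  X-shiftX off (p ∷ m) (suc i) h = X-shiftX off m i (s≤s⁻¹ h)

  A-shiftX : ∀ off m i → A[ shiftX off m ] i ≡ A[ m ] i
  A-shiftX off [] i = refl
  A-shiftX off (p ∷ m) zero = refl
  A-shiftX off (p ∷ m) (suc i) = A-shiftX off m i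

  stdCycle-shiftX : ∀ off m → stdCycle (shiftX off m) ≡ stdCycle m
  stdCycle-shiftX off m = at-ext _ _ (trans (length-stdCycle (shiftX off m)) (trans (length-shiftX off m) (sym (length-stdCycle m))))
    (λ i i< → let i<m = subst (i <_) (trans (length-stdCycle (shiftX off m)) (length-shiftX off m)) i< in
      trans (at-stdCycle (shiftX off m) i (subst (i <_) (sym (length-shiftX off m)) i<m))
      (trans (next-length-cong X[ shiftX off m ] A[ shiftX off m ] (length-shiftX off m) i)
      (trans (StdCycleCong.next-cong (length m) X[ shiftX off m ] A[ shiftX off m ] X[ m ] A[ m ]
               (λ y z y< z< → trans (cong₂ _≡ᵇ_ (X-shiftX off m z z<) (X-shiftX off m y y<)) (eqb (X[ m ] z) (X[ m ] y) off))
               (λ z _ → A-shiftX off m z) i i<m)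
      (sym (at-stdCycle m i i<m)))))
    where
    eqb : ∀ a b k → (a + k ≡ᵇ b + k) ≡ (a ≡ᵇ b)
    eqb a b k = T-injective (λ h → ≡⇒≡ᵇ a b (+-cancelʳ-≡ k a b (≡ᵇ⇒≡ _ _ h))) (λ h → ≡⇒≡ᵇ (a + k) (b + k) (cong (_+ k) (≡ᵇ⇒≡ a b h)))

  testWord : ℕ → List AnyPerm → Monomial
  testWord off [] = []
  testWord off ((c , α) ∷ w) = shiftX off (canonical α) ++ testWord (off + c) w

  length-testWord : ∀ off w → length (testWord off w) ≡ sum (map proj₁ w)
  length-testWord off [] = refl
  length-testWord off ((c , α) ∷ w) = trans (length-++ (shiftX off (canonical α))) (cong₂ _+_ (trans (length-shiftX off (canonical α)) (length-canonical α)) (length-testWord (off + c) w))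

  X-++ˡ : ∀ (l1 l2 : Monomial) i → i < length l1 → X[ l1 ++ l2 ] i ≡ X[ l1 ] i
  X-++ˡ l1 l2 i h = trans (cong (λ l → at l i) (map-++ proj₁ l1 l2)) (at-++ˡ (xWord l1) (xWord l2) i (subst (i <_) (sym (length-map proj₁ l1)) h))

  X-++ʳ : ∀ (l1 l2 : Monomial) j → X[ l1 ++ l2 ] (length l1 + j) ≡ X[ l2 ] j
  X-++ʳ l1 l2 j = trans (cong (λ l → at l (length l1 + j)) (map-++ proj₁ l1 l2))
    (trans (cong (λ k → at (xWord l1 ++ xWord l2) (k + j)) (sym (length-map proj₁ l1))) (at-++ʳ (xWord l1) (xWord l2) j))

  take-++ : ∀ (l1 l2 : Monomial) → take (length l1) (l1 ++ l2) ≡ l1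
  take-++ [] l2 = refl
  take-++ (x ∷ l1) l2 = cong (x ∷_) (take-++ l1 l2)

  drop-++ : ∀ (l1 l2 : Monomial) → drop (length l1) (l1 ++ l2) ≡ l2
  drop-++ [] l2 = refl
  drop-++ (x ∷ l1) l2 = drop-++ l1 l2

  testWord-X≥ : ∀ off w j → j < length (testWord off w) → off ≤ X[ testWord off w ] j
  testWord-X≥ off ((c , α) ∷ w) j j< with j <? length (shiftX off (canonical α))
  ... | yes j<s = subst (off ≤_) (sym (trans (X-++ˡ (shiftX off (canonical α)) (testWord (off + c) w) j j<s)
          (X-shiftX off (canonical α) j (subst (j <_) (length-shiftX off (canonical α)) j<s)))) (m≤n+m off _)
  ... | no j≮s = subst (off ≤_) (sym (trans (cong X[ testWord off ((c , α) ∷ w) ] (sym je)) (X-++ʳ (shiftX off (canonical α)) (testWord (off + c) w) (j ∸ L))))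
          (≤-trans (m≤m+n off c) (testWord-X≥ (off + c) w (j ∸ L) j′<))
    where
    L = length (shiftX off (canonical α))
    je : L + (j ∸ L) ≡ j
    je = m+[n∸m]≡n (≮⇒≥ j≮s)
    j′< : j ∸ L < length (testWord (off + c) w)
    j′< = +-cancelˡ-< L (j ∸ L) (length (testWord (off + c) w))
      (subst₂ _<_ (sym je) (length-++ (shiftX off (canonical α))) j<)

  length-shiftCanonical : ∀ off {c} (α : Perm c) → length (shiftX off (canonical α)) ≡ c
  length-shiftCanonical off α = trans (length-shiftX off (canonical α)) (length-canonical α)

  testWord-take : ∀ off c (α : Perm c) w → take c (testWord off ((c , α) ∷ w)) ≡ shiftX off (canonical α)
  testWord-take off c α w = subst (λ k → take k (testWord off ((c , α) ∷ w)) ≡ shiftX off (canonical α)) (length-shiftCanonical off α) (take-++ (shiftX off (canonical α)) (testWord (off + c) w))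

  testWord-drop : ∀ off c (α : Perm c) w → drop c (testWord off ((c , α) ∷ w)) ≡ testWord (off + c) w
  testWord-drop off c α w = subst (λ k → drop k (testWord off ((c , α) ∷ w)) ≡ testWord (off + c) w) (length-shiftCanonical off α) (drop-++ (shiftX off (canonical α)) (testWord (off + c) w))

  testWord-factors : ∀ off w → T (Factors w (testWord off w))
  testWord-factors off [] = tt
  testWord-factors off ((c , α) ∷ w) = T-∧⁺
    (subst (λ v → T (phiCond α (xWord v) (aWord v))) (sym (testWord-take off c α w))
      (stdCycle⇒phiCond α (shiftX off (canonical α)) (length-shiftCanonical off α) (sym (trans (stdCycle-shiftX off (canonical α)) (stdCycle-canonical α)))))
    (subst (λ v → T (Factors w v)) (sym (testWord-drop off c α w)) (testWord-factors (off + c) w))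

  testWord-splits : ∀ off w → SplitsAll (testWord off w) (map proj₁ w)
  testWord-splits off [] = tt
  testWord-splits off ((c , α) ∷ w) = nc , subst (λ v → SplitsAll v (map proj₁ w)) (sym (testWord-drop off c α w)) (testWord-splits (off + c) w)
    where
    S = shiftX off (canonical α)
    M = testWord off ((c , α) ∷ w)
    nc : Splits M c
    nc i j i< j< e i<c with j <? c
    ... | yes j<c = j<c
    ... | no j≮c = ⊥-elim (<-irrefl refl (<-≤-trans xi< (subst (off + c ≤_) (sym (trans e xj)) low)))
      where
      i<S : i < length S
      i<S = subst (i <_) (sym (length-shiftCanonical off α)) i<c
      xi : X[ M ] i ≡ Cycles.leader α i + off
      xi = trans (X-++ˡ S (testWord (off + c) w) i i<S) (trans (X-shiftX off (canonical α) i (subst (i <_) (sym (length-canonical α)) i<c)) (cong (_+ off) (xWord-canonical α i i<c)))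
      xi< : X[ M ] i < off + c
      xi< = subst (_< off + c) (sym xi) (subst (Cycles.leader α i + off <_) (+-comm c off) (+-monoˡ-< off (Cycles.leader< α i i<c)))
      je : length S + (j ∸ c) ≡ j
      je = trans (cong (_+ (j ∸ c)) (length-shiftCanonical off α)) (m+[n∸m]≡n (≮⇒≥ j≮c))
      xj : X[ M ] j ≡ X[ testWord (off + c) w ] (j ∸ c)
      xj = trans (cong X[ M ] (sym je)) (X-++ʳ S (testWord (off + c) w) (j ∸ c))
      j′< : j ∸ c < length (testWord (off + c) w)
      j′< = +-cancelˡ-< (length S) (j ∸ c) (length (testWord (off + c) w)) (subst₂ _<_ (sym je) (length-++ S) j<)
      low : off + c ≤ X[ testWord (off + c) w ] (j ∸ c)
      low = testWord-X≥ (off + c) w (j ∸ c) j′<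

  testWord-separates : ∀ w w′ → All (λ q → Connected (proj₂ q)) w → All (λ q → Connected (proj₂ q)) w′ →
    T (Factors w′ (testWord 0 w)) → length w′ ≤ length w → w′ ≡ w
  testWord-separates w w′ cw cw′ h le = Factors-unique w′ w (testWord 0 w) h (testWord-factors 0 w) (proj₂ k (sym lw≡))
    where
    k = connectedFactors-refine w′ (map proj₁ w) (testWord 0 w) (testWord-splits 0 w) (connected-sizes-pos w cw) (sym (length-testWord 0 w)) h cw′
    lmap : length (map proj₁ w) ≡ length w
    lmap = length-map proj₁ w
    lw≡ : length w′ ≡ length (map proj₁ w)
    lw≡ = trans (≤-antisym le (subst (_≤ length w′) lmap (proj₁ k))) (sym lmap)

  ν : Monomial → AnyPerm
  ν m = length m , stdPerm m

  phiCondₚ : AnyPerm → Monomial → Bool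
  phiCondₚ p m = phiCond (proj₂ p) (xWord m) (aWord m)

  phiCondₚ⇒≡ν : ∀ p m → T (phiCondₚ p m) → p ≡ ν m
  phiCondₚ⇒≡ν (n , σ) m h = AnyPerm-≡ σ (stdPerm m) (sym (proj₁ (phiCond⇒stdCycle σ m h))) (proj₂ (phiCond⇒stdCycle σ m h))

  phiCondₚ-ν : ∀ m → T (phiCondₚ (ν m) m)
  phiCondₚ-ν m = stdCycle⇒phiCond (stdPerm m) m refl refl

  Factors⇔PermFactors : ∀ w m → Factors w m ≡ (length m ≡ᵇ sum (map proj₁ w)) ∧ PermFactors w (imagesOf (ν m))
  Factors⇔PermFactors w m = T-injective
    (λ h → T-∧⁺ (≡⇒≡ᵇ _ _ (Factors-length w m h)) (Factors⇒PermFactors w m h))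
    (λ h → PermFactors⇒Factors w m (T-∧⁻ʳ {length m ≡ᵇ sum (map proj₁ w)} h))

  Factors-singleton : ∀ {b} (β : Perm b) v → Factors ((b , β) ∷ []) v ≡ phiCond β (xWord v) (aWord v)
  Factors-singleton {b} β v = T-injective
    (λ h → subst (λ u → T (phiCond β (xWord u) (aWord u))) (LP.take-all b v (b≥ h)) (T-∧⁻ˡ h))
    (λ h → T-∧⁺ (subst (λ u → T (phiCond β (xWord u) (aWord u))) (sym (LP.take-all b v (≤-reflexive (proj₁ (phiCond⇒stdCycle β v h))))) h)
                (≡⇒≡ᵇ (length (drop b v)) 0 (cong length (LP.drop-all b v (≤-reflexive (proj₁ (phiCond⇒stdCycle β v h)))))))
    where
    b≥ : T (Factors ((b , β) ∷ []) v) → b ≥ length v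
    b≥ h = m∸n≡0⇒m≤n (trans (sym (length-drop b v)) (≡ᵇ⇒≡ _ 0 (T-∧⁻ʳ {phiCond β (xWord (take b v)) (aWord (take b v))} h)))

  decomposition-permFactors : ∀ {n} (σ : Perm n) → T (PermFactors (decomposition σ) (images σ))
  decomposition-permFactors σ = subst (λ l → T (PermFactors (decomposition σ) l)) (stdCycle-canonical σ)
    (Factors⇒PermFactors (decomposition σ) (canonical σ) (Decomposition.factors σ))

  length≤sum : ∀ (ns : List ℕ) → All (0 <_) ns → length ns ≤ sum ns
  length≤sum [] [] = z≤n
  length≤sum (n ∷ ns) (p ∷ ps) = +-mono-≤ p (length≤sum ns ps)

  splitAtMaximum : ∀ {a} {A : Set a} (μ : A → ℕ) (x : A) (L : List A) →
    Σ (List A) λ L₁ → Σ A λ y → Σ (List A) λ L₂ → (x ∷ L ≡ L₁ ++ y ∷ L₂) × All (λ p → μ p ≤ μ y) (x ∷ L)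
  splitAtMaximum μ x [] = [] , x , [] , refl , ≤-refl ∷ []
  splitAtMaximum μ x (x′ ∷ L) with splitAtMaximum μ x′ L
  ... | L₁ , y , L₂ , e , bounded with μ x ≤? μ y
  ...   | yes le = x ∷ L₁ , y , L₂ , cong (x ∷_) e , le ∷ bounded
  ...   | no nle = [] , x , x′ ∷ L , refl , ≤-refl ∷ All.map (λ h → ≤-trans h (<⇒≤ (≰⇒> nle))) bounded

  length-middle : ∀ {a} {A : Set a} (xs : List A) {y ys} → length (xs ++ y ∷ ys) ≡ suc (length (xs ++ ys))
  length-middle [] = refl
  length-middle (x ∷ xs) = cong suc (length-middle xs)

  All-middle : ∀ {a p} {A : Set a} {P : A → Set p} (xs : List A) {y ys} → All P (xs ++ y ∷ ys) → P y × All P (xs ++ ys)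
  All-middle [] (py ∷ a) = py , a
  All-middle (x ∷ xs) (px ∷ a) = proj₁ (All-middle xs a) , px ∷ proj₂ (All-middle xs a)

  AllPairs-middle : ∀ {a r} {A : Set a} {R : A → A → Set r} (xs : List A) {y ys} → AllPairs R (xs ++ y ∷ ys) →
    All (λ x → R x y) xs × All (R y) ys × AllPairs R (xs ++ ys)
  AllPairs-middle [] (py ∷ a) = [] , py , a
  AllPairs-middle (x ∷ xs) (px ∷ a) =
    (proj₁ (All-middle xs px) ∷ proj₁ (AllPairs-middle xs a)) , proj₁ (proj₂ (AllPairs-middle xs a)) ,
    (proj₂ (All-middle xs px) ∷ proj₂ (proj₂ (AllPairs-middle xs a)))

-- The algebra spanned by the φ_σ

module _ {c ℓ} (K : CharZeroField c ℓ) where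
  open CharZeroField K
  open Series K
  open Biwords
  open import Data.Nat as ℕ using (ℕ; suc; _<_; _≤_; _≡ᵇ_; s≤s)
  import Data.Nat.Properties as ℕₚ
  open import Data.Nat.ListAction using (sum)
  open import Data.Bool using (Bool; true; false; _∧_; if_then_else_; T)
  open import Data.List using ([]; _∷_; _++_; length; take; drop; concatMap)
  import Data.List.Properties as List
  open import Data.List.Membership.Propositional using (_∈_)
  open import Data.List.Membership.Propositional.Properties using (∈-map⁺; ∈-++⁺ˡ; ∈-++⁺ʳ)
  open import Data.List.Relation.Unary.Any using (here; there)
  open import Data.List.Relation.Unary.All using ([]; _∷_)
  import Data.List.Relation.Unary.All as All
  import Data.List.Relation.Unary.All.Properties as All
  open import Data.List.Relation.Unary.AllPairs using (AllPairs; _∷_)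
  open import Data.Empty using (⊥-elim)
  open import Relation.Nullary using (¬_; Dec; yes; no)
  open import Relation.Nullary.Decidable using (T?)
  open import Relation.Binary.PropositionalEquality as ≡ using (_≡_; _≢_; cong; subst)
  open import Relation.Binary.Reasoning.Setoid setoid
  open import Algebra.Properties.Ring ring using (-‿distribˡ-*)
  open import Algebra.Properties.AbelianGroup +-abelianGroup using (⁻¹-∙-comm)

  ind : Bool → Carrier
  ind b = if b then 1# else 0#

  ind-∧ : ∀ a b → ind a * ind b ≈ ind (a ∧ b)
  ind-∧ true b = *-identityˡ (ind b)
  ind-∧ false b = zeroˡ (ind b)

  ind-false : ∀ {b} → ¬ T b → ind b ≡ 0#
  ind-false {true} h = ⊥-elim (h _)
  ind-false {false} h = ≡.refl

  ind-true : ∀ {b} → T b → ind b ≡ 1#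
  ind-true {true} h = ≡.refl

  ≡⇒≈ : ∀ {x y} → x ≡ y → x ≈ y
  ≡⇒≈ ≡.refl = refl

  *ˢ-cons : ∀ (F G : Ser) l m → (F *ˢ G) (l ∷ m) ≡ F [] * G (l ∷ m) + ((λ u → F (l ∷ u)) *ˢ G) m
  *ˢ-cons F G l m = cong (λ t → F [] * G (l ∷ m) + sumK t) (≡.sym (List.map-∘ (splits m)))

  *ˢ-split : ∀ (F G : Ser) n → (∀ u → ¬ (length u ≡ n) → F u ≈ 0#) → ∀ m → (F *ˢ G) m ≈ F (take n m) * G (drop n m)
  *ˢ-split F G ℕ.zero F≈0 [] = +-identityʳ _
  *ˢ-split F G (suc n) F≈0 [] = +-identityʳ _
  *ˢ-split F G ℕ.zero F≈0 (l ∷ m) = begin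
    (F *ˢ G) (l ∷ m)                             ≡⟨ *ˢ-cons F G l m ⟩
    F [] * G (l ∷ m) + ((λ u → F (l ∷ u)) *ˢ G) m ≈⟨ +-congˡ (*ˢ-split (λ u → F (l ∷ u)) G ℕ.zero (λ u _ → F≈0 (l ∷ u) (λ ())) m) ⟩
    F [] * G (l ∷ m) + F (l ∷ []) * G m          ≈⟨ +-congˡ (trans (*-congʳ (F≈0 (l ∷ []) (λ ()))) (zeroˡ _)) ⟩
    F [] * G (l ∷ m) + 0#                        ≈⟨ +-identityʳ _ ⟩
    F [] * G (l ∷ m)                             ∎
  *ˢ-split F G (suc n) F≈0 (l ∷ m) = begin
    (F *ˢ G) (l ∷ m)                             ≡⟨ *ˢ-cons F G l m ⟩
    F [] * G (l ∷ m) + ((λ u → F (l ∷ u)) *ˢ G) m ≈⟨ +-congʳ (trans (*-congʳ (F≈0 [] (λ ()))) (zeroˡ _)) ⟩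
    0# + ((λ u → F (l ∷ u)) *ˢ G) m              ≈⟨ +-identityˡ _ ⟩
    ((λ u → F (l ∷ u)) *ˢ G) m                    ≈⟨ *ˢ-split (λ u → F (l ∷ u)) G n (λ u ne → F≈0 (l ∷ u) (λ e → ne (ℕₚ.suc-injective e))) m ⟩
    F (l ∷ take n m) * G (drop n m)              ∎

  φ-length : ∀ {n} (σ : Perm n) u → ¬ (length u ≡ n) → φ σ u ≈ 0#
  φ-length σ u ne = ≡⇒≈ (ind-false (λ h → ne (proj₁ (phiCond⇒stdCycle σ u h))))

  φword-Factors : ∀ w m → φword w m ≈ ind (Factors w m)
  φword-Factors [] [] = refl
  φword-Factors [] (_ ∷ _) = refl
  φword-Factors ((c , α) ∷ w) m = begin
    (φ α *ˢ φword w) m                                                          ≈⟨ *ˢ-split (φ α) (φword w) c (φ-length α) m ⟩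
    φ α (take c m) * φword w (drop c m)                                         ≈⟨ *-congˡ (φword-Factors w (drop c m)) ⟩
    ind (phiCond α (xWord (take c m)) (aWord (take c m))) * ind (Factors w (drop c m)) ≈⟨ ind-∧ _ _ ⟩
    ind (Factors ((c , α) ∷ w) m)                                               ∎

  sum-none : ∀ S m → (∀ p → p ∈ S → ¬ T (phiCondₚ p m)) → sumˢ (map φ' S) m ≈ 0#
  sum-none [] m none = refl
  sum-none (p ∷ S) m none =
    trans (+-cong (≡⇒≈ (ind-false (none p (here ≡.refl)))) (sum-none S m (λ q q∈ → none q (there q∈)))) (+-identityʳ 0#)

  sum-unique : ∀ S m → Unique S → ν m ∈ S → sumˢ (map φ' S) m ≈ 1#
  sum-unique (p ∷ S) m (p∉S ∷ _) (here ≡.refl) = trans (+-cong (≡⇒≈ (ind-true (phiCondₚ-ν m)))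
    (sum-none S m (λ q q∈ hq → All.lookup p∉S q∈ (≡.sym (phiCondₚ⇒≡ν q m hq))))) (+-identityʳ 1#)
  sum-unique (p ∷ S) m (p∉S ∷ uS) (there ν∈) = trans (+-cong (≡⇒≈ (ind-false (λ hp → All.lookup p∉S ν∈ (phiCondₚ⇒≡ν p m hp))))
    (sum-unique S m uS ν∈)) (+-identityˡ 1#)

  sum-select : ∀ N Q m → sumˢ (map φ' (select N Q)) m ≈ ind ((length m ≡ᵇ N) ∧ Q (ν m))
  sum-select N Q m = by-cases (T? ((length m ≡ᵇ N) ∧ Q (ν m)))
    where
    by-cases : Dec (T ((length m ≡ᵇ N) ∧ Q (ν m))) → sumˢ (map φ' (select N Q)) m ≈ ind ((length m ≡ᵇ N) ∧ Q (ν m))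
    by-cases (yes h) = trans (sum-unique (select N Q) m (select-unique N Q) ν∈) (≡⇒≈ (≡.sym (ind-true h)))
      where
      ν∈ : ν m ∈ select N Q
      ν∈ = select⁺ N Q (stdPerm m) (ℕₚ.≡ᵇ⇒≡ (length m) N (T-∧⁻ˡ h)) (T-∧⁻ʳ {length m ≡ᵇ N} h)
    by-cases (no ¬h) = trans (sum-none (select N Q) m misses) (≡⇒≈ (≡.sym (ind-false ¬h)))
      where
      misses : ∀ p → p ∈ select N Q → ¬ T (phiCondₚ p m)
      misses p p∈ hp = ¬h (T-∧⁺ (ℕₚ.≡⇒≡ᵇ (length m) N (≡.trans (cong proj₁ (≡.sym p≡ν)) (proj₁ selected)))
                               (subst (λ q → T (Q q)) p≡ν (proj₂ selected)))
        where
        p≡ν : p ≡ ν m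
        p≡ν = phiCondₚ⇒≡ν p m hp
        selected = select⁻ N Q p p∈

  φ-product : ∀ {a b} (α : Perm a) (β : Perm b) → Σ (List AnyPerm) (λ S → Unique S × ((φ α *ˢ φ β) ≈ˢ sumˢ (map φ' S)))
  φ-product {a} {b} α β = select N Q , select-unique N Q , λ m → begin
      (φ α *ˢ φ β) m                                                       ≈⟨ *ˢ-split (φ α) (φ β) a (φ-length α) m ⟩
      φ α (take a m) * φ β (drop a m)                                      ≈⟨ ind-∧ _ _ ⟩
      ind (phiCond α (xWord (take a m)) (aWord (take a m)) ∧ phiCond β (xWord (drop a m)) (aWord (drop a m)))
        ≡⟨ cong (λ t → ind (phiCond α (xWord (take a m)) (aWord (take a m)) ∧ t)) (≡.sym (Factors-singleton β (drop a m))) ⟩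
      ind (Factors w m)                                                    ≡⟨ cong ind (Factors⇔PermFactors w m) ⟩
      ind ((length m ≡ᵇ N) ∧ Q (ν m))                                      ≈⟨ sym (sum-select N Q m) ⟩
      sumˢ (map φ' (select N Q)) m                                          ∎
    where
    w = (a , α) ∷ (b , β) ∷ []
    N = sum (map proj₁ w)
    Q : AnyPerm → Bool
    Q p = PermFactors w (imagesOf p)

  φword-decomposition : ∀ {n} (σ : Perm n) m → φword (decomposition σ) m ≈ φ σ m + sumˢ (map φ' (otherTerms σ)) m
  φword-decomposition {n} σ m = by-cases (T? (phiCondₚ (n , σ) m))
    where
    w = decomposition σ
    by-cases : Dec (T (phiCondₚ (n , σ) m)) → φword w m ≈ φ σ m + sumˢ (map φ' (otherTerms σ)) m
    by-cases (yes h) = begin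
        φword w m                                 ≈⟨ φword-Factors w m ⟩
        ind (Factors w m)                         ≡⟨ ind-true factors ⟩
        1#                                        ≈⟨ sym (+-identityʳ 1#) ⟩
        1# + 0#                                   ≈⟨ +-cong (≡⇒≈ (≡.sym (ind-true h))) (sym (sum-none (otherTerms σ) m other-misses)) ⟩
        φ σ m + sumˢ (map φ' (otherTerms σ)) m    ∎
      where
      σ≡ν : (n , σ) ≡ ν m
      σ≡ν = phiCondₚ⇒≡ν (n , σ) m h
      factors : T (Factors w m)
      factors = PermFactors⇒Factors w m (subst (λ p → T (PermFactors w (imagesOf p))) σ≡ν (decomposition-permFactors σ))
      other-misses : ∀ p → p ∈ otherTerms σ → ¬ T (phiCondₚ p m)
      other-misses p p∈ hp = T-not⁻ (T-∧⁻ʳ {PermFactors w (imagesOf p)} (proj₂ (select⁻ n (otherTermᵇ σ) p p∈)))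
        (subst (λ q → T (listEqB (imagesOf p) (imagesOf q))) (≡.trans (phiCondₚ⇒≡ν p m hp) (≡.sym σ≡ν)) (listEqB-refl (imagesOf p)))
    by-cases (no ¬h) = begin
        φword w m                                  ≈⟨ φword-Factors w m ⟩
        ind (Factors w m)                          ≡⟨ cong ind (T-injective to from) ⟩
        ind ((length m ≡ᵇ n) ∧ otherTermᵇ σ (ν m)) ≈⟨ sym (sum-select n (otherTermᵇ σ) m) ⟩
        sumˢ (map φ' (otherTerms σ)) m             ≈⟨ sym (+-identityˡ _) ⟩
        0# + sumˢ (map φ' (otherTerms σ)) m        ≈⟨ +-congʳ (≡⇒≈ (≡.sym (ind-false ¬h))) ⟩
        φ σ m + sumˢ (map φ' (otherTerms σ)) m     ∎
      where
      to : T (Factors w m) → T ((length m ≡ᵇ n) ∧ otherTermᵇ σ (ν m))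
      to f = T-∧⁺ (ℕₚ.≡⇒≡ᵇ _ _ length-m) (T-∧⁺ (Factors⇒PermFactors w m f)
               (T-not⁺ (λ e → ¬h (stdCycle⇒phiCond σ m length-m (≡.sym (listEqB⇒≡ _ _ e))))))
        where
        length-m : length m ≡ n
        length-m = ≡.trans (Factors-length w m f) (decomposition-size σ)
      from : T ((length m ≡ᵇ n) ∧ otherTermᵇ σ (ν m)) → T (Factors w m)
      from h = PermFactors⇒Factors w m (T-∧⁻ˡ (T-∧⁻ʳ {length m ≡ᵇ n} h))

  neg : Carrier × List AnyPerm → Carrier × List AnyPerm
  neg (a , w) = (- a , w)

  -0≈0 : - 0# ≈ 0#
  -0≈0 = trans (sym (+-identityʳ (- 0#))) (-‿inverseˡ 0#)

  lincomb-++ : ∀ L₁ L₂ m → lincomb (L₁ ++ L₂) m ≈ lincomb L₁ m + lincomb L₂ m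
  lincomb-++ [] L₂ m = sym (+-identityˡ _)
  lincomb-++ ((a , w) ∷ L₁) L₂ m = trans (+-congˡ (lincomb-++ L₁ L₂ m)) (sym (+-assoc _ _ _))

  lincomb-neg : ∀ L m → lincomb (map neg L) m ≈ - lincomb L m
  lincomb-neg [] m = sym -0≈0
  lincomb-neg ((a , w) ∷ L) m = trans (+-cong (sym (-‿distribˡ-* a (φword w m))) (lincomb-neg L m)) (⁻¹-∙-comm _ _)

  lincomb-concatMap-neg : ∀ (Ts : List AnyPerm) (Lf : AnyPerm → List (Carrier × List AnyPerm)) m →
    (∀ p → p ∈ Ts → lincomb (Lf p) m ≈ φ' p m) → lincomb (concatMap (λ p → map neg (Lf p)) Ts) m ≈ - sumˢ (map φ' Ts) m
  lincomb-concatMap-neg [] Lf m h = sym -0≈0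
  lincomb-concatMap-neg (p ∷ Ts) Lf m h = begin
    lincomb (map neg (Lf p) ++ concatMap (λ p → map neg (Lf p)) Ts) m               ≈⟨ lincomb-++ (map neg (Lf p)) _ m ⟩
    lincomb (map neg (Lf p)) m + lincomb (concatMap (λ p → map neg (Lf p)) Ts) m   ≈⟨ +-cong (trans (lincomb-neg (Lf p) m) (-‿cong (h p (here ≡.refl))))
                                                                                        (lincomb-concatMap-neg Ts Lf m (λ q q∈ → h q (there q∈))) ⟩
    - φ' p m + - sumˢ (map φ' Ts) m                                                 ≈⟨ ⁻¹-∙-comm _ _ ⟩
    - (φ' p m + sumˢ (map φ' Ts) m)                                                 ∎

  lincomb-zero : ∀ L m → (∀ p → p ∈ L → φword (proj₂ p) m ≈ 0#) → lincomb L m ≈ 0#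
  lincomb-zero [] m h = refl
  lincomb-zero ((a , w) ∷ L) m h =
    trans (+-cong (trans (*-congˡ (h (a , w) (here ≡.refl))) (zeroʳ a)) (lincomb-zero L m (λ q q∈ → h q (there q∈)))) (+-identityʳ 0#)

  ConnectedWords : List (Carrier × List AnyPerm) → Set c
  ConnectedWords = All (λ p → All (λ q → Connected (proj₂ q)) (proj₂ p))

  -- φ_σ = φ_{decomposition σ} − Σ φ_τ over the other terms, expanded recursively; the fuel only has to exceed
  -- the number of connected components, which decreases along the recursion.
  expansion : ℕ → ∀ {n} → Perm n → List (Carrier × List AnyPerm)
  expansion ℕ.zero σ = []
  expansion (suc f) σ = (1# , decomposition σ) ∷ concatMap (λ p → map neg (expansion f (proj₂ p))) (otherTerms σ)

  expansion-connected : ∀ f {n} (σ : Perm n) → ConnectedWords (expansion f σ)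
  expansion-connected ℕ.zero σ = []
  expansion-connected (suc f) σ = Decomposition.connected σ ∷ others (otherTerms σ)
    where
    neg-connected : ∀ L → ConnectedWords L → ConnectedWords (map neg L)
    neg-connected [] [] = []
    neg-connected (x ∷ L) (h ∷ hs) = h ∷ neg-connected L hs
    others : ∀ S → ConnectedWords (concatMap (λ p → map neg (expansion f (proj₂ p))) S)
    others [] = []
    others (p ∷ S) = All.++⁺ (neg-connected (expansion f (proj₂ p)) (expansion-connected f (proj₂ p))) (others S)

  expansion-correct : ∀ f {n} (σ : Perm n) → length (decomposition σ) ≤ f → φ σ ≈ˢ lincomb (expansion (suc f) σ)
  expansion-correct f {n} σ le m = begin
      φ σ m                                    ≈⟨ sym (+-identityʳ _) ⟩
      φ σ m + 0#                               ≈⟨ +-congˡ (sym (-‿inverseʳ S)) ⟩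
      φ σ m + (S + - S)                        ≈⟨ sym (+-assoc _ _ _) ⟩
      (φ σ m + S) + - S                        ≈⟨ +-congʳ (sym (φword-decomposition σ m)) ⟩
      φword (decomposition σ) m + - S          ≈⟨ +-cong (sym (*-identityˡ _)) (sym (lincomb-concatMap-neg (otherTerms σ) (λ p → expansion f (proj₂ p)) m others)) ⟩
      1# * φword (decomposition σ) m + lincomb (concatMap (λ p → map neg (expansion f (proj₂ p))) (otherTerms σ)) m ∎
    where
    S = sumˢ (map φ' (otherTerms σ)) m
    others : ∀ p → p ∈ otherTerms σ → lincomb (expansion f (proj₂ p)) m ≈ φ' p m
    others p p∈ = recurse f le
      where
      fewer = otherTerms-fewerComponents σ p p∈
      recurse : ∀ f → length (decomposition σ) ≤ f → lincomb (expansion f (proj₂ p)) m ≈ φ' p m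
      recurse ℕ.zero le₀ = ⊥-elim (ℕₚ.n≮0 (ℕₚ.<-≤-trans fewer le₀))
      recurse (suc f′) le′ = sym (expansion-correct f′ (proj₂ p) (ℕₚ.<⇒≤pred (ℕₚ.<-≤-trans fewer le′)) m)

  φ-generated : ∀ {n} (σ : Perm n) → Σ (List (Carrier × List AnyPerm)) (λ L → ConnectedWords L × (φ σ ≈ˢ lincomb L))
  φ-generated {n} σ = expansion (suc n) σ , expansion-connected (suc n) σ , expansion-correct n σ components≤n
    where
    components≤n : length (decomposition σ) ≤ n
    components≤n = ≡.subst₂ _≤_ (List.length-map proj₁ (decomposition σ)) (decomposition-size σ)
      (length≤sum (map proj₁ (decomposition σ)) (connected-sizes-pos _ (Decomposition.connected σ)))

  lincomb-middle : ∀ L₁ y L₂ m → lincomb L₁ m ≈ 0# → lincomb L₂ m ≈ 0# → lincomb (L₁ ++ y ∷ L₂) m ≈ proj₁ y * φword (proj₂ y) m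
  lincomb-middle L₁ y L₂ m z₁ z₂ = begin
    lincomb (L₁ ++ y ∷ L₂) m                                         ≈⟨ lincomb-++ L₁ (y ∷ L₂) m ⟩
    lincomb L₁ m + (proj₁ y * φword (proj₂ y) m + lincomb L₂ m)      ≈⟨ +-cong z₁ (+-congˡ z₂) ⟩
    0# + (proj₁ y * φword (proj₂ y) m + 0#)                          ≈⟨ trans (+-identityˡ _) (+-identityʳ _) ⟩
    proj₁ y * φword (proj₂ y) m                                      ∎

  lincomb-dropMiddle : ∀ L₁ y L₂ → proj₁ y ≈ 0# → lincomb (L₁ ++ y ∷ L₂) ≈ˢ lincomb (L₁ ++ L₂)
  lincomb-dropMiddle L₁ y L₂ y≈0 m = begin
    lincomb (L₁ ++ y ∷ L₂) m                                         ≈⟨ lincomb-++ L₁ (y ∷ L₂) m ⟩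
    lincomb L₁ m + (proj₁ y * φword (proj₂ y) m + lincomb L₂ m)      ≈⟨ +-congˡ (+-congʳ (trans (*-congʳ y≈0) (zeroˡ _))) ⟩
    lincomb L₁ m + (0# + lincomb L₂ m)                               ≈⟨ +-congˡ (+-identityˡ _) ⟩
    lincomb L₁ m + lincomb L₂ m                                      ≈⟨ sym (lincomb-++ L₁ L₂ m) ⟩
    lincomb (L₁ ++ L₂) m                                             ∎

  -- At the test biword of w, a word in connected permutations is nonzero only if its blocks refine those of w,
  -- so among the words of length at most |w| only w itself survives.
  longest-coefficient≈0 : ∀ L₁ y L₂ → ConnectedWords (L₁ ++ y ∷ L₂) → Unique (map proj₂ (L₁ ++ y ∷ L₂)) →
    All (λ p → length (proj₂ p) ≤ length (proj₂ y)) (L₁ ++ y ∷ L₂) → lincomb (L₁ ++ y ∷ L₂) ≈ˢ 0ˢ → proj₁ y ≈ 0#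
  longest-coefficient≈0 L₁ y L₂ connected unique longest L≈0 = begin
    proj₁ y                                  ≈⟨ sym (*-identityʳ _) ⟩
    proj₁ y * 1#                             ≈⟨ *-congˡ (sym (trans (φword-Factors (proj₂ y) m₀) (≡⇒≈ (ind-true (testWord-factors 0 (proj₂ y)))))) ⟩
    proj₁ y * φword (proj₂ y) m₀             ≈⟨ sym (lincomb-middle L₁ y L₂ m₀
                                                   (lincomb-zero L₁ m₀ (λ p p∈ → vanishes p (∈-++⁺ˡ p∈) (≢-before p p∈)))
                                                   (lincomb-zero L₂ m₀ (λ p p∈ → vanishes p (∈-++⁺ʳ L₁ p∈) (≢-after p p∈)))) ⟩
    lincomb (L₁ ++ y ∷ L₂) m₀                ≈⟨ L≈0 m₀ ⟩
    0#                                       ∎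
    where
    m₀ = testWord 0 (proj₂ y)
    split-unique = AllPairs-middle (map proj₂ L₁)
      (subst (AllPairs _) (List.map-++ proj₂ L₁ (y ∷ L₂)) unique)
    vanishes : ∀ p → p ∈ L₁ ++ L₂ → proj₂ p ≢ proj₂ y → φword (proj₂ p) m₀ ≈ 0#
    vanishes p p∈ ne = trans (φword-Factors (proj₂ p) m₀) (≡⇒≈ (ind-false (λ h → ne
      (testWord-separates (proj₂ y) (proj₂ p) (proj₁ (All-middle L₁ connected)) (All.lookup (proj₂ (All-middle L₁ connected)) p∈) h
        (All.lookup (proj₂ (All-middle L₁ longest)) p∈)))))
    ≢-before : ∀ p → p ∈ L₁ → proj₂ p ≢ proj₂ y
    ≢-before p p∈ = All.lookup (proj₁ split-unique) (∈-map⁺ proj₂ p∈)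
    ≢-after : ∀ p → p ∈ L₂ → proj₂ p ≢ proj₂ y
    ≢-after p p∈ e = All.lookup (proj₁ (proj₂ split-unique)) (∈-map⁺ proj₂ p∈) (≡.sym e)

  independent-fuel : ∀ f L → length L ≤ f → ConnectedWords L → Unique (map proj₂ L) → lincomb L ≈ˢ 0ˢ → All (λ p → proj₁ p ≈ 0#) L
  independent-fuel f [] _ _ _ _ = []
  independent-fuel (suc f) (x ∷ L) (s≤s le) connected unique L≈0 with splitAtMaximum (λ p → length (proj₂ p)) x L
  ... | L₁ , y , L₂ , split , longest =
    subst (All _) (≡.sym split) (All.++⁺ (All.++⁻ˡ L₁ rest≈0) (y≈0 ∷ All.++⁻ʳ L₁ rest≈0))
    where
    connected′ = subst ConnectedWords split connected
    unique′ : AllPairs _ (map proj₂ L₁ ++ proj₂ y ∷ map proj₂ L₂)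
    unique′ = subst (AllPairs _) (≡.trans (cong (map proj₂) split) (List.map-++ proj₂ L₁ (y ∷ L₂))) unique
    L≈0′ : lincomb (L₁ ++ y ∷ L₂) ≈ˢ 0ˢ
    L≈0′ m = subst (λ l → lincomb l m ≈ 0#) split (L≈0 m)
    y≈0 : proj₁ y ≈ 0#
    y≈0 = longest-coefficient≈0 L₁ y L₂ connected′ (subst (AllPairs _) (≡.sym (List.map-++ proj₂ L₁ (y ∷ L₂))) unique′)
      (subst (All _) split longest) L≈0′
    shorter : length (L₁ ++ L₂) ≤ f
    shorter = subst (_≤ f) (ℕₚ.suc-injective (≡.trans (cong length split) (length-middle L₁))) le
    rest≈0 : All (λ p → proj₁ p ≈ 0#) (L₁ ++ L₂)
    rest≈0 = independent-fuel f (L₁ ++ L₂) shorter (proj₂ (All-middle L₁ connected′))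
      (subst (AllPairs _) (≡.sym (List.map-++ proj₂ L₁ L₂)) (proj₂ (proj₂ (AllPairs-middle (map proj₂ L₁) unique′))))
      (λ m → trans (sym (lincomb-dropMiddle L₁ y L₂ y≈0 m)) (L≈0′ m))

  φ-words-independent : ∀ L → ConnectedWords L → Unique (map proj₂ L) → lincomb L ≈ˢ 0ˢ → All (λ p → proj₁ p ≈ 0#) L
  φ-words-independent L = independent-fuel (length L) L ℕₚ.≤-refl

mainTheorem6 : ∀ {c ℓ} (K : CharZeroField c ℓ) →
  let open CharZeroField K
      open Series K
  in
  -- φ_α φ_β = Σ_σ g^σ_{α,β} φ_σ with g ∈ {0,1}: a sum of distinct φ_σ
  (∀ {m k} (α : Perm m) (β : Perm k) →
     Σ (List AnyPerm) (λ S → Unique S × ((φ α *ˢ φ β) ≈ˢ sumˢ (map φ' S))))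
  -- freeness over {φ_α | α connected}: (1) the φ_α, α connected, generate ΦSym
  × (∀ {n} (σ : Perm n) →
     Σ (List (Carrier × List AnyPerm)) (λ L →
       All (λ p → All (λ q → Connected (proj₂ q)) (proj₂ p)) L × (φ σ ≈ˢ lincomb L)))
  -- (2) distinct words in the φ_α, α connected, are linearly independent
  × (∀ (L : List (Carrier × List AnyPerm)) →
     All (λ p → All (λ q → Connected (proj₂ q)) (proj₂ p)) L →
     Unique (map proj₂ L) →
     lincomb L ≈ˢ 0ˢ →
     All (λ p → proj₁ p ≈ 0#) L)
mainTheorem6 K = φ-product K , φ-generated K , φ-words-independent K
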